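{- Let $G$ be a finite simple graph on $[d]$. Then for every integer $k\ge0$, \[H(R[G]/K_G,k)=\sum_{G'\in{\rm Ind}(G)}{\rm Kc}(G',k),\] and in particular \[{\rm Kc}(G,k)=\sum_{m=0}^d(-1)^{d-m}\sum_{G'\in{\rm Ind}_m(G)}H(R[G']/K_{G'},k).\]
   Context: $G$ is a simple graph on $[d]$, $\mathbb{K}$ a field. For a graph $H$ on a finite vertex set $W$: its stable sets are subsets of $W$ with no edge (including $\emptyset$ and singletons), $S(H)$ is their set, $R[H]=\mathbb{K}[x_S:S\in S(H)]$ with all $\deg x_S=1$; for a $k$-coloring $f$ of an induced subgraph of $H$ (a map to $[k]$ with adjacent vertices colored differently), ${\mathbf x}_f=\prod_{\ell=1}^kx_{f^{ -1}(\ell)}$; $J_H$ is the ideal generated by all ${\mathbf x}_f-{\mathbf x}_g$ with $f,g$ $2$-colorings of the same induced subgraph of $H$; $M_H=\langle x_Sx_T:S,T\in S(H),S\cap T\ne\emptyset\rangle$; $K_H=J_H+M_H$. Kempe switching: for a $k$-coloring $f$ of $H$, colors $i<j$, and a connected component $C$ of $H[f^{ -1}(i)\cup f^{ -1}(j)]$, exchange colors $i,j$ on $C$; Kempe equivalence $\sim_k$ on the set of $k$-colorings of $H$ is reachability by finitely many Kempe switchings, with colorings differing by a permutation of colors identified; ${\rm Kc}(H,k)$ is the number of equivalence classes (0 if $H$ has no $k$-coloring; the graph with no vertices has exactly one coloring). ${\rm Ind}(G)$ is the set of induced subgraphs $G[W]$, $W\subseteq[d]$ (so $|{\rm Ind}(G)|=2^d$),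 and ${\rm Ind}_m(G)$ those with $|W|=m$. For a graded ideal $I$ of a graded polynomial ring $R$, the Hilbert function is $H(R/I,k)=\dim_{\mathbb{K}}R_k/I_k$. -}

module Defs where

open import Level using (Level; _⊔_)
open import Algebra.Bundles using (CommutativeRing)
open import Data.Nat as ℕ using (ℕ; zero; suc; _≡ᵇ_)
open import Data.Integer as ℤ using (ℤ; +_)
open import Data.Bool using (Bool; true; false; if_then_else_; _∧_)
open import Data.Fin using (Fin)
import Data.Fin as Fin
open import Data.Fin.Subset using (Subset; _∈_; _⊆_; _∩_; Nonempty; ⊤; ∣_∣; inside; outside)
open import Data.Fin.Subset.Properties using (_∈?_)
open import Data.Fin.Permutation using (Permutation′; _⟨$⟩ʳ_)
open import Data.List as List using (List; []; _∷_; _++_; map; concatMap; filter; length; upTo; foldr)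
open import Data.List.Relation.Unary.All using (All)
open import Data.Vec using (Vec; tabulate)
open import Data.Vec.Properties using (≡-dec)
import Data.Bool.Properties as BoolP
open import Data.Product using (Σ; ∃; _×_; _,_; proj₁; proj₂)
open import Data.Sum using (_⊎_)
open import Relation.Nullary using (¬_; Dec; yes; no; does)
open import Relation.Binary.PropositionalEquality using (_≡_; _≢_)
open import Relation.Binary.Construct.Closure.Equivalence using (EqClosure)

record Field (c ℓ : Level) : Set (Level.suc (c ⊔ ℓ)) where
  field
    commutativeRing : CommutativeRing c ℓ
  open CommutativeRing commutativeRing public
  field
    0≉1     : ¬ (0# ≈ 1#)
    inverse : ∀ x → ¬ (x ≈ 0#) → ∃ λ y → (x * y) ≈ 1#

record Graph (d : ℕ) : Set₁ where
  field
    Adj     : Fin d → Fin d → Set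
    sym     : ∀ {u v} → Adj u v → Adj v u
    irrefl  : ∀ {u} → ¬ Adj u u
open Graph public

-- Throughout, the induced subgraph G[W] (W ⊆ [d]) is handled through the
-- pair (G , W): its vertices are the elements of W and its edges are the
-- edges of G between elements of W.

Stable : ∀ {d} → Graph d → Subset d → Subset d → Set
Stable G W S = S ⊆ W × (∀ {u v} → u ∈ S → v ∈ S → ¬ Adj G u v)

ColMap : ∀ {d} → Subset d → ℕ → Set
ColMap {d} W k = (v : Fin d) → v ∈ W → Fin k

Proper : ∀ {d} → Graph d → (W : Subset d) → (k : ℕ) → ColMap W k → Set
Proper {d} G W k f = ∀ (u v : Fin d) (pu : u ∈ W) (pv : v ∈ W) → Adj G u v → f u pu ≢ f v pv

Coloring : ∀ {d} → Graph d → Subset d → ℕ → Set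
Coloring G W k = Σ (ColMap W k) (Proper G W k)

preimage : ∀ {d k} (W : Subset d) → ColMap W k → Fin k → Subset d
preimage {d} W f ℓ = tabulate λ v → at v (v ∈? W)
  where
  at : (v : Fin d) → Dec (v ∈ W) → Bool
  at v (yes p) = does (f v p Fin.≟ ℓ)
  at v (no _)  = false

module _ {d : ℕ} (G : Graph d) (W : Subset d) (k : ℕ) where

  InIJ : ColMap W k → Fin k → Fin k → Fin d → Set
  InIJ f i j u = Σ (u ∈ W) λ p → f u p ≡ i ⊎ f u p ≡ j

  -- u lies in the connected component of v in G[W][f⁻¹(i) ∪ f⁻¹(j)]
  data Path (f : ColMap W k) (i j : Fin k) (v : Fin d) : Fin d → Set where
    here : InIJ f i j v → Path f i j v v
    step : ∀ {u w} → Path f i j v u → Adj G u w → InIJ f i j w → Path f i j v w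

  swapCol : Fin k → Fin k → Fin k → Fin k
  swapCol i j x with x Fin.≟ i | x Fin.≟ j
  ... | yes _ | _     = j
  ... | no _  | yes _ = i
  ... | no _  | no _  = x

  KempeSwitch : Coloring G W k → Coloring G W k → Set
  KempeSwitch (f , _) (g , _) =
    Σ (Fin k) λ i → Σ (Fin k) λ j → Fin._<_ i j × Σ (Fin d) λ v → InIJ f i j v ×
      (∀ u (p : u ∈ W) →
          (Path f i j v u → g u p ≡ swapCol i j (f u p))
        × (¬ Path f i j v u → g u p ≡ f u p))

  ColorPerm : Coloring G W k → Coloring G W k → Set
  ColorPerm (f , _) (g , _) =
    Σ (Permutation′ k) λ σ → ∀ u (p : u ∈ W) → g u p ≡ σ ⟨$⟩ʳ f u p

  SameMap : Coloring G W k → Coloring G W k → Set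
  SameMap (f , _) (g , _) = ∀ u (p q : u ∈ W) → f u p ≡ g u q

  data KempeStep (f g : Coloring G W k) : Set where
    switch : KempeSwitch f g → KempeStep f g
    perm   : ColorPerm f g → KempeStep f g
    same   : SameMap f g → KempeStep f g

  KempeEq : Coloring G W k → Coloring G W k → Set
  KempeEq = EqClosure KempeStep

  KcIs : ℕ → Set
  KcIs n = Σ (Fin n → Coloring G W k) λ rep →
      (∀ a b → KempeEq (rep a) (rep b) → a ≡ b)
    × (∀ f → ∃ λ a → KempeEq f (rep a))

-- Polynomials over a field in variables x_S (S ⊆ [d]).
-- A monomial is a list of variables (a product, order irrelevant), a
-- polynomial a formal sum of terms; equality is coefficientwise.

module PolyRing {c ℓ : Level} (F : Field c ℓ) {d : ℕ} (G : Graph d) where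
  open Field F

  Mon : Set
  Mon = List (Subset d)

  Poly : Set c
  Poly = List (Carrier × Mon)

  _≟S_ : (S T : Subset d) → Dec (S ≡ T)
  _≟S_ = ≡-dec BoolP._≟_

  count : Subset d → Mon → ℕ
  count S m = length (filter (λ T → T ≟S S) m)

  sameMon : Mon → Mon → Bool
  sameMon m m' = foldr (λ S b → (count S m ≡ᵇ count S m') ∧ b) true (m ++ m')

  coeff : Poly → Mon → Carrier
  coeff [] m = 0#
  coeff ((a , m') ∷ p) m = if sameMon m' m then a + coeff p m else coeff p m

  _≈P_ : Poly → Poly → Set ℓ
  p ≈P q = ∀ m → coeff p m ≈ coeff q m

  _+P_ : Poly → Poly → Poly
  p +P q = p ++ q

  -P_ : Poly → Poly
  -P_ = map (λ t → (- proj₁ t) , proj₂ t)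

  _-P_ : Poly → Poly → Poly
  p -P q = p +P (-P q)

  _*P_ : Poly → Poly → Poly
  p *P q = concatMap (λ t → map (λ s → (proj₁ t * proj₁ s) , (proj₂ t ++ proj₂ s)) q) p

  _·P_ : Carrier → Poly → Poly
  a ·P p = map (λ t → (a * proj₁ t) , proj₂ t) p

  0P : Poly
  0P = []

  monomial : Mon → Poly
  monomial m = (1# , m) ∷ []

  sumP : List Poly → Poly
  sumP = foldr _+P_ 0P

  -- p ∈ R[G[W]] : only variables x_S with S stable in G[W] occur
  InR : Subset d → Poly → Set c
  InR W p = All (λ t → All (Stable G W) (proj₂ t)) p

  Homog : ℕ → Poly → Set c
  Homog k p = All (λ t → length (proj₂ t) ≡ k) p

  xf : ∀ {U : Subset d} → ColMap U 2 → Mon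
  xf {U} f = preimage U f Fin.zero ∷ preimage U f (Fin.suc Fin.zero) ∷ []

  -- generators of K_{G[W]} = J_{G[W]} + M_{G[W]}
  data Gen (W : Subset d) : Poly → Set c where
    jgen : (U : Subset d) → U ⊆ W → (f g : Coloring G U 2) →
           Gen W (monomial (xf (proj₁ f)) -P monomial (xf (proj₁ g)))
    mgen : (S T : Subset d) → Stable G W S → Stable G W T → Nonempty (S ∩ T) →
           Gen W (monomial (S ∷ T ∷ []))

  InK : Subset d → Poly → Set (c ⊔ ℓ)
  InK W p = Σ (List (Poly × Poly)) λ rs →
      All (λ rg → InR W (proj₁ rg) × Gen W (proj₂ rg)) rs
    × p ≈P sumP (map (λ rg → proj₁ rg *P proj₂ rg) rs)

  lincomb : ∀ {n} → (Fin n → Carrier) → (Fin n → Poly) → Poly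
  lincomb {n} a b = sumP (map (λ i → a i ·P b i) (List.allFin n))

  -- H(R[G[W]]/K_{G[W]}, k) = n : the K-vector space R_k/(K_{G[W]})_k has
  -- a basis of n elements (images of b 0, …, b (n-1) ∈ R_k)
  HilbertIs : Subset d → ℕ → ℕ → Set (c ⊔ ℓ)
  HilbertIs W k n = Σ (Fin n → Poly) λ b →
      (∀ i → InR W (b i) × Homog k (b i))
    × (∀ (a : Fin n → Carrier) → InK W (lincomb a b) → ∀ i → a i ≈ 0#)
    × (∀ p → InR W p → Homog k p → ∃ λ (a : Fin n → Carrier) → InK W (p -P lincomb a b))

allSubsets : (n : ℕ) → List (Subset n)
allSubsets zero = Data.Vec.[] ∷ []
allSubsets (suc n) = map (inside Data.Vec.∷_) (allSubsets n) ++ map (outside Data.Vec.∷_) (allSubsets n)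

subsetsOfSize : (n m : ℕ) → List (Subset n)
subsetsOfSize n m = filter (λ W → ∣ W ∣ ℕ.≟ m) (allSubsets n)

sumℕ : List ℕ → ℕ
sumℕ = foldr ℕ._+_ 0

sumℤ : List ℤ → ℤ
sumℤ = foldr ℤ._+_ (+ 0)

altSum : (d : ℕ) → (Subset d → ℕ) → ℤ
altSum d h = sumℤ (map (λ m → ((ℤ.- (+ 1)) ℤ.^ (d ℕ.∸ m)) ℤ.* (+ sumℕ (map h (subsetsOfSize d m)))) (upTo (suc d)))

-- Modulo M_G a product x_{S₁} ⋯ x_{S_k} of k variables survives only when the stable sets S_i are
-- pairwise disjoint, i.e. when it is x_f for a k-coloring f of the induced subgraph on S₁ ∪ ⋯ ∪ S_k,
-- up to renaming colors; and the multiples of the binomials of J_G identify x_f and x_g exactly when f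
-- and g are related by Kempe switchings.  So the monomials x_f, one for each Kempe class of each
-- induced subgraph, span (R[G]/K_G)_k, and they are independent because the functionals reading off
-- the Kempe class of a monomial vanish on K_G.  Counting this basis for every G[W] gives the Hilbert
-- function, and Möbius inversion over the subsets W gives Kc(G, k).
-- Kempe classes, and the linear algebra over an arbitrary field, are only classically computable; those
-- steps run in the double-negation monad, which is enough since every conclusion drawn is decidable.

module Submission where

open import Level using (Level)
open import Data.Bool using (Bool)
open import Data.Nat using (ℕ)
open import Data.Fin.Subset using (Subset)
open import Data.List.Relation.Unary.All using (All)
open import Relation.Binary.PropositionalEquality using (_≡_)
open import Defs renaming (sym to adj-sym)

module Classical where

  open import Level using (Level)
  open import Function using (_∘_)
  open import Data.Nat as ℕ using (ℕ; zero; suc)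
  import Data.Nat.Properties as ℕ
  open import Data.Fin as Fin using (Fin)
  import Data.Fin.Properties as Fin
  open import Data.Fin.Subset using (Subset; inside; outside)
  open import Data.Vec using ([]; _∷_)
  open import Data.List as List using (List; []; _∷_)
  open import Data.List.Relation.Unary.Any using (here; there)
  import Data.List.Membership.Propositional as List
  open import Data.Product using (Σ; ∃; _×_; _,_; proj₁; proj₂)
  open import Relation.Nullary using (¬_; Dec; yes; no; contradiction)
  open import Relation.Nullary.Decidable using (¬¬-excluded-middle)
  open import Relation.Binary using (Rel; IsEquivalence)
  open import Relation.Binary.PropositionalEquality

  private
    variable
      a p : Level
      A B : Set a

  infixl 1 _>>=_

  _>>=_ : ¬ ¬ A → (A → ¬ ¬ B) → ¬ ¬ B
  (m >>= f) ¬b = m λ x → f x ¬b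

  return : A → ¬ ¬ A
  return x ¬x = ¬x x

  ¬¬-Π-Fin : ∀ n {P : Fin n → Set p} → (∀ i → ¬ ¬ P i) → ¬ ¬ (∀ i → P i)
  ¬¬-Π-Fin zero    h = return λ ()
  ¬¬-Π-Fin (suc n) h = do
    p₀ ← h Fin.zero
    ps ← ¬¬-Π-Fin n (h ∘ Fin.suc)
    return λ { Fin.zero → p₀ ; (Fin.suc i) → ps i }

  ¬¬-Π-Subset : ∀ d {P : Subset d → Set p} → (∀ W → ¬ ¬ P W) → ¬ ¬ (∀ W → P W)
  ¬¬-Π-Subset zero    h = do
    p₀ ← h []
    return λ { [] → p₀ }
  ¬¬-Π-Subset (suc d) h = do
    ins  ← ¬¬-Π-Subset d (h ∘ (inside ∷_))
    outs ← ¬¬-Π-Subset d (h ∘ (outside ∷_))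
    return λ { (inside ∷ W) → ins W ; (outside ∷ W) → outs W }


  module _ {a ℓ : Level} {A : Set a} {_~_ : Rel A ℓ} (isEquivalence : IsEquivalence _~_) where

    open IsEquivalence isEquivalence renaming (refl to ~-refl; sym to ~-sym; trans to ~-trans)

    Representatives : List A → Set _
    Representatives L = Σ ℕ λ n → Σ (Fin n → A) λ rep → (∀ i j → rep i ~ rep j → i ≡ j) × (∀ {x} → x List.∈ L → ∃ λ i → x ~ rep i)

    ¬¬-representatives : ∀ L → ¬ ¬ Representatives L
    ¬¬-representatives []      = return (0 , (λ ()) , (λ ()) , λ ())
    ¬¬-representatives (x ∷ L) = do
      (n , rep , rep-injective , covers) ← ¬¬-representatives L
      x-covered? ← ¬¬-excluded-middle {A = ∃ λ i → x ~ rep i}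
      return (extend n rep rep-injective covers x-covered?)
      where
      extend : ∀ n (rep : Fin n → A) → (∀ i j → rep i ~ rep j → i ≡ j) → (∀ {y} → y List.∈ L → ∃ λ i → y ~ rep i) →
               Dec (∃ λ i → x ~ rep i) → Representatives (x ∷ L)
      extend n rep rep-injective covers (yes x~rep) = n , rep , rep-injective , λ
        { (here refl) → x~rep
        ; (there y∈L) → covers y∈L }
      extend n rep rep-injective covers (no x≁rep) = suc n , rep′ , rep′-injective , λ
        { (here refl) → Fin.zero , ~-refl
        ; (there y∈L) → let i , y~rep = covers y∈L in Fin.suc i , y~rep }
        where
        rep′ : Fin (suc n) → A
        rep′ Fin.zero    = x
        rep′ (Fin.suc i) = rep i
        rep′-injective : ∀ i j → rep′ i ~ rep′ j → i ≡ j
        rep′-injective Fin.zero    Fin.zero    _ = refl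
        rep′-injective Fin.zero    (Fin.suc j) x~repj = contradiction (j , x~repj) x≁rep
        rep′-injective (Fin.suc i) Fin.zero    repi~x = contradiction (i , ~-sym repi~x) x≁rep
        rep′-injective (Fin.suc i) (Fin.suc j) repi~repj = cong Fin.suc (rep-injective i j repi~repj)

    inequivalent⇒≤ : ∀ {m n} (rep : Fin m → A) (rep′ : Fin n → A) → (∀ i j → rep i ~ rep j → i ≡ j) →
                             (∀ i → ∃ λ j → rep i ~ rep′ j) → m ℕ.≤ n
    inequivalent⇒≤ {m} {n} rep rep′ rep-injective covered with m ℕ.≤? n
    ... | yes m≤n = m≤n
    ... | no m≰n with Fin.pigeonhole (ℕ.≰⇒> m≰n) (proj₁ ∘ covered)
    ...   | i , j , i<j , j≡ = contradiction (rep-injective i j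
              (~-trans (proj₂ (covered i)) (~-trans (reflexive (cong rep′ j≡)) (~-sym (proj₂ (covered j)))))) (Fin.<⇒≢ i<j)

  ¬¬-select : ∀ {a p} {A : Set a} {P : A → Set p} (L : List A) →
              ¬ ¬ Σ (List (Σ A P)) λ L′ → ∀ {x} → x List.∈ L → P x → ∃ λ px → (x , px) List.∈ L′
  ¬¬-select []      = return ([] , λ ())
  ¬¬-select {P = P} (x ∷ L) = do
    (L′ , selected) ← ¬¬-select L
    Px? ← ¬¬-excluded-middle {A = P x}
    return (extend L′ selected Px?)
    where
    extend : ∀ L′ → (∀ {y} → y List.∈ L → P y → ∃ λ py → (y , py) List.∈ L′) → Dec (P x) →
             Σ (List (Σ _ P)) λ L″ → ∀ {y} → y List.∈ x ∷ L → P y → ∃ λ py → (y , py) List.∈ L″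
    extend L′ selected (yes px) = (x , px) ∷ L′ , λ
      { (here refl) _  → px , here refl
      ; (there y∈L) py → let py′ , y∈L′ = selected y∈L py in py′ , there y∈L′ }
    extend L′ selected (no ¬px) = L′ , λ
      { (here refl) px → contradiction px ¬px
      ; (there y∈L) py → selected y∈L py }

module Multisets where

  open import Function using (_∘_)
  open import Data.Nat as ℕ using (ℕ; zero; suc; _+_)
  import Data.Nat.Properties as ℕ
  open import Data.Bool using (Bool; true; false)
  import Data.Bool.Properties as Bool
  open import Data.Fin as Fin using (Fin)
  open import Data.Fin.Subset using (Subset)
  open import Data.Fin.Permutation as Perm using (Permutation′; _⟨$⟩ʳ_; _⟨$⟩ˡ_; _∘ₚ_)
  import Data.Vec.Properties as Vec
  open import Data.List as List using (List; []; _∷_; _++_; length; filter; tabulate)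
  import Data.List.Properties as List
  open import Data.Product using (Σ; ∃; _,_; proj₁; proj₂)
  open import Relation.Nullary using (Dec; yes; no; does; contradiction)
  open import Relation.Binary.PropositionalEquality
  import Algebra.Properties.CommutativeMonoid.Sum as CommutativeMonoidSum

  ⟨$⟩ʳ-injective : ∀ {k} (ρ : Permutation′ k) {x y} → ρ ⟨$⟩ʳ x ≡ ρ ⟨$⟩ʳ y → x ≡ y
  ⟨$⟩ʳ-injective ρ e = trans (sym (Perm.inverseˡ ρ)) (trans (cong (ρ ⟨$⟩ˡ_) e) (Perm.inverseˡ ρ))

  indicator : Bool → ℕ
  indicator true  = 1
  indicator false = 0

  module _ {d : ℕ} where

    _≟S_ : (S T : Subset d) → Dec (S ≡ T)
    _≟S_ = Vec.≡-dec Bool._≟_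

    count : Subset d → List (Subset d) → ℕ
    count S m = length (filter (_≟S S) m)

    count-∷ : ∀ S T m → count S (T ∷ m) ≡ indicator (does (T ≟S S)) + count S m
    count-∷ S T m with T ≟S S
    ... | yes _ = refl
    ... | no _  = refl

    count-∷-self : ∀ S m → count S (S ∷ m) ≡ suc (count S m)
    count-∷-self S m with S ≟S S
    ... | yes _  = refl
    ... | no S≢S = contradiction refl S≢S

    count-++ : ∀ S m m′ → count S (m ++ m′) ≡ count S m + count S m′
    count-++ S m m′ = trans (cong length (List.filter-++ (_≟S S) m m′)) (List.length-++ (filter (_≟S S) m))

    infix 4 _∼_

    record _∼_ (m m′ : List (Subset d)) : Set where
      constructor mk∼
      field count-≡ : ∀ S → count S m ≡ count S m′
    open _∼_ public

    ∼-refl : ∀ {m} → m ∼ m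
    ∼-refl = mk∼ λ _ → refl

    ∼-sym : ∀ {m m′} → m ∼ m′ → m′ ∼ m
    ∼-sym e = mk∼ λ S → sym (count-≡ e S)

    ∼-trans : ∀ {m m′ m″} → m ∼ m′ → m′ ∼ m″ → m ∼ m″
    ∼-trans e e′ = mk∼ λ S → trans (count-≡ e S) (count-≡ e′ S)

    ≡⇒∼ : ∀ {m m′} → m ≡ m′ → m ∼ m′
    ≡⇒∼ refl = ∼-refl

    ++-comm-∼ : ∀ m m′ → m ++ m′ ∼ m′ ++ m
    ++-comm-∼ m m′ = mk∼ λ S → begin
      count S (m ++ m′)         ≡⟨ count-++ S m m′ ⟩
      count S m + count S m′    ≡⟨ ℕ.+-comm (count S m) _ ⟩
      count S m′ + count S m    ≡⟨ count-++ S m′ m ⟨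
      count S (m′ ++ m)         ∎
      where open ≡-Reasoning

    removeOne : Subset d → List (Subset d) → List (Subset d)
    removeOne S []      = []
    removeOne S (T ∷ m) with T ≟S S
    ... | yes _ = m
    ... | no _  = T ∷ removeOne S m

    count-removeOne : ∀ S m → count S m ≢ 0 → ∀ T → count T m ≡ indicator (does (S ≟S T)) + count T (removeOne S m)
    count-removeOne S []      S∉m T = contradiction refl S∉m
    count-removeOne S (U ∷ m) S∈m T with U ≟S S
    ... | yes refl = count-∷ T U m
    ... | no _     = begin
      count T (U ∷ m)                        ≡⟨ count-∷ T U m ⟩
      [U] + count T m                        ≡⟨ cong ([U] +_) (count-removeOne S m S∈m T) ⟩
      [U] + ([S] + count T (removeOne S m))  ≡⟨ ℕ.+-comm [U] _ ⟩
      ([S] + count T (removeOne S m)) + [U]  ≡⟨ ℕ.+-assoc [S] _ [U] ⟩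
      [S] + (count T (removeOne S m) + [U])  ≡⟨ cong ([S] +_) (ℕ.+-comm _ [U]) ⟩
      [S] + ([U] + count T (removeOne S m))  ≡⟨ cong ([S] +_) (count-∷ T U (removeOne S m)) ⟨
      [S] + count T (U ∷ removeOne S m)      ∎
      where
      open ≡-Reasoning
      [U] = indicator (does (U ≟S T))
      [S] = indicator (does (S ≟S T))

    length-removeOne : ∀ S m → count S m ≢ 0 → length m ≡ suc (length (removeOne S m))
    length-removeOne S []      S∉m = contradiction refl S∉m
    length-removeOne S (U ∷ m) S∈m with U ≟S S
    ... | yes _ = refl
    ... | no _  = cong suc (length-removeOne S m S∈m)

    ∼⇒length≡ : ∀ m m′ → m ∼ m′ → length m ≡ length m′
    ∼⇒length≡ []      []       e = refl
    ∼⇒length≡ []      (T ∷ m′) e = contradiction (trans (count-≡ e T) (count-∷-self T m′)) ℕ.0≢1+n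
    ∼⇒length≡ (S ∷ m) m′       e =
      trans (cong suc (∼⇒length≡ m (removeOne S m′) e′)) (sym (length-removeOne S m′ S∈m′))
      where
      S∈m′ : count S m′ ≢ 0
      S∈m′ eq = ℕ.0≢1+n (trans (sym eq) (trans (sym (count-≡ e S)) (count-∷-self S m)))
      e′ : m ∼ removeOne S m′
      e′ = mk∼ λ T → ℕ.+-cancelˡ-≡ (indicator (does (S ≟S T))) _ _
             (trans (sym (count-∷ T S m)) (trans (count-≡ e T) (count-removeOne S m′ S∈m′ T)))

    open CommutativeMonoidSum ℕ.+-0-commutativeMonoid using (sum; sum-permute)

    count-tabulate : ∀ {k} (A : Fin k → Subset d) S → count S (tabulate A) ≡ sum (λ ℓ → indicator (does (A ℓ ≟S S)))
    count-tabulate {zero}  A S = refl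
    count-tabulate {suc k} A S =
      trans (count-∷ S (A Fin.zero) _) (cong (indicator (does (A Fin.zero ≟S S)) +_) (count-tabulate (A ∘ Fin.suc) S))

    tabulate-permute-∼ : ∀ {k} (A : Fin k → Subset d) (σ : Permutation′ k) → tabulate A ∼ tabulate (A ∘ (σ ⟨$⟩ʳ_))
    tabulate-permute-∼ A σ = mk∼ λ S → begin
      count S (tabulate A)                            ≡⟨ count-tabulate A S ⟩
      sum (λ ℓ → indicator (does (A ℓ ≟S S)))           ≡⟨ sum-permute _ σ ⟩
      sum (λ ℓ → indicator (does (A (σ ⟨$⟩ʳ ℓ) ≟S S)))  ≡⟨ count-tabulate (A ∘ (σ ⟨$⟩ʳ_)) S ⟨
      count S (tabulate (A ∘ (σ ⟨$⟩ʳ_)))              ∎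
      where open ≡-Reasoning

    count-tabulate-≢0 : ∀ {k} (A : Fin k → Subset d) {S} → count S (tabulate A) ≢ 0 → ∃ λ ℓ → A ℓ ≡ S
    count-tabulate-≢0 {zero}  A S∉A = contradiction refl S∉A
    count-tabulate-≢0 {suc k} A {S} S∈A with A Fin.zero ≟S S
    ... | yes A₀≡S = Fin.zero , A₀≡S
    ... | no _     = let ℓ , Aℓ≡S = count-tabulate-≢0 (A ∘ Fin.suc) S∈A in Fin.suc ℓ , Aℓ≡S

    tabulate-∼⇒permutation : ∀ {k} (A B : Fin k → Subset d) → tabulate A ∼ tabulate B →
                             Σ (Permutation′ k) λ σ → ∀ ℓ → A (σ ⟨$⟩ʳ ℓ) ≡ B ℓ
    tabulate-∼⇒permutation {zero}  A B e = Perm.id , λ ()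
    tabulate-∼⇒permutation {suc k} A B e = Perm.lift₀ σ ∘ₚ τ , λ { Fin.zero → A′₀≡B₀ ; (Fin.suc ℓ) → σ-spec ℓ }
      where
      B₀ = B Fin.zero
      B₀∈A : count B₀ (tabulate A) ≢ 0
      B₀∈A eq = ℕ.0≢1+n (trans (sym eq) (trans (count-≡ e B₀) (count-∷-self B₀ _)))
      τ : Permutation′ (suc k)
      τ = Perm.transpose Fin.zero (proj₁ (count-tabulate-≢0 A B₀∈A))
      A′ = A ∘ (τ ⟨$⟩ʳ_)
      A′₀≡B₀ : A′ Fin.zero ≡ B₀
      A′₀≡B₀ = proj₂ (count-tabulate-≢0 A B₀∈A)
      tails : tabulate (A′ ∘ Fin.suc) ∼ tabulate (B ∘ Fin.suc)
      tails = mk∼ λ S → ℕ.+-cancelˡ-≡ (indicator (does (B₀ ≟S S))) _ _ (begin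
        indicator (does (B₀ ≟S S)) + count S (tabulate (A′ ∘ Fin.suc))
          ≡⟨ cong (λ X → indicator (does (X ≟S S)) + count S (tabulate (A′ ∘ Fin.suc))) A′₀≡B₀ ⟨
        indicator (does (A′ Fin.zero ≟S S)) + count S (tabulate (A′ ∘ Fin.suc))
          ≡⟨ count-∷ S (A′ Fin.zero) _ ⟨
        count S (tabulate A′)
          ≡⟨ count-≡ (tabulate-permute-∼ A τ) S ⟨
        count S (tabulate A)
          ≡⟨ count-≡ e S ⟩
        count S (tabulate B)
          ≡⟨ count-∷ S B₀ _ ⟩
        indicator (does (B₀ ≟S S)) + count S (tabulate (B ∘ Fin.suc))
          ∎)
        where open ≡-Reasoning
      σ = proj₁ (tabulate-∼⇒permutation (A′ ∘ Fin.suc) (B ∘ Fin.suc) tails)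
      σ-spec = proj₂ (tabulate-∼⇒permutation (A′ ∘ Fin.suc) (B ∘ Fin.suc) tails)

  module _ {k : ℕ} {i j : Fin (suc (suc k))} (i≢j : i ≢ j) where

    private
      τ₁ : Permutation′ (suc (suc k))
      τ₁ = Perm.transpose Fin.zero i

      j′ : Fin (suc (suc k))
      j′ = τ₁ ⟨$⟩ˡ j

      j′≢0 : j′ ≢ Fin.zero
      j′≢0 eq = i≢j (trans (cong (τ₁ ⟨$⟩ʳ_) (sym eq)) (Perm.inverseʳ τ₁))

      τ₂ : Permutation′ (suc (suc k))
      τ₂ = Perm.transpose (Fin.suc Fin.zero) j′

      τ₂-fixes-0 : τ₂ ⟨$⟩ʳ Fin.zero ≡ Fin.zero
      τ₂-fixes-0 with Fin.zero Fin.≟ j′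
      ... | yes eq = contradiction (sym eq) j′≢0
      ... | no _   = refl

    ρ : Permutation′ (suc (suc k))
    ρ = τ₂ ∘ₚ τ₁

    ρ-0 : ρ ⟨$⟩ʳ Fin.zero ≡ i
    ρ-0 = cong (τ₁ ⟨$⟩ʳ_) τ₂-fixes-0

    ρ-1 : ρ ⟨$⟩ʳ Fin.suc Fin.zero ≡ j
    ρ-1 = Perm.inverseʳ τ₁

    others : Fin k → Fin (suc (suc k))
    others ℓ = ρ ⟨$⟩ʳ Fin.suc (Fin.suc ℓ)

    others-≢ˡ : ∀ ℓ → others ℓ ≢ i
    others-≢ˡ ℓ eq with ⟨$⟩ʳ-injective ρ {Fin.suc (Fin.suc ℓ)} {Fin.zero} (trans eq (sym ρ-0))
    ... | ()

    others-≢ʳ : ∀ ℓ → others ℓ ≢ j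
    others-≢ʳ ℓ eq with ⟨$⟩ʳ-injective ρ {Fin.suc (Fin.suc ℓ)} {Fin.suc Fin.zero} (trans eq (sym ρ-1))
    ... | ()

    tabulate-∼-others : ∀ {d} (A : Fin (suc (suc k)) → Subset d) →
                        tabulate A ∼ tabulate (A ∘ others) ++ A i ∷ A j ∷ []
    tabulate-∼-others A = ∼-trans (tabulate-permute-∼ A ρ)
      (∼-trans (≡⇒∼ (cong₂ (λ X Y → X ∷ Y ∷ tabulate (A ∘ others)) (cong A ρ-0) (cong A ρ-1)))
               (++-comm-∼ (A i ∷ A j ∷ []) _))

module SubsetSums where

  open import Level using (Level)
  open import Function using (_∘_)
  open import Data.Nat as ℕ using (ℕ; zero; suc; _+_)
  import Data.Nat.Properties as ℕ
  import Data.Nat.ListAction.Properties as ListAction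
  open import Data.Bool using (if_then_else_)
  open import Data.Fin as Fin using (Fin; _↑ˡ_; _↑ʳ_)
  import Data.Fin.Properties as Fin
  open import Data.Fin.Subset using (Subset; inside; outside; ⊤)
  open import Data.Fin.Subset.Properties using (_⊆?_; ⊆⊤)
  open import Data.Vec using ([]; _∷_)
  open import Data.List as List using (_++_; map)
  import Data.List.Properties as List
  open import Data.Product using (Σ; _×_; _,_; proj₁; proj₂)
  open import Data.Sum using (inj₁; inj₂; [_,_]′)
  open import Relation.Nullary using (Dec; yes; no; does; contradiction)
  open import Relation.Nullary.Negation using (contradiction-irr)
  open import Relation.Binary.PropositionalEquality

  private
    variable
      p : Level

  sumSubsets : (d : ℕ) → (Subset d → ℕ) → ℕ
  sumSubsets zero    n = n []
  sumSubsets (suc d) n = sumSubsets d (n ∘ (inside ∷_)) + sumSubsets d (n ∘ (outside ∷_))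

  sumSubsets-cong : ∀ d {n n′ : Subset d → ℕ} → (∀ W → n W ≡ n′ W) → sumSubsets d n ≡ sumSubsets d n′
  sumSubsets-cong zero    eq = eq []
  sumSubsets-cong (suc d) eq = cong₂ _+_ (sumSubsets-cong d (eq ∘ (inside ∷_))) (sumSubsets-cong d (eq ∘ (outside ∷_)))

  sumℕ-allSubsets : ∀ d n → sumℕ (List.map n (allSubsets d)) ≡ sumSubsets d n
  sumℕ-allSubsets zero    n = ℕ.+-identityʳ (n [])
  sumℕ-allSubsets (suc d) n = begin
    sumℕ (List.map n (ins ++ outs))                      ≡⟨ cong sumℕ (List.map-++ n ins outs) ⟩
    sumℕ (List.map n ins ++ List.map n outs)             ≡⟨ ListAction.sum-++ (List.map n ins) _ ⟩
    sumℕ (List.map n ins) + sumℕ (List.map n outs)       ≡⟨ cong₂ _+_ (cong sumℕ (List.map-∘ (allSubsets d)))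
                                                                       (cong sumℕ (List.map-∘ (allSubsets d))) ⟨
    sumℕ (List.map (n ∘ (inside ∷_)) (allSubsets d)) + sumℕ (List.map (n ∘ (outside ∷_)) (allSubsets d))
      ≡⟨ cong₂ _+_ (sumℕ-allSubsets d (n ∘ (inside ∷_))) (sumℕ-allSubsets d (n ∘ (outside ∷_))) ⟩
    sumSubsets (suc d) n                                  ∎
    where
    open ≡-Reasoning
    ins  = List.map (inside ∷_) (allSubsets d)
    outs = List.map (outside ∷_) (allSubsets d)

  encode : ∀ d (n : Subset d → ℕ) → Σ (Subset d) (Fin ∘ n) → Fin (sumSubsets d n)
  encode zero    n ([] , a)          = a
  encode (suc d) n (inside ∷ W , a)  = encode d (n ∘ (inside ∷_)) (W , a) ↑ˡ _
  encode (suc d) n (outside ∷ W , a) = sumSubsets d (n ∘ (inside ∷_)) ↑ʳ encode d (n ∘ (outside ∷_)) (W , a)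

  decode : ∀ d (n : Subset d → ℕ) → Fin (sumSubsets d n) → Σ (Subset d) (Fin ∘ n)
  decode zero    n a = [] , a
  decode (suc d) n i = [ (λ a → let W , x = decode d (n ∘ (inside ∷_)) a in inside ∷ W , x)
                       , (λ b → let W , x = decode d (n ∘ (outside ∷_)) b in outside ∷ W , x)
                       ]′ (Fin.splitAt (sumSubsets d (n ∘ (inside ∷_))) i)

  decode-encode : ∀ d n x → decode d n (encode d n x) ≡ x
  decode-encode zero    n ([] , a) = refl
  decode-encode (suc d) n (inside ∷ W , a)
    rewrite Fin.splitAt-↑ˡ (sumSubsets d (n ∘ (inside ∷_))) (encode d (n ∘ (inside ∷_)) (W , a)) (sumSubsets d (n ∘ (outside ∷_)))
          | decode-encode d (n ∘ (inside ∷_)) (W , a) = refl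
  decode-encode (suc d) n (outside ∷ W , a)
    rewrite Fin.splitAt-↑ʳ (sumSubsets d (n ∘ (inside ∷_))) (sumSubsets d (n ∘ (outside ∷_))) (encode d (n ∘ (outside ∷_)) (W , a))
          | decode-encode d (n ∘ (outside ∷_)) (W , a) = refl

  encode-decode : ∀ d n i → encode d n (decode d n i) ≡ i
  encode-decode zero    n i = refl
  encode-decode (suc d) n i with Fin.splitAt (sumSubsets d (n ∘ (inside ∷_))) i in eq
  ... | inj₁ a = trans (cong (_↑ˡ _) (encode-decode d (n ∘ (inside ∷_)) a)) (Fin.splitAt⁻¹-↑ˡ eq)
  ... | inj₂ b = trans (cong (_ ↑ʳ_) (encode-decode d (n ∘ (outside ∷_)) b)) (Fin.splitAt⁻¹-↑ʳ eq)

  module _ {P : Set p} where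

    restrict : Dec P → ℕ → ℕ
    restrict D n = if does D then n else 0

    injectRestrict : ∀ {n} (D : Dec P) → .P → Fin n → Fin (restrict D n)
    injectRestrict (yes _) _ a = a
    injectRestrict (no ¬p) p _ = contradiction-irr p ¬p

    projectRestrict : ∀ {n} (D : Dec P) → Fin (restrict D n) → P × Fin n
    projectRestrict (yes p) a = p , a

    projectRestrict-injectRestrict : ∀ {n} D .(p : P) (a : Fin n) → proj₂ (projectRestrict D (injectRestrict D p a)) ≡ a
    projectRestrict-injectRestrict (yes _) _ _ = refl
    projectRestrict-injectRestrict (no ¬p) p _ = contradiction-irr p ¬p

    injectRestrict-projectRestrict : ∀ {n} D (a : Fin (restrict D n)) →
                                     injectRestrict D (proj₁ (projectRestrict D a)) (proj₂ (projectRestrict D a)) ≡ a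
    injectRestrict-projectRestrict (yes _) _ = refl

  sumBelow : ∀ {d} → (Subset d → ℕ) → Subset d → ℕ
  sumBelow {d} n W = sumSubsets d λ W′ → restrict (W′ ⊆? W) (n W′)

  sumBelow-⊤ : ∀ {d} (n : Subset d → ℕ) → sumBelow n ⊤ ≡ sumℕ (map n (allSubsets d))
  sumBelow-⊤ {d} n = trans (sumSubsets-cong d below-⊤) (sym (sumℕ-allSubsets d n))
    where
    below-⊤ : ∀ W → restrict (W ⊆? ⊤) (n W) ≡ n W
    below-⊤ W with W ⊆? ⊤
    ... | yes _    = refl
    ... | no W⊈⊤   = contradiction (λ {u} → ⊆⊤ {x = u}) W⊈⊤

module Colorings where

  open import Function using (_∘_)
  open import Data.Empty using (⊥)
  open import Data.Nat as ℕ using (ℕ; zero; suc)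
  open import Data.Bool using (Bool; true; false; if_then_else_)
  open import Data.Fin as Fin using (Fin)
  import Data.Fin.Properties as Fin
  open import Data.Fin.Subset using (Subset; _∈_; _⊆_; _∪_)
  open import Data.Fin.Subset.Properties using (_∈?_; ⊆-antisym; x∈p∪q⁺; x∈p∪q⁻)
  open import Data.Vec as Vec using (Vec)
  import Data.Vec.Properties as Vec
  open import Data.Vec.Properties.WithK using ([]=-irrelevant)
  open import Data.List as List using (List; []; _∷_; length; tabulate)
  import Data.List.Properties as List
  open import Data.List.Relation.Unary.All as All using (All; []; _∷_)
  open import Data.List.Membership.Propositional.Properties using (∈-allFin)
  import Data.List.Relation.Unary.All.Properties as All
  open import Data.Product as Product using (Σ; ∃; _×_; _,_; proj₁; proj₂)
  open import Data.Sum as Sum using (_⊎_; inj₁; inj₂)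
  open import Relation.Nullary using (¬_; Dec; yes; no; does; contradiction; _→-dec_; _⊎-dec_)
  open import Relation.Binary.PropositionalEquality
  import Relation.Binary.Construct.Closure.Equivalence as EqC
  open import Relation.Nullary.Negation using (¬¬-map)
  open import Relation.Nullary.Decidable using (¬¬-excluded-middle)
  open Classical

  ∈-irrelevant : ∀ {d} {u : Fin d} {S : Subset d} (p q : u ∈ S) → p ≡ q
  ∈-irrelevant = []=-irrelevant

  module _ {d k : ℕ} {W : Subset d} (f : ColMap W k) where

    private
      inClass : Fin k → (v : Fin d) → Dec (v ∈ W) → Bool
      inClass ℓ v (yes p) = does (f v p Fin.≟ ℓ)
      inClass ℓ v (no _)  = false

      preimage-tabulate : ∀ ℓ → preimage W f ℓ ≡ Vec.tabulate (λ v → inClass ℓ v (v ∈? W))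
      preimage-tabulate ℓ = eq
        where
        -- the left side is the local helper that Defs.preimage tabulates, which cannot be named here
        pointwise : ∀ v → _ ≡ inClass ℓ v (v ∈? W)
        eq : preimage W f ℓ ≡ Vec.tabulate (λ v → inClass ℓ v (v ∈? W))
        eq = Vec.tabulate-cong pointwise
        pointwise v with v ∈? W
        ... | yes _ = refl
        ... | no _  = refl

      lookup-preimage : ∀ ℓ u → Vec.lookup (preimage W f ℓ) u ≡ inClass ℓ u (u ∈? W)
      lookup-preimage ℓ u = trans (cong (λ xs → Vec.lookup xs u) (preimage-tabulate ℓ))
                                  (Vec.lookup∘tabulate (λ v → inClass ℓ v (v ∈? W)) u)

    ∈-preimage⁺ : ∀ {u ℓ} (p : u ∈ W) → f u p ≡ ℓ → u ∈ preimage W f ℓ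
    ∈-preimage⁺ {u} {ℓ} p refl = Vec.lookup⇒[]= u _ (trans (lookup-preimage ℓ u) (inClass-self (u ∈? W)))
      where
      inClass-self : (D : Dec (u ∈ W)) → inClass (f u p) u D ≡ true
      inClass-self (yes p′) rewrite ∈-irrelevant p′ p with f u p Fin.≟ f u p
      ... | yes _ = refl
      ... | no fu≢fu = contradiction refl fu≢fu
      inClass-self (no u∉W) = contradiction p u∉W

    ∈-preimage⁻ : ∀ {u ℓ} → u ∈ preimage W f ℓ → Σ (u ∈ W) λ p → f u p ≡ ℓ
    ∈-preimage⁻ {u} {ℓ} q = fromInClass (u ∈? W) (trans (sym (lookup-preimage ℓ u)) (Vec.[]=⇒lookup q))
      where
      fromInClass : (D : Dec (u ∈ W)) → inClass ℓ u D ≡ true → Σ (u ∈ W) λ p → f u p ≡ ℓ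
      fromInClass (yes p) eq with f u p Fin.≟ ℓ
      ... | yes fu≡ℓ = p , fu≡ℓ
      fromInClass (no _) ()

    preimage⊆ : ∀ ℓ → preimage W f ℓ ⊆ W
    preimage⊆ ℓ = proj₁ ∘ ∈-preimage⁻

    preimage-disjoint : ∀ {u ℓ ℓ′} → u ∈ preimage W f ℓ → u ∈ preimage W f ℓ′ → ℓ ≡ ℓ′
    preimage-disjoint q q′ with ∈-preimage⁻ q | ∈-preimage⁻ q′
    ... | p , refl | p′ , refl = cong (f _) (∈-irrelevant p p′)

    colorMonomial : List (Subset d)
    colorMonomial = tabulate (preimage W f)

    length-colorMonomial : length colorMonomial ≡ k
    length-colorMonomial = List.length-tabulate (preimage W f)

  module _ {d k : ℕ} {W : Subset d} where

    preimage-≡ : ∀ (f g : ColMap W k) {ℓ ℓ′} → (∀ u p → f u p ≡ ℓ → g u p ≡ ℓ′) → (∀ u p → g u p ≡ ℓ′ → f u p ≡ ℓ) →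
                 preimage W f ℓ ≡ preimage W g ℓ′
    preimage-≡ f g f⇒g g⇒f = ⊆-antisym
      (λ q → let p , eq = ∈-preimage⁻ f q in ∈-preimage⁺ g p (f⇒g _ p eq))
      (λ q → let p , eq = ∈-preimage⁻ g q in ∈-preimage⁺ f p (g⇒f _ p eq))

  module _ {d : ℕ} (G : Graph d) {W : Subset d} {k : ℕ} where

    preimage-stable : ∀ (f : Coloring G W k) ℓ → Stable G W (preimage W (proj₁ f) ℓ)
    preimage-stable (f , proper) ℓ = preimage⊆ f ℓ , λ qu qv adj →
      let pu , fu≡ℓ = ∈-preimage⁻ f qu
          pv , fv≡ℓ = ∈-preimage⁻ f qv
      in proper _ _ pu pv adj (trans fu≡ℓ (sym fv≡ℓ))

    colorMonomial-stable : ∀ (f : Coloring G W k) → All (Stable G W) (colorMonomial (proj₁ f))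
    colorMonomial-stable f = All.tabulate⁺ (preimage-stable f)

  Stable-mono : ∀ {d} (G : Graph d) {V W : Subset d} → V ⊆ W → ∀ {S} → Stable G V S → Stable G W S
  Stable-mono G V⊆W (S⊆V , independent) = V⊆W ∘ S⊆V , independent

  module _ {d k : ℕ} (M : Fin k → Subset d) where

    union : Subset d
    union = Vec.tabulate λ u → does (Fin.any? λ ℓ → u ∈? M ℓ)

    ∈-union⁺ : ∀ {u} ℓ → u ∈ M ℓ → u ∈ union
    ∈-union⁺ {u} ℓ q = Vec.lookup⇒[]= u _ (trans (Vec.lookup∘tabulate _ u) (any-true (Fin.any? λ ℓ → u ∈? M ℓ)))
      where
      any-true : (D : Dec (∃ λ ℓ → u ∈ M ℓ)) → does D ≡ true
      any-true (yes _) = refl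
      any-true (no ∄) = contradiction (ℓ , q) ∄

    ∈-union⁻ : ∀ {u} → u ∈ union → ∃ λ ℓ → u ∈ M ℓ
    ∈-union⁻ {u} q = witness (Fin.any? λ ℓ → u ∈? M ℓ) (trans (sym (Vec.lookup∘tabulate _ u)) (Vec.[]=⇒lookup q))
      where
      witness : (D : Dec (∃ λ ℓ → u ∈ M ℓ)) → does D ≡ true → ∃ λ ℓ → u ∈ M ℓ
      witness (yes w) _ = w

    Disjoint : Set
    Disjoint = ∀ u ℓ ℓ′ → u ∈ M ℓ → u ∈ M ℓ′ → ℓ ≡ ℓ′

    private
      separated? : ∀ u ℓ ℓ′ → Dec (u ∈ M ℓ → u ∈ M ℓ′ → ℓ ≡ ℓ′)
      separated? u ℓ ℓ′ = (u ∈? M ℓ) →-dec (u ∈? M ℓ′) →-dec (ℓ Fin.≟ ℓ′)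

    disjoint? : Dec Disjoint
    disjoint? = Fin.all? λ u → Fin.all? λ ℓ → Fin.all? λ ℓ′ → separated? u ℓ ℓ′

    ¬Disjoint⇒overlap : ¬ Disjoint → ∃ λ u → ∃ λ ℓ → ∃ λ ℓ′ → u ∈ M ℓ × u ∈ M ℓ′ × ℓ ≢ ℓ′
    ¬Disjoint⇒overlap ¬disjoint with Fin.¬∀⟶∃¬ d _ (λ u → Fin.all? λ ℓ → Fin.all? λ ℓ′ → separated? u ℓ ℓ′) ¬disjoint
    ... | u , ¬u with Fin.¬∀⟶∃¬ k _ (λ ℓ → Fin.all? λ ℓ′ → separated? u ℓ ℓ′) ¬u
    ...   | ℓ , ¬ℓ with Fin.¬∀⟶∃¬ k _ (separated? u ℓ) ¬ℓ
    ...     | ℓ′ , ¬ℓ′ with u ∈? M ℓ | u ∈? M ℓ′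
    ...       | yes q | yes q′ = u , ℓ , ℓ′ , q , q′ , λ ℓ≡ℓ′ → ¬ℓ′ λ _ _ → ℓ≡ℓ′
    ...       | no ¬q | _      = contradiction (λ q → contradiction q ¬q) ¬ℓ′
    ...       | yes _ | no ¬q′ = contradiction (λ _ q′ → contradiction q′ ¬q′) ¬ℓ′

    Covers : Subset d → Set
    Covers W = ∀ u → u ∈ W → ∃ λ ℓ → u ∈ M ℓ

    union-covers : Covers union
    union-covers _ = ∈-union⁻

    module _ {W : Subset d} (cover : Covers W) where

      colorBy : ColMap W k
      colorBy u p = proj₁ (cover u p)

      ∈-colorBy : ∀ u p → u ∈ M (colorBy u p)
      ∈-colorBy u p = proj₂ (cover u p)

      colorBy-unique : Disjoint → ∀ {u} p {ℓ} → u ∈ M ℓ → colorBy u p ≡ ℓ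
      colorBy-unique disjoint p q = disjoint _ _ _ (∈-colorBy _ p) q

      colorBy-proper : ∀ (G : Graph d) → (∀ ℓ {u v} → u ∈ M ℓ → v ∈ M ℓ → ¬ Adj G u v) → Proper G W k colorBy
      colorBy-proper G independent u v pu pv adj eq =
        independent (colorBy v pv) (subst (λ ℓ → u ∈ M ℓ) eq (∈-colorBy u pu)) (∈-colorBy v pv) adj

      preimage-colorBy : Disjoint → (∀ ℓ → M ℓ ⊆ W) → ∀ ℓ → preimage W colorBy ℓ ≡ M ℓ
      preimage-colorBy disjoint M⊆W ℓ = ⊆-antisym to from
        where
        to : preimage W colorBy ℓ ⊆ M ℓ
        to q = let p , eq = ∈-preimage⁻ colorBy q in subst (λ ℓ → _ ∈ M ℓ) eq (∈-colorBy _ p)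
        from : M ℓ ⊆ preimage W colorBy ℓ
        from q = ∈-preimage⁺ colorBy (M⊆W ℓ q) (colorBy-unique disjoint (M⊆W ℓ q) q)

  module _ {d : ℕ} {G : Graph d} {W : Subset d} {k : ℕ} where

    Kempe-refl : ∀ {f : Coloring G W k} → KempeEq G W k f f
    Kempe-refl = EqC.reflexive (KempeStep G W k)

    Kempe-sym : ∀ {f g : Coloring G W k} → KempeEq G W k f g → KempeEq G W k g f
    Kempe-sym = EqC.symmetric (KempeStep G W k)

    Kempe-trans : ∀ {f g h : Coloring G W k} → KempeEq G W k f g → KempeEq G W k g h → KempeEq G W k f h
    Kempe-trans = EqC.transitive (KempeStep G W k)

    pointwise⇒Kempe : ∀ (f g : Coloring G W k) → (∀ u p → proj₁ f u p ≡ proj₁ g u p) → KempeEq G W k f g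
    pointwise⇒Kempe f g eq = EqC.return (same λ u p q → trans (eq u p) (cong (proj₁ g u) (∈-irrelevant p q)))

  module _ {k : ℕ} (i j : Fin k) where

    OneOf : Fin k → Set
    OneOf x = x ≡ i ⊎ x ≡ j

    oneOf? : ∀ x → Dec (OneOf x)
    oneOf? x = (x Fin.≟ i) ⊎-dec (x Fin.≟ j)

    AgreeOutside : ∀ {d} {W : Subset d} → ColMap W k → ColMap W k → Set
    AgreeOutside {W = W} f g = ∀ u (p : u ∈ W) → f u p ≡ g u p ⊎ (OneOf (f u p) × OneOf (g u p))

  module _ {d : ℕ} {G : Graph d} {W : Subset d} {k : ℕ} {i j : Fin k} where

    swapCol-OneOf : ∀ {x} → OneOf i j x → OneOf i j (swapCol G W k i j x)
    swapCol-OneOf {x} x∈ij with x Fin.≟ i | x Fin.≟ j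
    ... | yes _ | _     = inj₂ refl
    ... | no _  | yes _ = inj₁ refl
    ... | no _  | no _  = x∈ij

    swapCol-outside : ∀ {x} → ¬ OneOf i j x → swapCol G W k i j x ≡ x
    swapCol-outside {x} x∉ij with x Fin.≟ i | x Fin.≟ j
    ... | yes x≡i | _       = contradiction (inj₁ x≡i) x∉ij
    ... | no _    | yes x≡j = contradiction (inj₂ x≡j) x∉ij
    ... | no _    | no _    = refl

  module _ {d : ℕ} {W : Subset d} {k : ℕ} {i j : Fin k} where

    AgreeOutside-sym : ∀ {f g : ColMap W k} → AgreeOutside i j f g → AgreeOutside i j g f
    AgreeOutside-sym agree u p = Sum.map sym Product.swap (agree u p)

    AgreeOutside-OneOf : ∀ {f g : ColMap W k} → AgreeOutside i j f g → ∀ u p → OneOf i j (f u p) → OneOf i j (g u p)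
    AgreeOutside-OneOf agree u p fu with agree u p
    ... | inj₁ eq       = subst (OneOf i j) eq fu
    ... | inj₂ (_ , gu) = gu

    AgreeOutside-≡ : ∀ {f g : ColMap W k} → AgreeOutside i j f g → ∀ {ℓ} → ¬ OneOf i j ℓ → ∀ u p → f u p ≡ ℓ → g u p ≡ ℓ
    AgreeOutside-≡ agree ℓ∉ij u p fu≡ℓ with agree u p
    ... | inj₁ eq       = trans (sym eq) fu≡ℓ
    ... | inj₂ (fu , _) = contradiction (subst (OneOf i j) fu≡ℓ fu) ℓ∉ij

    AgreeOutside-preimage : ∀ {f g : ColMap W k} → AgreeOutside i j f g → ∀ ℓ → ¬ OneOf i j ℓ → preimage W f ℓ ≡ preimage W g ℓ
    AgreeOutside-preimage {f} {g} agree ℓ ℓ∉ij =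
      preimage-≡ f g (AgreeOutside-≡ agree ℓ∉ij) (AgreeOutside-≡ (AgreeOutside-sym agree) ℓ∉ij)

  module _ {d : ℕ} {W : Subset d} {k : ℕ} {i j : Fin k} (f : ColMap W k) where

    pairClasses : Subset d
    pairClasses = preimage W f i ∪ preimage W f j

    pairClasses⊆W : pairClasses ⊆ W
    pairClasses⊆W q with x∈p∪q⁻ (preimage W f i) _ q
    ... | inj₁ qi = preimage⊆ f i qi
    ... | inj₂ qj = preimage⊆ f j qj

    ∈-pairClasses⁺ : ∀ {u} p → OneOf i j (f u p) → u ∈ pairClasses
    ∈-pairClasses⁺ p (inj₁ eq) = x∈p∪q⁺ (inj₁ (∈-preimage⁺ f p eq))
    ∈-pairClasses⁺ p (inj₂ eq) = x∈p∪q⁺ (inj₂ (∈-preimage⁺ f p eq))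

    ∈-pairClasses⁻ : ∀ {u} (q : u ∈ pairClasses) p → OneOf i j (f u p)
    ∈-pairClasses⁻ q p with x∈p∪q⁻ (preimage W f i) _ q
    ... | inj₁ qi = let p′ , eq = ∈-preimage⁻ f qi in inj₁ (subst (λ p → f _ p ≡ i) (∈-irrelevant p′ p) eq)
    ... | inj₂ qj = let p′ , eq = ∈-preimage⁻ f qj in inj₂ (subst (λ p → f _ p ≡ j) (∈-irrelevant p′ p) eq)

  module _ {d : ℕ} (G : Graph d) {W : Subset d} {k : ℕ} {i j : Fin k} (i≢j : i ≢ j) where

    toBit : Fin k → Fin 2
    toBit x = if does (x Fin.≟ i) then Fin.zero else Fin.suc Fin.zero

    fromBit : Fin 2 → Fin k
    fromBit Fin.zero       = i
    fromBit (Fin.suc _)    = j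

    fromBit-toBit : ∀ {x} → OneOf i j x → fromBit (toBit x) ≡ x
    fromBit-toBit {x} (inj₁ refl) with x Fin.≟ x
    ... | yes _ = refl
    ... | no x≢x = contradiction refl x≢x
    fromBit-toBit {x} (inj₂ refl) with x Fin.≟ i
    ... | yes x≡i = contradiction (sym x≡i) i≢j
    ... | no _    = refl

    toBit-fromBit : ∀ b → toBit (fromBit b) ≡ b
    toBit-fromBit Fin.zero with i Fin.≟ i
    ... | yes _ = refl
    ... | no i≢i = contradiction refl i≢i
    toBit-fromBit (Fin.suc Fin.zero) with j Fin.≟ i
    ... | yes j≡i = contradiction (sym j≡i) i≢j
    ... | no _    = refl

    fromBit-OneOf : ∀ b → OneOf i j (fromBit b)
    fromBit-OneOf Fin.zero    = inj₁ refl
    fromBit-OneOf (Fin.suc _) = inj₂ refl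

    module RestrictToPair (g : Coloring G W k) {P : Subset d} (P⊆W : P ⊆ W)
             (OneOf⇒∈P : ∀ {u} p → OneOf i j (proj₁ g u p) → u ∈ P)
             (∈P⇒OneOf : ∀ {u} (q : u ∈ P) p → OneOf i j (proj₁ g u p)) where

      restricted : Coloring G P 2
      restricted = (λ u q → toBit (proj₁ g u (P⊆W q))) , proper
        where
        proper : Proper G P 2 (λ u q → toBit (proj₁ g u (P⊆W q)))
        proper u v qu qv adj eq = proj₂ g u v (P⊆W qu) (P⊆W qv) adj (begin
          proj₁ g u (P⊆W qu)                     ≡⟨ fromBit-toBit (∈P⇒OneOf qu _) ⟨
          fromBit (toBit (proj₁ g u (P⊆W qu)))   ≡⟨ cong fromBit eq ⟩
          fromBit (toBit (proj₁ g v (P⊆W qv)))   ≡⟨ fromBit-toBit (∈P⇒OneOf qv _) ⟩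
          proj₁ g v (P⊆W qv)                     ∎)
          where open ≡-Reasoning

      preimage-restricted : ∀ b → preimage P (proj₁ restricted) b ≡ preimage W (proj₁ g) (fromBit b)
      preimage-restricted b = ⊆-antisym to from
        where
        to : preimage P (proj₁ restricted) b ⊆ preimage W (proj₁ g) (fromBit b)
        to q = let qP , eq = ∈-preimage⁻ (proj₁ restricted) q
               in ∈-preimage⁺ (proj₁ g) (P⊆W qP) (trans (sym (fromBit-toBit (∈P⇒OneOf qP _))) (cong fromBit eq))
        from : preimage W (proj₁ g) (fromBit b) ⊆ preimage P (proj₁ restricted) b
        from q = let p , eq = ∈-preimage⁻ (proj₁ g) q
                     qP = OneOf⇒∈P p (subst (OneOf i j) (sym eq) (fromBit-OneOf b))
                 in ∈-preimage⁺ (proj₁ restricted) qP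
                      (trans (cong (toBit ∘ proj₁ g _) (∈-irrelevant (P⊆W qP) p)) (trans (cong toBit eq) (toBit-fromBit b)))

  module _ {d : ℕ} {G : Graph d} {W : Subset d} {k : ℕ} {i j : Fin k} (i<j : i Fin.< j) where

    private
      i≢j : i ≢ j
      i≢j = Fin.<⇒≢ i<j

      swap : Fin k → Fin k
      swap = swapCol G W k i j

      swap-i : swap i ≡ j
      swap-i with i Fin.≟ i
      ... | yes _  = refl
      ... | no i≢i = contradiction refl i≢i

      swap-j : swap j ≡ i
      swap-j with j Fin.≟ i | j Fin.≟ j
      ... | yes j≡i | _       = contradiction (sym j≡i) i≢j
      ... | no _    | yes _   = refl
      ... | no _    | no j≢j  = contradiction refl j≢j

      swap-involutive : ∀ {x} → OneOf i j x → swap (swap x) ≡ x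
      swap-involutive (inj₁ refl) = trans (cong swap swap-i) swap-j
      swap-involutive (inj₂ refl) = trans (cong swap swap-j) swap-i

      swap-≢ : ∀ {x} → OneOf i j x → swap x ≢ x
      swap-≢ (inj₁ refl) eq = i≢j (trans (sym eq) swap-i)
      swap-≢ (inj₂ refl) eq = i≢j (trans (sym swap-j) eq)

      OneOf-≢⇒swap : ∀ {x y} → OneOf i j x → OneOf i j y → x ≢ y → y ≡ swap x
      OneOf-≢⇒swap (inj₁ refl) (inj₁ refl) x≢y = contradiction refl x≢y
      OneOf-≢⇒swap (inj₁ refl) (inj₂ refl) _   = sym swap-i
      OneOf-≢⇒swap (inj₂ refl) (inj₁ refl) _   = sym swap-j
      OneOf-≢⇒swap (inj₂ refl) (inj₂ refl) x≢y = contradiction refl x≢y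

      OneOf-irrelevant : ∀ (f : ColMap W k) {u} (p q : u ∈ W) → OneOf i j (f u p) → OneOf i j (f u q)
      OneOf-irrelevant f p q = subst (λ p → OneOf i j (f _ p)) (∈-irrelevant p q)

      Component : ColMap W k → Fin d → Fin d → Set
      Component f = Path G W k f i j

      component-OneOf : ∀ {f v u} → Component f v u → InIJ G W k f i j u
      component-OneOf (here h)     = h
      component-OneOf (step _ _ h) = h

    module Switching (c : Coloring G W k) (v : Fin d) (pv : v ∈ W) (cv : OneOf i j (proj₁ c v pv))
                     (component? : ∀ u → Dec (Component (proj₁ c) v u)) where

      private
        f = proj₁ c

      switchedMap : ColMap W k
      switchedMap u p with component? u
      ... | yes _ = swap (f u p)
      ... | no _  = f u p

      switched-on : ∀ u p → Component f v u → switchedMap u p ≡ swap (f u p)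
      switched-on u p inC with component? u
      ... | yes _  = refl
      ... | no ∉C  = contradiction inC ∉C

      switched-off : ∀ u p → ¬ Component f v u → switchedMap u p ≡ f u p
      switched-off u p ∉C with component? u
      ... | yes inC = contradiction inC ∉C
      ... | no _    = refl

      switched-proper : Proper G W k switchedMap
      switched-proper u w pu pw adj eq = cases (component? u) (component? w)
        where
        OneOf-on : ∀ {x} (px : x ∈ W) → Component f v x → OneOf i j (f x px)
        OneOf-on px inC = OneOf-irrelevant f _ px (proj₂ (component-OneOf inC))
        cases : Dec (Component f v u) → Dec (Component f v w) → ⊥
        cases (yes inU) (yes inW) = proj₂ c u w pu pw adj (begin
          f u pu               ≡⟨ swap-involutive (OneOf-on pu inU) ⟨
          swap (swap (f u pu)) ≡⟨ cong swap (trans (sym (switched-on u pu inU)) (trans eq (switched-on w pw inW))) ⟩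
          swap (swap (f w pw)) ≡⟨ swap-involutive (OneOf-on pw inW) ⟩
          f w pw               ∎)
          where open ≡-Reasoning
        cases (no ∉U) (no ∉W) =
          proj₂ c u w pu pw adj (trans (sym (switched-off u pu ∉U)) (trans eq (switched-off w pw ∉W)))
        cases (yes inU) (no ∉W) = ∉W (step inU adj (pw , fw))
          where
          fw : OneOf i j (f w pw)
          fw = subst (OneOf i j) (trans (sym (switched-on u pu inU)) (trans eq (switched-off w pw ∉W)))
                     (swapCol-OneOf {G = G} {W = W} (OneOf-on pu inU))
        cases (no ∉U) (yes inW) = ∉U (step inW (adj-sym G adj) (pu , fu))
          where
          fu : OneOf i j (f u pu)
          fu = subst (OneOf i j) (trans (sym (switched-on w pw inW)) (trans (sym eq) (switched-off u pu ∉U)))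
                     (swapCol-OneOf {G = G} {W = W} (OneOf-on pw inW))

      switched : Coloring G W k
      switched = switchedMap , switched-proper

      Kempe-switched : KempeEq G W k c switched
      Kempe-switched = EqC.return (switch (i , j , i<j , v , (pv , cv) , λ u p → switched-on u p , switched-off u p))

    private
      swap-on-component : ∀ (c c₂ : Coloring G W k) → AgreeOutside i j (proj₁ c) (proj₁ c₂) →
                          ∀ {v} (pv : v ∈ W) → proj₁ c v pv ≢ proj₁ c₂ v pv →
                          ∀ {u} → Component (proj₁ c) v u → ∀ pu → proj₁ c₂ u pu ≡ swap (proj₁ c u pu)
      swap-on-component c c₂ agree pv cv≢c₂v (here (_ , cv)) pu with ∈-irrelevant pv pu | agree _ pu
      ... | refl | inj₁ cv≡c₂v    = contradiction cv≡c₂v cv≢c₂v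
      ... | refl | inj₂ (_ , c₂v) = OneOf-≢⇒swap (OneOf-irrelevant (proj₁ c) _ pu cv) c₂v cv≢c₂v
      swap-on-component c c₂ agree pv cv≢c₂v {w} (step {u} path adj (_ , cw)) pw = begin
        g w pw               ≡⟨ OneOf-≢⇒swap g-u g-w (proj₂ c₂ u w pu pw adj) ⟩
        swap (g u pu)        ≡⟨ cong swap (swap-on-component c c₂ agree pv cv≢c₂v path pu) ⟩
        swap (swap (f u pu)) ≡⟨ swap-involutive f-u ⟩
        f u pu               ≡⟨ swap-involutive f-u ⟨
        swap (swap (f u pu)) ≡⟨ cong swap (OneOf-≢⇒swap f-u f-w (proj₂ c u w pu pw adj)) ⟨
        swap (f w pw)        ∎
        where
        open ≡-Reasoning
        f = proj₁ c
        g = proj₁ c₂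
        pu = proj₁ (component-OneOf path)
        f-u : OneOf i j (f u pu)
        f-u = proj₂ (component-OneOf path)
        f-w : OneOf i j (f w pw)
        f-w = OneOf-irrelevant f _ pw cw
        g-u : OneOf i j (g u pu)
        g-u = AgreeOutside-OneOf agree u pu f-u
        g-w : OneOf i j (g w pw)
        g-w = AgreeOutside-OneOf agree w pw f-w

      Progress : Coloring G W k → Coloring G W k → List (Fin d) → Set
      Progress a b L = Σ (Coloring G W k) λ c → KempeEq G W k a c × AgreeOutside i j (proj₁ c) (proj₁ b)
                         × All (λ u → ∀ p → proj₁ c u p ≡ proj₁ b u p) L

      progress-∷ : ∀ a b v {L} → Progress a b L → ¬ ¬ Progress a b (v ∷ L)
      progress-∷ a b v (c , a~c , agree , fixed) with v ∈? W
      ... | no v∉W = return (c , a~c , agree , (λ p → contradiction p v∉W) ∷ fixed)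
      ... | yes pv with proj₁ c v pv Fin.≟ proj₁ b v pv
      ...   | yes cv≡bv = return (c , a~c , agree , (λ p → subst (λ p → proj₁ c v p ≡ proj₁ b v p) (∈-irrelevant pv p) cv≡bv) ∷ fixed)
      ...   | no cv≢bv  = ¬¬-map switchAt (¬¬-Π-Fin d λ _ → ¬¬-excluded-middle)
        where
        cv : OneOf i j (proj₁ c v pv)
        cv with agree v pv
        ... | inj₁ cv≡bv   = contradiction cv≡bv cv≢bv
        ... | inj₂ (cv , _) = cv
        switchAt : (∀ u → Dec (Component (proj₁ c) v u)) → Progress a b (v ∷ _)
        switchAt component? = switched , Kempe-trans a~c Kempe-switched , agree′ , fixed-v ∷ All.map keep fixed
          where
          open Switching c v pv cv component?
          flipped : ∀ {u} → Component (proj₁ c) v u → ∀ pu → proj₁ b u pu ≡ swap (proj₁ c u pu)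
          flipped = swap-on-component c b agree pv cv≢bv
          agree′ : AgreeOutside i j switchedMap (proj₁ b)
          agree′ u p with component? u
          ... | yes inC = inj₁ (sym (flipped inC p))
          ... | no _    = agree u p
          fixed-v : ∀ p → switchedMap v p ≡ proj₁ b v p
          fixed-v p = trans (switched-on v p (here (pv , cv))) (sym (flipped (here (pv , cv)) p))
          keep : ∀ {u} → (∀ p → proj₁ c u p ≡ proj₁ b u p) → ∀ p → switchedMap u p ≡ proj₁ b u p
          keep {u} c≡b p with component? u
          ... | yes inC = contradiction (sym (trans (c≡b p) (flipped inC p)))
                            (swap-≢ (OneOf-irrelevant (proj₁ c) _ p (proj₂ (component-OneOf inC))))
          ... | no _    = c≡b p

      progress : ∀ a b → AgreeOutside i j (proj₁ a) (proj₁ b) → ∀ L → ¬ ¬ Progress a b L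
      progress a b agree []      = return (a , Kempe-refl , agree , [])
      progress a b agree (v ∷ L) = progress a b agree L >>= progress-∷ a b v

    -- Fix the vertices one at a time: where c and b still differ at v, b is c with the {i, j}-component
    -- of v swapped, so switching that component fixes v without disturbing the vertices fixed before.
    AgreeOutside⇒¬¬Kempe : ∀ (a b : Coloring G W k) → AgreeOutside i j (proj₁ a) (proj₁ b) → ¬ ¬ KempeEq G W k a b
    AgreeOutside⇒¬¬Kempe a b agree = ¬¬-map finish (progress a b agree (List.allFin d))
      where
      finish : Progress a b (List.allFin d) → KempeEq G W k a b
      finish (c , a~c , _ , fixed) = Kempe-trans a~c (pointwise⇒Kempe c b λ u → All.lookup fixed (∈-allFin u))

module LinearAlgebra {c ℓ : Level} (F : Field c ℓ) where

  open import Level using (Level; _⊔_)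
  open import Function using (_∘_)
  open import Data.Nat as ℕ using (ℕ; zero; suc; _<_; s≤s)
  import Data.Nat.Properties as ℕ
  open import Data.Fin as Fin using (Fin; punchIn; punchOut)
  import Data.Fin.Properties as Fin
  open import Data.Product using (Σ; ∃; _×_; _,_)
  open import Relation.Nullary using (¬_; Dec; yes; no; contradiction; ¬¬-map)
  open import Relation.Nullary.Decidable using (¬¬-excluded-middle)
  import Relation.Binary.PropositionalEquality as ≡
  open ≡ using (_≡_)
  import Relation.Binary.Reasoning.Setoid as SetoidReasoning
  import Algebra.Properties.Semiring.Sum as SemiringSum
  open Classical using (_>>=_; return; ¬¬-Π-Fin)

  open Field F
  open SemiringSum semiring using (sum; sum-cong-≋; sum-remove; ∑-comm; ∑-distrib-+; *-distribˡ-sum; *-distribʳ-sum)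
  open import Algebra.Properties.Ring ring using (-‿distribˡ-*; -‿distribʳ-*; -‿+-comm; -0#≈0#; x∙y⁻¹≈ε⇒x≈y)
  open SetoidReasoning setoid

  sum-0 : ∀ {n} (x : Fin n → Carrier) → (∀ j → x j ≈ 0#) → sum x ≈ 0#
  sum-0 {zero}  x x≈0 = refl
  sum-0 {suc n} x x≈0 = trans (+-cong (x≈0 Fin.zero) (sum-0 (x ∘ Fin.suc) (x≈0 ∘ Fin.suc))) (+-identityˡ 0#)

  sum-neg : ∀ {n} (x : Fin n → Carrier) → sum (λ j → - x j) ≈ - sum x
  sum-neg {zero}  x = sym -0#≈0#
  sum-neg {suc n} x = trans (+-congˡ (sum-neg (x ∘ Fin.suc))) (-‿+-comm _ _)

  bilinear-0 : ∀ {m n} (B : Fin m → Fin n → Carrier) (x : Fin m → Carrier) (β : Fin n → Carrier) →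
               (∀ i → sum (λ j → B j i * x j) ≈ 0#) → sum (λ j → x j * sum (λ i → B j i * β i)) ≈ 0#
  bilinear-0 B x β xB≈0 = begin
    sum (λ j → x j * sum (λ i → B j i * β i))       ≈⟨ sum-cong-≋ (λ j → *-distribˡ-sum (x j) (λ i → B j i * β i)) ⟩
    sum (λ j → sum (λ i → x j * (B j i * β i)))     ≈⟨ ∑-comm (λ j i → x j * (B j i * β i)) ⟩
    sum (λ i → sum (λ j → x j * (B j i * β i)))     ≈⟨ sum-cong-≋ (λ i → sum-cong-≋ λ j →
                                                         trans (sym (*-assoc (x j) (B j i) (β i))) (*-congʳ (*-comm (x j) (B j i)))) ⟩
    sum (λ i → sum (λ j → (B j i * x j) * β i))     ≈⟨ sum-cong-≋ (λ i → *-distribʳ-sum (β i) (λ j → B j i * x j)) ⟨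
    sum (λ i → sum (λ j → B j i * x j) * β i)       ≈⟨ sum-0 _ (λ i → trans (*-congʳ (xB≈0 i)) (zeroˡ (β i))) ⟩
    0#                                              ∎

  NontrivialSolution : ∀ {m n} → (Fin m → Fin n → Carrier) → Set (c ⊔ ℓ)
  NontrivialSolution {n = n} A = Σ (Fin n → Carrier) λ x → (∃ λ j → ¬ x j ≈ 0#) × (∀ i → sum (λ j → A i j * x j) ≈ 0#)

  -- Eliminating the unknown p with the first row, whose entry at p has inverse y.
  module Elimination {m n} (A : Fin (suc m) → Fin (suc n) → Carrier) (p : Fin (suc n))
                     (y : Carrier) (Ay≈1 : A Fin.zero p * y ≈ 1#) where

    reduced : Fin m → Fin n → Carrier
    reduced i l = A (Fin.suc i) (punchIn p l) - (A (Fin.suc i) p * y) * A Fin.zero (punchIn p l)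

    module _ (x′ : Fin n → Carrier) where

      private
        r : Fin n → Carrier
        r l = A Fin.zero (punchIn p l)

        S : Carrier
        S = sum (λ l → r l * x′ l)

      extended : Fin (suc n) → Carrier
      extended j with p Fin.≟ j
      ... | yes _  = - (y * S)
      ... | no p≢j = x′ (punchOut p≢j)

      private
        extended-p : extended p ≡ - (y * S)
        extended-p with p Fin.≟ p
        ... | yes _  = ≡.refl
        ... | no p≢p = contradiction ≡.refl p≢p

      extended-punchIn : ∀ l → extended (punchIn p l) ≡ x′ l
      extended-punchIn l with p Fin.≟ punchIn p l
      ... | yes p≡ = contradiction (≡.sym p≡) (Fin.punchInᵢ≢i p l)
      ... | no _   = ≡.cong x′ (≡.trans (Fin.punchOut-cong p ≡.refl) (Fin.punchOut-punchIn p))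

      private
        split : ∀ (B : Fin (suc n) → Carrier) → sum (λ j → B j * extended j) ≈ B p * - (y * S) + sum (λ l → B (punchIn p l) * x′ l)
        split B = trans (sum-remove {i = p} (λ j → B j * extended j))
                        (+-cong (reflexive (≡.cong (B p *_) extended-p))
                                (sum-cong-≋ λ l → reflexive (≡.cong (B (punchIn p l) *_) (extended-punchIn l))))

        times-pivot : ∀ K → K * - (y * S) ≈ - ((K * y) * S)
        times-pivot K = trans (sym (-‿distribʳ-* K (y * S))) (-‿cong (sym (*-assoc K y S)))

      extended-row₀ : sum (λ j → A Fin.zero j * extended j) ≈ 0#
      extended-row₀ = begin
        sum (λ j → A Fin.zero j * extended j)     ≈⟨ split (A Fin.zero) ⟩
        A Fin.zero p * - (y * S) + S              ≈⟨ +-congʳ (times-pivot (A Fin.zero p)) ⟩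
        - ((A Fin.zero p * y) * S) + S            ≈⟨ +-congʳ (-‿cong (trans (*-congʳ Ay≈1) (*-identityˡ S))) ⟩
        - S + S                                   ≈⟨ -‿inverseˡ S ⟩
        0#                                        ∎

      extended-row : ∀ i → sum (λ l → reduced i l * x′ l) ≈ 0# → sum (λ j → A (Fin.suc i) j * extended j) ≈ 0#
      extended-row i reduced-row = begin
        sum (λ j → A (Fin.suc i) j * extended j)  ≈⟨ split (A (Fin.suc i)) ⟩
        A (Fin.suc i) p * - (y * S) + X           ≈⟨ +-congʳ (times-pivot (A (Fin.suc i) p)) ⟩
        - (K * S) + X                             ≈⟨ +-congˡ (x∙y⁻¹≈ε⇒x≈y X (K * S) X-KS≈0) ⟩
        - (K * S) + K * S                         ≈⟨ -‿inverseˡ (K * S) ⟩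
        0#                                        ∎
        where
        K = A (Fin.suc i) p * y
        X = sum (λ l → A (Fin.suc i) (punchIn p l) * x′ l)
        X-KS≈0 : X - K * S ≈ 0#
        X-KS≈0 = begin
          X - K * S                                                          ≈⟨ +-congˡ (-‿cong (*-distribˡ-sum K (λ l → r l * x′ l))) ⟩
          X - sum (λ l → K * (r l * x′ l))                                   ≈⟨ +-congˡ (sum-neg (λ l → K * (r l * x′ l))) ⟨
          X + sum (λ l → - (K * (r l * x′ l)))                               ≈⟨ ∑-distrib-+ (λ l → A (Fin.suc i) (punchIn p l) * x′ l) _ ⟨
          sum (λ l → A (Fin.suc i) (punchIn p l) * x′ l + - (K * (r l * x′ l)))
            ≈⟨ sum-cong-≋ (λ l → +-congˡ (trans (-‿cong (sym (*-assoc K (r l) (x′ l)))) (-‿distribˡ-* (K * r l) (x′ l)))) ⟩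
          sum (λ l → A (Fin.suc i) (punchIn p l) * x′ l + (- (K * r l)) * x′ l)
            ≈⟨ sum-cong-≋ (λ l → sym (distribʳ (x′ l) _ _)) ⟩
          sum (λ l → reduced i l * x′ l)                                     ≈⟨ reduced-row ⟩
          0#                                                                 ∎

    extend : NontrivialSolution reduced → NontrivialSolution A
    extend (x′ , (l₀ , x′l₀≉0) , rows) =
      extended x′ , (punchIn p l₀ , x′l₀≉0 ∘ ≡.subst (_≈ 0#) (extended-punchIn x′ l₀)) , λ
        { Fin.zero    → extended-row₀ x′
        ; (Fin.suc i) → extended-row x′ i (rows i) }

  underdetermined⇒¬¬solution : ∀ m n → m < n → (A : Fin m → Fin n → Carrier) → ¬ ¬ NontrivialSolution A
  underdetermined⇒¬¬solution zero    (suc n) _         A = return ((λ _ → 1#) , (Fin.zero , λ 1≈0 → 0≉1 (sym 1≈0)) , λ ())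
  underdetermined⇒¬¬solution (suc m) (suc n) (s≤s m<n) A = do
    row₀? ← ¬¬-Π-Fin (suc n) (λ j → ¬¬-excluded-middle {A = A Fin.zero j ≈ 0#})
    byPivot row₀? (Fin.all? row₀?)
    where
    byPivot : (∀ j → Dec (A Fin.zero j ≈ 0#)) → Dec (∀ j → A Fin.zero j ≈ 0#) → ¬ ¬ NontrivialSolution A
    byPivot _ (yes row₀≈0) = ¬¬-map extend (underdetermined⇒¬¬solution m (suc n) (ℕ.m≤n⇒m≤1+n m<n) (A ∘ Fin.suc))
      where
      extend : NontrivialSolution (A ∘ Fin.suc) → NontrivialSolution A
      extend (x , x≢0 , rows) = x , x≢0 , λ
        { Fin.zero    → sum-0 (λ j → A Fin.zero j * x j) λ j → trans (*-congʳ (row₀≈0 j)) (zeroˡ (x j))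
        ; (Fin.suc i) → rows i }
    byPivot row₀? (no row₀≉0) =
      let p , A₀p≉0 = Fin.¬∀⟶∃¬ (suc n) _ row₀? row₀≉0
          y , A₀p*y≈1 = inverse (A Fin.zero p) A₀p≉0
      in ¬¬-map (Elimination.extend A p y A₀p*y≈1) (underdetermined⇒¬¬solution m n m<n (Elimination.reduced A p y A₀p*y≈1))

module Polynomials {c ℓ : Level} (F : Field c ℓ) {d : ℕ} (G : Graph d) where

  open import Level using (Level; _⊔_)
  open import Function using (_∘_)
  open import Data.Nat as ℕ using (ℕ; zero; suc; _≡ᵇ_)
  import Data.Nat.Properties as ℕ
  open import Data.Bool using (Bool; true; false; if_then_else_; _∧_)
  import Data.Bool.Properties as Bool
  open import Function.Bundles using (Equivalence)
  open import Data.Fin as Fin using (Fin)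
  open import Data.Fin.Subset using (Subset; _⊆_; _∩_; Nonempty)
  open import Data.List as List using (List; []; _∷_; _++_; map; tabulate)
  import Data.List.Properties as List
  open import Data.List.Relation.Unary.All as All using (All; []; _∷_)
  import Data.List.Relation.Unary.All.Properties as All
  open import Data.List.Relation.Binary.Pointwise using (Pointwise; []; _∷_)
  open import Data.Product using (_×_; _,_; proj₁; proj₂)
  open import Relation.Nullary using (Dec; yes; no; does; contradiction)
  import Relation.Binary.PropositionalEquality as ≡
  open ≡ using (_≡_; _≢_)
  open import Relation.Binary.Structures using (IsEquivalence)
  import Relation.Binary.Reasoning.Setoid as SetoidReasoning
  import Algebra.Properties.Ring as RingProperties
  import Algebra.Properties.CommutativeMonoid.Sum as CommutativeMonoidSum
  open Multisets
  open Colorings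

  open Field F
  open PolyRing F G using (Mon; Poly; sameMon; coeff; _≈P_; _+P_; -P_; _-P_; _*P_; _·P_; 0P; monomial; sumP;
                           InR; Homog; xf; Gen; jgen; mgen; InK; lincomb)
  open RingProperties ring public using (-0#≈0#; -‿+-comm; -1*x≈-x; ⁻¹-anti-homo‿-; x∙y⁻¹≈ε⇒x≈y; x[y-z]≈xy-xz)
  open CommutativeMonoidSum +-commutativeMonoid public using (sum; sum-cong-≋; ∑-distrib-+)
  open LinearAlgebra F using (sum-0)
  open SetoidReasoning setoid

  private
    foldr-∧-true⁻ : ∀ (P : Subset d → Bool) L → List.foldr (λ S b → P S ∧ b) true L ≡ true →
                    ∀ S → count S L ≢ 0 → P S ≡ true
    foldr-∧-true⁻ P []      _  S S∉L = contradiction ≡.refl S∉L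
    foldr-∧-true⁻ P (T ∷ L) eq S S∈L with P T in PT | T ≟S S
    ... | true  | yes ≡.refl = PT
    ... | true  | no _       = foldr-∧-true⁻ P L eq S S∈L
    ... | false | _          with () ← eq

    foldr-∧-true⁺ : ∀ (P : Subset d → Bool) L → (∀ S → P S ≡ true) → List.foldr (λ S b → P S ∧ b) true L ≡ true
    foldr-∧-true⁺ P []      _   = ≡.refl
    foldr-∧-true⁺ P (T ∷ L) all rewrite all T = foldr-∧-true⁺ P L all

    ≡true⇔⇒≡ : ∀ {b b′} → (b ≡ true → b′ ≡ true) → (b′ ≡ true → b ≡ true) → b ≡ b′
    ≡true⇔⇒≡ {true}  {_}     to _    = ≡.sym (to ≡.refl)
    ≡true⇔⇒≡ {false} {true}  _  from with () ← from ≡.refl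
    ≡true⇔⇒≡ {false} {false} _  _    = ≡.refl

  sameMon-complete : ∀ {m m′} → m ∼ m′ → sameMon m m′ ≡ true
  sameMon-complete {m} {m′} e = foldr-∧-true⁺ _ (m ++ m′) λ S → Equivalence.to Bool.T-≡ (ℕ.≡⇒≡ᵇ _ _ (count-≡ e S))

  sameMon-sound : ∀ m m′ → sameMon m m′ ≡ true → m ∼ m′
  sameMon-sound m m′ eq = mk∼ λ S → counts S (count S m ℕ.≟ 0) (count S m′ ℕ.≟ 0)
    where
    occurring : ∀ S → count S (m ++ m′) ≢ 0 → count S m ≡ count S m′
    occurring S S∈ = ℕ.≡ᵇ⇒≡ _ _ (Equivalence.from Bool.T-≡ (foldr-∧-true⁻ _ (m ++ m′) eq S S∈))
    counts : ∀ S → Dec (count S m ≡ 0) → Dec (count S m′ ≡ 0) → count S m ≡ count S m′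
    counts S (yes m₀) (yes m′₀) = ≡.trans m₀ (≡.sym m′₀)
    counts S (no m≢0) _         = occurring S (m≢0 ∘ ℕ.m+n≡0⇒m≡0 _ ∘ ≡.trans (≡.sym (count-++ S m m′)))
    counts S (yes _)  (no m′≢0) = occurring S (m′≢0 ∘ ℕ.m+n≡0⇒n≡0 (count S m) ∘ ≡.trans (≡.sym (count-++ S m m′)))

  sameMon-∼ˡ : ∀ {m m′} → m ∼ m′ → ∀ x → sameMon m x ≡ sameMon m′ x
  sameMon-∼ˡ {m} {m′} e x = ≡true⇔⇒≡ (λ t → sameMon-complete (∼-trans (∼-sym e) (sameMon-sound m x t)))
                                     (λ t → sameMon-complete (∼-trans e (sameMon-sound m′ x t)))

  sameMon-∼ʳ : ∀ {m m′} → m ∼ m′ → ∀ x → sameMon x m ≡ sameMon x m′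
  sameMon-∼ʳ {m} {m′} e x = ≡true⇔⇒≡ (λ t → sameMon-complete (∼-trans (sameMon-sound x m t) e))
                                     (λ t → sameMon-complete (∼-trans (sameMon-sound x m′ t) (∼-sym e)))

  infix 8 [_]·_

  [_]·_ : Bool → Carrier → Carrier
  [ b ]· a = if b then a else 0#

  []·-cong : ∀ b {x y} → x ≈ y → [ b ]· x ≈ [ b ]· y
  []·-cong true  x≈y = x≈y
  []·-cong false _   = refl

  []·-+ : ∀ b x y → [ b ]· (x + y) ≈ [ b ]· x + [ b ]· y
  []·-+ true  x y = refl
  []·-+ false x y = sym (+-identityˡ 0#)

  []·-neg : ∀ b a → [ b ]· (- a) ≈ - [ b ]· a
  []·-neg true  a = refl
  []·-neg false a = sym -0#≈0#

  []·-*ˡ : ∀ b a x → [ b ]· (a * x) ≈ a * [ b ]· x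
  []·-*ˡ true  a x = refl
  []·-*ˡ false a x = sym (zeroʳ a)

  []·-*ʳ : ∀ b x y → [ b ]· x * y ≈ [ b ]· (x * y)
  []·-*ʳ true  x y = refl
  []·-*ʳ false x y = zeroˡ y

  []·-0 : ∀ b {x} → x ≈ 0# → [ b ]· x ≈ 0#
  []·-0 true  x≈0 = x≈0
  []·-0 false _   = refl

  coeff-∷ : ∀ a m′ p m → coeff ((a , m′) ∷ p) m ≈ [ sameMon m′ m ]· a + coeff p m
  coeff-∷ a m′ p m with sameMon m′ m
  ... | true  = refl
  ... | false = sym (+-identityˡ _)

  coeff-++ : ∀ p q m → coeff (p ++ q) m ≈ coeff p m + coeff q m
  coeff-++ []             q m = sym (+-identityˡ _)
  coeff-++ ((a , m′) ∷ p) q m = begin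
    coeff ((a , m′) ∷ p ++ q) m                       ≈⟨ coeff-∷ a m′ (p ++ q) m ⟩
    [ sameMon m′ m ]· a + coeff (p ++ q) m            ≈⟨ +-congˡ (coeff-++ p q m) ⟩
    [ sameMon m′ m ]· a + (coeff p m + coeff q m)     ≈⟨ +-assoc _ _ _ ⟨
    [ sameMon m′ m ]· a + coeff p m + coeff q m       ≈⟨ +-congʳ (coeff-∷ a m′ p m) ⟨
    coeff ((a , m′) ∷ p) m + coeff q m                ∎

  coeff-neg : ∀ p m → coeff (-P p) m ≈ - coeff p m
  coeff-neg []             m = sym -0#≈0#
  coeff-neg ((a , m′) ∷ p) m = begin
    coeff ((- a , m′) ∷ -P p) m                    ≈⟨ coeff-∷ (- a) m′ (-P p) m ⟩
    [ sameMon m′ m ]· (- a) + coeff (-P p) m       ≈⟨ +-cong ([]·-neg (sameMon m′ m) a) (coeff-neg p m) ⟩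
    - [ sameMon m′ m ]· a + - coeff p m            ≈⟨ -‿+-comm _ _ ⟩
    - ([ sameMon m′ m ]· a + coeff p m)            ≈⟨ -‿cong (coeff-∷ a m′ p m) ⟨
    - coeff ((a , m′) ∷ p) m                       ∎

  coeff-sub : ∀ p q m → coeff (p -P q) m ≈ coeff p m - coeff q m
  coeff-sub p q m = trans (coeff-++ p (-P q) m) (+-congˡ (coeff-neg q m))

  coeff-scale : ∀ a p m → coeff (a ·P p) m ≈ a * coeff p m
  coeff-scale a []             m = sym (zeroʳ a)
  coeff-scale a ((b , m′) ∷ p) m = begin
    coeff ((a * b , m′) ∷ a ·P p) m                ≈⟨ coeff-∷ (a * b) m′ (a ·P p) m ⟩
    [ sameMon m′ m ]· (a * b) + coeff (a ·P p) m   ≈⟨ +-cong ([]·-*ˡ (sameMon m′ m) a b) (coeff-scale a p m) ⟩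
    a * [ sameMon m′ m ]· b + a * coeff p m        ≈⟨ distribˡ _ _ _ ⟨
    a * ([ sameMon m′ m ]· b + coeff p m)          ≈⟨ *-congˡ (coeff-∷ b m′ p m) ⟨
    a * coeff ((b , m′) ∷ p) m                     ∎

  termMul : Carrier → Mon → Poly → Poly
  termMul b m₀ = map (λ s → (b * proj₁ s) , (m₀ ++ proj₂ s))

  private

    coeff-termMul-* : ∀ a b m₀ g m → coeff (termMul (a * b) m₀ g) m ≈ a * coeff (termMul b m₀ g) m
    coeff-termMul-* a b m₀ []             m = sym (zeroʳ a)
    coeff-termMul-* a b m₀ ((e , m′) ∷ g) m = begin
      coeff (termMul (a * b) m₀ ((e , m′) ∷ g)) m                ≈⟨ coeff-∷ (a * b * e) (m₀ ++ m′) (termMul (a * b) m₀ g) m ⟩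
      [ s ]· (a * b * e) + coeff (termMul (a * b) m₀ g) m        ≈⟨ +-cong ([]·-cong s (*-assoc a b e)) (coeff-termMul-* a b m₀ g m) ⟩
      [ s ]· (a * (b * e)) + a * coeff (termMul b m₀ g) m        ≈⟨ +-congʳ ([]·-*ˡ s a (b * e)) ⟩
      a * [ s ]· (b * e) + a * coeff (termMul b m₀ g) m          ≈⟨ distribˡ _ _ _ ⟨
      a * ([ s ]· (b * e) + coeff (termMul b m₀ g) m)            ≈⟨ *-congˡ (coeff-∷ (b * e) (m₀ ++ m′) (termMul b m₀ g) m) ⟨
      a * coeff (termMul b m₀ ((e , m′) ∷ g)) m                  ∎
      where s = sameMon (m₀ ++ m′) m

  coeff-scale-*P : ∀ a r g m → coeff ((a ·P r) *P g) m ≈ a * coeff (r *P g) m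
  coeff-scale-*P a []             g m = sym (zeroʳ a)
  coeff-scale-*P a ((b , m₀) ∷ r) g m = begin
    coeff (termMul (a * b) m₀ g ++ (a ·P r) *P g) m              ≈⟨ coeff-++ (termMul (a * b) m₀ g) _ m ⟩
    coeff (termMul (a * b) m₀ g) m + coeff ((a ·P r) *P g) m     ≈⟨ +-cong (coeff-termMul-* a b m₀ g m) (coeff-scale-*P a r g m) ⟩
    a * coeff (termMul b m₀ g) m + a * coeff (r *P g) m          ≈⟨ distribˡ _ _ _ ⟨
    a * (coeff (termMul b m₀ g) m + coeff (r *P g) m)            ≈⟨ *-congˡ (coeff-++ (termMul b m₀ g) _ m) ⟨
    a * coeff (((b , m₀) ∷ r) *P g) m                        ∎

  _≈ₜ_ : Carrier × Mon → Carrier × Mon → Set ℓ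
  (a , m) ≈ₜ (b , m′) = a ≈ b × m ∼ m′

  termwise⇒≈P : ∀ {p q} → Pointwise _≈ₜ_ p q → p ≈P q
  termwise⇒≈P []                                          m = refl
  termwise⇒≈P (_∷_ {a , m₁} {b , m₂} {p} {q} (a≈b , e) ps) m = begin
    coeff ((a , m₁) ∷ p) m               ≈⟨ coeff-∷ a m₁ p m ⟩
    [ sameMon m₁ m ]· a + coeff p m      ≈⟨ +-cong ([]·-cong (sameMon m₁ m) a≈b) (termwise⇒≈P ps m) ⟩
    [ sameMon m₁ m ]· b + coeff q m      ≡⟨ ≡.cong (λ s → [ s ]· b + coeff q m) (sameMon-∼ˡ e m) ⟩
    [ sameMon m₂ m ]· b + coeff q m      ≈⟨ coeff-∷ b m₂ q m ⟨
    coeff ((b , m₂) ∷ q) m               ∎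

  coeff-sumP-tabulate : ∀ {n} (p : Fin n → Poly) m → coeff (sumP (tabulate p)) m ≈ sum (λ i → coeff (p i) m)
  coeff-sumP-tabulate {zero}  p m = refl
  coeff-sumP-tabulate {suc n} p m = trans (coeff-++ (p Fin.zero) _ m) (+-congˡ (coeff-sumP-tabulate (p ∘ Fin.suc) m))

  lincomb-tabulate : ∀ {n} (a : Fin n → Carrier) (b : Fin n → Poly) → lincomb a b ≡ sumP (tabulate (λ i → a i ·P b i))
  lincomb-tabulate a b = ≡.cong sumP (List.map-tabulate (λ i → i) (λ i → a i ·P b i))

  coeff-lincomb : ∀ {n} (a : Fin n → Carrier) (b : Fin n → Poly) m → coeff (lincomb a b) m ≈ sum (λ i → a i * coeff (b i) m)
  coeff-lincomb a b m rewrite lincomb-tabulate a b =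
    trans (coeff-sumP-tabulate (λ i → a i ·P b i) m) (sum-cong-≋ (λ i → coeff-scale (a i) (b i) m))

  combination : List (Poly × Poly) → Poly
  combination rs = sumP (map (λ rg → proj₁ rg *P proj₂ rg) rs)

  binomial : Mon → Mon → Poly
  binomial m₁ m₂ = monomial m₁ -P monomial m₂

  coeff-binomial : ∀ m₁ m₂ m → coeff (binomial m₁ m₂) m ≈ coeff (monomial m₁) m - coeff (monomial m₂) m
  coeff-binomial m₁ m₂ = coeff-sub (monomial m₁) (monomial m₂)

  coeff-combination-++ : ∀ rs rs′ m → coeff (combination (rs ++ rs′)) m ≈ coeff (combination rs) m + coeff (combination rs′) m
  coeff-combination-++ []              rs′ m = sym (+-identityˡ _)
  coeff-combination-++ ((r , g) ∷ rs) rs′ m = begin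
    coeff (r *P g ++ combination (rs ++ rs′)) m                                 ≈⟨ coeff-++ (r *P g) _ m ⟩
    coeff (r *P g) m + coeff (combination (rs ++ rs′)) m                         ≈⟨ +-congˡ (coeff-combination-++ rs rs′ m) ⟩
    coeff (r *P g) m + (coeff (combination rs) m + coeff (combination rs′) m)   ≈⟨ +-assoc _ _ _ ⟨
    coeff (r *P g) m + coeff (combination rs) m + coeff (combination rs′) m     ≈⟨ +-congʳ (coeff-++ (r *P g) _ m) ⟨
    coeff (combination ((r , g) ∷ rs)) m + coeff (combination rs′) m            ∎

  coeff-combination-scale : ∀ a rs m → coeff (combination (map (λ rg → (a ·P proj₁ rg) , proj₂ rg) rs)) m
                                        ≈ a * coeff (combination rs) m
  coeff-combination-scale a []              m = sym (zeroʳ a)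
  coeff-combination-scale a ((r , g) ∷ rs) m = begin
    coeff ((a ·P r) *P g ++ combination as) m                  ≈⟨ coeff-++ ((a ·P r) *P g) _ m ⟩
    coeff ((a ·P r) *P g) m + coeff (combination as) m         ≈⟨ +-cong (coeff-scale-*P a r g m) (coeff-combination-scale a rs m) ⟩
    a * coeff (r *P g) m + a * coeff (combination rs) m        ≈⟨ distribˡ _ _ _ ⟨
    a * (coeff (r *P g) m + coeff (combination rs) m)          ≈⟨ *-congˡ (coeff-++ (r *P g) _ m) ⟨
    a * coeff (combination ((r , g) ∷ rs)) m                   ∎
    where as = map (λ rg → (a ·P proj₁ rg) , proj₂ rg) rs

  module _ {W : Subset d} where

    InR-++ : ∀ {p q} → InR W p → InR W q → InR W (p ++ q)
    InR-++ = All.++⁺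

    InR-neg : ∀ {p} → InR W p → InR W (-P p)
    InR-neg = All.map⁺

    InR-scale : ∀ a {p} → InR W p → InR W (a ·P p)
    InR-scale a = All.map⁺

    InR-*P : ∀ {r g} → InR W r → InR W g → InR W (r *P g)
    InR-*P []          _  = []
    InR-*P (m₀ ∷ r) g = InR-++ (All.map⁺ (All.map (All.++⁺ m₀) g)) (InR-*P r g)

    InR-monomial : ∀ {m} → All (Stable G W) m → InR W (monomial m)
    InR-monomial m = m ∷ []

    InR-Gen : ∀ {g} → Gen W g → InR W g
    InR-Gen (jgen U U⊆W f g) = classes f ∷ classes g ∷ []
      where
      classes : (h : Coloring G U 2) → All (Stable G W) (xf (proj₁ h))
      classes h = stable h Fin.zero ∷ stable h (Fin.suc Fin.zero) ∷ []
        where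
        stable : ∀ (h : Coloring G U 2) b → Stable G W (preimage U (proj₁ h) b)
        stable h b = let U-stable = preimage-stable G h b in U⊆W ∘ proj₁ U-stable , proj₂ U-stable
    InR-Gen (mgen S T sS sT _) = (sS ∷ sT ∷ []) ∷ []

    InR-combination : ∀ {rs} → All (λ rg → InR W (proj₁ rg) × Gen W (proj₂ rg)) rs → InR W (combination rs)
    InR-combination []               = []
    InR-combination ((r , g) ∷ rgs) = InR-++ (InR-*P r (InR-Gen g)) (InR-combination rgs)

    InK-resp : ∀ p q → p ≈P q → InK W q → InK W p
    InK-resp _ _ p≈q (rs , rgs , q≈rs) = rs , rgs , λ m → trans (p≈q m) (q≈rs m)

    InK-zero : ∀ p → p ≈P 0P → InK W p
    InK-zero _ p≈0 = [] , [] , p≈0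

    InK-+ : ∀ p q → InK W p → InK W q → InK W (p +P q)
    InK-+ p q (rs , rgs , p≈rs) (rs′ , rgs′ , q≈rs′) = rs ++ rs′ , All.++⁺ rgs rgs′ , λ m → begin
      coeff (p ++ q) m                                            ≈⟨ coeff-++ p q m ⟩
      coeff p m + coeff q m                                       ≈⟨ +-cong (p≈rs m) (q≈rs′ m) ⟩
      coeff (combination rs) m + coeff (combination rs′) m        ≈⟨ coeff-combination-++ rs rs′ m ⟨
      coeff (combination (rs ++ rs′)) m                           ∎

    InK-scale : ∀ a p → InK W p → InK W (a ·P p)
    InK-scale a p (rs , rgs , p≈rs) = map (λ rg → (a ·P proj₁ rg) , proj₂ rg) rs
                                      , All.map⁺ (All.map (λ (r , g) → InR-scale a r , g) rgs) , λ m → begin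
      coeff (a ·P p) m                  ≈⟨ coeff-scale a p m ⟩
      a * coeff p m                     ≈⟨ *-congˡ (p≈rs m) ⟩
      a * coeff (combination rs) m      ≈⟨ coeff-combination-scale a rs m ⟨
      coeff (combination (map (λ rg → (a ·P proj₁ rg) , proj₂ rg) rs)) m ∎

    InK-neg : ∀ p → InK W p → InK W (-P p)
    InK-neg p p∈K = InK-resp (-P p) ((- 1#) ·P p) (λ m → begin
      coeff (-P p) m            ≈⟨ coeff-neg p m ⟩
      - coeff p m               ≈⟨ -1*x≈-x _ ⟨
      - 1# * coeff p m          ≈⟨ coeff-scale (- 1#) p m ⟨
      coeff ((- 1#) ·P p) m     ∎) (InK-scale (- 1#) p p∈K)

    InK-Gen : ∀ {r g} → InR W r → Gen W g → InK W (r *P g)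
    InK-Gen {r} {g} r∈R g∈Gen = ((r , g) ∷ []) , ((r∈R , g∈Gen) ∷ []) , λ m → sym (trans (coeff-++ (r *P g) [] m) (+-identityʳ _))

    InR-sumP-tabulate : ∀ {n} (p : Fin n → Poly) → (∀ j → InR W (p j)) → InR W (sumP (tabulate p))
    InR-sumP-tabulate {zero}  p _   = []
    InR-sumP-tabulate {suc n} p p∈R = InR-++ (p∈R Fin.zero) (InR-sumP-tabulate (p ∘ Fin.suc) (p∈R ∘ Fin.suc))

    InK-sumP-tabulate : ∀ {n} (p : Fin n → Poly) → (∀ j → InK W (p j)) → InK W (sumP (tabulate p))
    InK-sumP-tabulate {zero}  p _   = InK-zero [] λ _ → refl
    InK-sumP-tabulate {suc n} p p∈K = InK-+ (p Fin.zero) _ (p∈K Fin.zero) (InK-sumP-tabulate (p ∘ Fin.suc) (p∈K ∘ Fin.suc))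

    Congruent : Mon → Mon → Set (c ⊔ ℓ)
    Congruent m₁ m₂ = InK W (binomial m₁ m₂)

    ∼⇒Congruent : ∀ {m₁ m₂} → m₁ ∼ m₂ → Congruent m₁ m₂
    ∼⇒Congruent {m₁} {m₂} e = InK-zero (binomial m₁ m₂) λ m → begin
      coeff (binomial m₁ m₂) m                            ≈⟨ coeff-binomial m₁ m₂ m ⟩
      coeff (monomial m₁) m - coeff (monomial m₂) m       ≡⟨ ≡.cong (λ s → coeff (monomial m₁) m - (if s then 1# + 0# else 0#))
                                                                   (sameMon-∼ˡ e m) ⟨
      coeff (monomial m₁) m - coeff (monomial m₁) m       ≈⟨ -‿inverseʳ _ ⟩
      0#                                                  ∎

    Congruent-sym : ∀ {m₁ m₂} → Congruent m₁ m₂ → Congruent m₂ m₁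
    Congruent-sym {m₁} {m₂} m₁≡m₂ = InK-resp (binomial m₂ m₁) (-P binomial m₁ m₂) (λ m → begin
      coeff (binomial m₂ m₁) m                            ≈⟨ coeff-binomial m₂ m₁ m ⟩
      coeff (monomial m₂) m - coeff (monomial m₁) m       ≈⟨ ⁻¹-anti-homo‿- _ _ ⟨
      - (coeff (monomial m₁) m - coeff (monomial m₂) m)   ≈⟨ -‿cong (coeff-binomial m₁ m₂ m) ⟨
      - coeff (binomial m₁ m₂) m                          ≈⟨ coeff-neg (binomial m₁ m₂) m ⟨
      coeff (-P binomial m₁ m₂) m                         ∎) (InK-neg (binomial m₁ m₂) m₁≡m₂)

    Congruent-trans : ∀ {m₁ m₂ m₃} → Congruent m₁ m₂ → Congruent m₂ m₃ → Congruent m₁ m₃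
    Congruent-trans {m₁} {m₂} {m₃} m₁≡m₂ m₂≡m₃ =
      InK-resp (binomial m₁ m₃) (binomial m₁ m₂ +P binomial m₂ m₃) telescope
        (InK-+ (binomial m₁ m₂) (binomial m₂ m₃) m₁≡m₂ m₂≡m₃)
      where
      telescope : binomial m₁ m₃ ≈P (binomial m₁ m₂ +P binomial m₂ m₃)
      telescope m = begin
        coeff (binomial m₁ m₃) m                             ≈⟨ coeff-binomial m₁ m₃ m ⟩
        x₁ - x₃                                              ≈⟨ +-congʳ (+-identityʳ x₁) ⟨
        (x₁ + 0#) - x₃                                       ≈⟨ +-congʳ (+-congˡ (-‿inverseˡ x₂)) ⟨
        (x₁ + (- x₂ + x₂)) - x₃                              ≈⟨ +-congʳ (+-assoc x₁ (- x₂) x₂) ⟨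
        ((x₁ - x₂) + x₂) - x₃                                ≈⟨ +-assoc (x₁ - x₂) x₂ (- x₃) ⟩
        (x₁ - x₂) + (x₂ - x₃)                                ≈⟨ +-cong (coeff-binomial m₁ m₂ m) (coeff-binomial m₂ m₃ m) ⟨
        coeff (binomial m₁ m₂) m + coeff (binomial m₂ m₃) m  ≈⟨ coeff-++ (binomial m₁ m₂) (binomial m₂ m₃) m ⟨
        coeff (binomial m₁ m₂ +P binomial m₂ m₃) m           ∎
        where
        x₁ = coeff (monomial m₁) m
        x₂ = coeff (monomial m₂) m
        x₃ = coeff (monomial m₃) m

    Congruent-isEquivalence : IsEquivalence Congruent
    Congruent-isEquivalence = record
      { refl  = λ {m} → ∼⇒Congruent {m} ∼-refl
      ; sym   = λ {m₁} {m₂} → Congruent-sym {m₁} {m₂}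
      ; trans = λ {m₁} {m₂} {m₃} → Congruent-trans {m₁} {m₂} {m₃}
      }

    Congruent-jgen : ∀ {m₁ m₂} rest {U} → U ⊆ W → (f g : Coloring G U 2) → All (Stable G W) rest →
                     m₁ ∼ rest ++ xf (proj₁ f) → m₂ ∼ rest ++ xf (proj₁ g) → Congruent m₁ m₂
    Congruent-jgen {m₁} {m₂} rest {U} U⊆W f g rest-stable e₁ e₂ =
      InK-resp (binomial m₁ m₂) (monomial rest *P (monomial (xf (proj₁ f)) -P monomial (xf (proj₁ g))))
        (termwise⇒≈P ((sym (*-identityˡ 1#) , e₁) ∷ (sym (*-identityˡ (- 1#)) , e₂) ∷ []))
        (InK-Gen (InR-monomial rest-stable) (jgen U U⊆W f g))

    InK-mgen : ∀ {m} rest S T → Stable G W S → Stable G W T → Nonempty (S ∩ T) → All (Stable G W) rest →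
               m ∼ rest ++ S ∷ T ∷ [] → InK W (monomial m)
    InK-mgen {m} rest S T S-stable T-stable S∩T≢∅ rest-stable e =
      InK-resp (monomial m) (monomial rest *P monomial (S ∷ T ∷ []))
        (termwise⇒≈P ((sym (*-identityˡ 1#) , e) ∷ []))
        (InK-Gen (InR-monomial rest-stable) (mgen S T S-stable T-stable S∩T≢∅))

  sum-δˡ : ∀ {n} (x : Fin n → Carrier) i → sum (λ j → [ does (j Fin.≟ i) ]· x j) ≈ x i
  sum-δˡ {suc n} x Fin.zero    = trans (+-congˡ (sum-0 (λ j → [ does (Fin.suc j Fin.≟ Fin.zero) ]· x (Fin.suc j)) λ _ → refl)) (+-identityʳ (x Fin.zero))
  sum-δˡ {suc n} x (Fin.suc i) = trans (+-identityˡ _) (sum-δˡ (x ∘ Fin.suc) i)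

  sum-δʳ : ∀ {n} (x : Fin n → Carrier) i → sum (λ j → [ does (i Fin.≟ j) ]· x j) ≈ x i
  sum-δʳ {suc n} x Fin.zero    = trans (+-congˡ (sum-0 (λ j → [ does (Fin.zero Fin.≟ Fin.suc j) ]· x (Fin.suc j)) λ _ → refl)) (+-identityʳ (x Fin.zero))
  sum-δʳ {suc n} x (Fin.suc i) = trans (+-identityˡ _) (sum-δʳ (x ∘ Fin.suc) i)

  coeff-lincomb-0 : ∀ {n} (x : Fin n → Carrier) b → (∀ i → x i ≈ 0#) → lincomb x b ≈P []
  coeff-lincomb-0 x b x≈0 m = trans (coeff-lincomb x b m) (sum-0 (λ i → x i * coeff (b i) m) λ i → trans (*-congʳ (x≈0 i)) (zeroˡ _))

  coeff-lincomb-+ : ∀ {n} (x y : Fin n → Carrier) b m →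
                    coeff (lincomb (λ i → x i + y i) b) m ≈ coeff (lincomb x b) m + coeff (lincomb y b) m
  coeff-lincomb-+ x y b m = begin
    coeff (lincomb (λ i → x i + y i) b) m                  ≈⟨ coeff-lincomb _ b m ⟩
    sum (λ i → (x i + y i) * coeff (b i) m)                ≈⟨ sum-cong-≋ (λ i → distribʳ (coeff (b i) m) (x i) (y i)) ⟩
    sum (λ i → x i * coeff (b i) m + y i * coeff (b i) m)  ≈⟨ ∑-distrib-+ (λ i → x i * coeff (b i) m) (λ i → y i * coeff (b i) m) ⟩
    sum (λ i → x i * coeff (b i) m) + sum (λ i → y i * coeff (b i) m)
                                                           ≈⟨ +-cong (coeff-lincomb x b m) (coeff-lincomb y b m) ⟨
    coeff (lincomb x b) m + coeff (lincomb y b) m          ∎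

  coeff-lincomb-δ : ∀ {n} a (b : Fin n → Poly) j m → coeff (lincomb (λ i → [ does (j Fin.≟ i) ]· a) b) m ≈ a * coeff (b j) m
  coeff-lincomb-δ a b j m = begin
    coeff (lincomb (λ i → [ does (j Fin.≟ i) ]· a) b) m    ≈⟨ coeff-lincomb _ b m ⟩
    sum (λ i → [ does (j Fin.≟ i) ]· a * coeff (b i) m)    ≈⟨ sum-cong-≋ (λ i → []·-*ʳ (does (j Fin.≟ i)) a _) ⟩
    sum (λ i → [ does (j Fin.≟ i) ]· (a * coeff (b i) m))  ≈⟨ sum-δʳ (λ i → a * coeff (b i) m) j ⟩
    a * coeff (b j) m                                      ∎

module KempeCongruence {c ℓ : Level} (F : Field c ℓ) {d : ℕ} (G : Graph d) {W : Subset d} where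

  open import Level using (Level)
  open import Function using (_∘_)
  open import Data.Nat using (ℕ; zero; suc)
  open import Data.Fin as Fin using (Fin)
  import Data.Fin.Properties as Fin
  open import Data.Fin.Subset using (Subset; _⊆_)
  open import Data.Fin.Permutation as Perm using (_⟨$⟩ʳ_; _⟨$⟩ˡ_)
  open import Data.List as List using (List; []; _∷_; _++_; tabulate)
  import Data.List.Properties as List
  open import Data.List.Relation.Unary.All using (All)
  import Data.List.Relation.Unary.All.Properties as All
  open import Data.Product using (_×_; _,_; proj₁; proj₂)
  open import Data.Sum using (_⊎_; inj₁; inj₂)
  open import Relation.Nullary using (¬_; Dec; yes; no; contradiction; _⊎-dec_; _×-dec_)
  open import Relation.Nullary.Decidable using (decidable-stable)
  open import Relation.Nullary.Negation using (¬¬-map)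
  open import Relation.Nullary.Decidable using (¬¬-excluded-middle)
  open import Relation.Binary.PropositionalEquality
  import Relation.Binary.Construct.Closure.Equivalence as EqC
  open Multisets
  open Colorings
  open PolyRing F G using (xf)
  open Polynomials F G

  module _ {V : Subset d} (V⊆W : V ⊆ W) where

    AgreeOutside⇒Congruent : ∀ {k} {i j : Fin k} → i ≢ j → (c c′ : Coloring G V k) →
                             AgreeOutside i j (proj₁ c) (proj₁ c′) →
                             Congruent {W} (colorMonomial (proj₁ c)) (colorMonomial (proj₁ c′))
    AgreeOutside⇒Congruent {zero}        {()}
    AgreeOutside⇒Congruent {suc zero}    {Fin.zero} {Fin.zero} i≢j = contradiction refl i≢j
    AgreeOutside⇒Congruent {suc (suc k)} {i} {j} i≢j c c′ agree =
      Congruent-jgen rest (V⊆W ∘ pairClasses⊆W {i = i} {j} f) R.restricted R′.restricted rest-stable e e′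
      where
      f = proj₁ c
      f′ = proj₁ c′
      module R = RestrictToPair G i≢j c (pairClasses⊆W {i = i} {j} f) (∈-pairClasses⁺ f) (∈-pairClasses⁻ f)
      module R′ = RestrictToPair G i≢j c′ (pairClasses⊆W {i = i} {j} f)
                    (λ p h → ∈-pairClasses⁺ f p (AgreeOutside-OneOf (AgreeOutside-sym agree) _ p h))
                    (λ q p → AgreeOutside-OneOf agree _ p (∈-pairClasses⁻ f q p))
      rest : List (Subset d)
      rest = tabulate (preimage V f ∘ others i≢j)
      rest≡ : rest ≡ tabulate (preimage V f′ ∘ others i≢j)
      rest≡ = List.tabulate-cong λ ℓ → AgreeOutside-preimage agree (others i≢j ℓ)
                λ { (inj₁ eq) → others-≢ˡ i≢j ℓ eq ; (inj₂ eq) → others-≢ʳ i≢j ℓ eq }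
      rest-stable : All (Stable G W) rest
      rest-stable = All.tabulate⁺ λ ℓ → Stable-mono G {V} {W} V⊆W (preimage-stable G c (others i≢j ℓ))
      e : colorMonomial f ∼ rest ++ xf (proj₁ R.restricted)
      e = ∼-trans (tabulate-∼-others i≢j (preimage V f))
            (≡⇒∼ (cong (rest ++_) (sym (cong₂ (λ X Y → X ∷ Y ∷ [])
              (R.preimage-restricted Fin.zero) (R.preimage-restricted (Fin.suc Fin.zero))))))
      e′ : colorMonomial f′ ∼ rest ++ xf (proj₁ R′.restricted)
      e′ = ∼-trans (tabulate-∼-others i≢j (preimage V f′))
             (≡⇒∼ (cong₂ _++_ (sym rest≡) (sym (cong₂ (λ X Y → X ∷ Y ∷ [])
               (R′.preimage-restricted Fin.zero) (R′.preimage-restricted (Fin.suc Fin.zero))))))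

    KempeStep⇒Congruent : ∀ {k} {f g : Coloring G V k} → KempeStep G V k f g →
                          Congruent {W} (colorMonomial (proj₁ f)) (colorMonomial (proj₁ g))
    KempeStep⇒Congruent {f = f , _} {g , _} (same f≡g) = ∼⇒Congruent (≡⇒∼ classes≡)
      where
      classes≡ : colorMonomial f ≡ colorMonomial g
      classes≡ = List.tabulate-cong λ ℓ →
        preimage-≡ f g (λ u p fu≡ℓ → trans (sym (f≡g u p p)) fu≡ℓ) (λ u p gu≡ℓ → trans (f≡g u p p) gu≡ℓ)
    KempeStep⇒Congruent {f = f , _} {g , _} (perm (σ , g≡σf)) =
      ∼⇒Congruent (∼-trans (tabulate-permute-∼ (preimage V f) (Perm.flip σ)) (≡⇒∼ classes≡))
      where
      classes≡ : tabulate (preimage V f ∘ (σ ⟨$⟩ˡ_)) ≡ colorMonomial g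
      classes≡ = List.tabulate-cong λ ℓ → preimage-≡ f g
        (λ u p fu≡σ⁻¹ℓ → trans (g≡σf u p) (trans (cong (σ ⟨$⟩ʳ_) fu≡σ⁻¹ℓ) (Perm.inverseʳ σ)))
        (λ u p gu≡ℓ → trans (sym (Perm.inverseˡ σ)) (cong (σ ⟨$⟩ˡ_) (trans (sym (g≡σf u p)) gu≡ℓ)))
    KempeStep⇒Congruent {k} {f} {g} (switch (i , j , i<j , v , _ , switched)) =
      AgreeOutside⇒Congruent (Fin.<⇒≢ i<j) f g agree
      where
      -- membership in a Kempe chain is not decidable, but the conclusion at each vertex is
      agree : AgreeOutside i j (proj₁ f) (proj₁ g)
      agree u p = decidable-stable ((proj₁ f u p Fin.≟ proj₁ g u p) ⊎-dec (oneOf? i j (proj₁ f u p) ×-dec oneOf? i j (proj₁ g u p)))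
                    (¬¬-map byComponent ¬¬-excluded-middle)
        where
        byComponent : Dec (Path G V k (proj₁ f) i j v u) → proj₁ f u p ≡ proj₁ g u p ⊎ (OneOf i j (proj₁ f u p) × OneOf i j (proj₁ g u p))
        byComponent (no ∉C) = inj₁ (sym (proj₂ (switched u p) ∉C))
        byComponent (yes inC) with oneOf? i j (proj₁ f u p)
        ... | yes fu = inj₂ (fu , subst (OneOf i j) (sym (proj₁ (switched u p) inC)) (swapCol-OneOf {G = G} {W = V} fu))
        ... | no fu∉ = inj₁ (sym (trans (proj₁ (switched u p) inC) (swapCol-outside {G = G} {W = V} fu∉)))

    Kempe⇒Congruent : ∀ {k} {f g : Coloring G V k} → KempeEq G V k f g →
                      Congruent {W} (colorMonomial (proj₁ f)) (colorMonomial (proj₁ g))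
    Kempe⇒Congruent = EqC.gfold Congruent-isEquivalence (colorMonomial ∘ proj₁) KempeStep⇒Congruent

module Families where

  open import Function using (_∘_)
  open import Data.Empty using (⊥; ⊥-elim)
  open import Data.Nat as ℕ using (ℕ; zero; suc)
  open import Data.Fin as Fin using (Fin; toℕ)
  import Data.Fin.Properties as Fin
  open import Data.Fin.Subset using (Subset; _∈_; _⊆_) renaming (⊥ to ∅)
  open import Data.List as List using (List; []; _∷_; length; tabulate)
  open import Data.List.Relation.Unary.All as All using (All; []; _∷_)
  open import Data.Product using (_×_; _,_; proj₁)
  open import Data.Sum using (_⊎_; inj₁; inj₂)
  open import Relation.Binary.PropositionalEquality
  open Multisets
  open Colorings

  module _ {d : ℕ} where

    lookup∅ : List (Subset d) → ℕ → Subset d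
    lookup∅ []      _       = ∅
    lookup∅ (S ∷ m) zero    = S
    lookup∅ (S ∷ m) (suc i) = lookup∅ m i

    -- the variables of m as a family of k color classes, padded with ∅
    family : ∀ {k} → List (Subset d) → Fin k → Subset d
    family m ℓ = lookup∅ m (toℕ ℓ)

    family-All : ∀ {k p} {P : Subset d → Set p} {m} → All P m → P ∅ → ∀ (ℓ : Fin k) → P (family m ℓ)
    family-All {P = P} s P∅ ℓ = go s (toℕ ℓ)
      where
      go : ∀ {m} → All P m → ∀ i → P (lookup∅ m i)
      go []       _       = P∅
      go (Ps ∷ _) zero    = Ps
      go (_ ∷ s)  (suc i) = go s i

    tabulate-family : ∀ {k} m → length m ≡ k → tabulate (family {k = k} m) ≡ m
    tabulate-family []      refl = refl
    tabulate-family (S ∷ m) refl = cong (S ∷_) (tabulate-family m refl)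

    family-tabulate : ∀ {k} (A : Fin k → Subset d) ℓ → family (tabulate A) ℓ ≡ A ℓ
    family-tabulate A Fin.zero    = refl
    family-tabulate A (Fin.suc ℓ) = family-tabulate (A ∘ Fin.suc) ℓ

  module PairFamily {d : ℕ} (G : Graph d) {U : Subset d} {k : ℕ} (rest : List (Subset d)) where

    pairFamily : Coloring G U 2 → Fin (suc (suc k)) → Subset d
    pairFamily h = family (preimage U (proj₁ h) Fin.zero ∷ preimage U (proj₁ h) (Fin.suc Fin.zero) ∷ rest)

    private
      other : ∀ (h h′ : Coloring G U 2) {u} c → u ∈ preimage U (proj₁ h) c →
              u ∈ pairFamily h′ Fin.zero ⊎ u ∈ pairFamily h′ (Fin.suc Fin.zero)
      other h h′ c q with ∈-preimage⁻ (proj₁ h) q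
      ... | p , _ with proj₁ h′ _ p in eq
      ...   | Fin.zero         = inj₁ (∈-preimage⁺ (proj₁ h′) p eq)
      ...   | Fin.suc Fin.zero = inj₂ (∈-preimage⁺ (proj₁ h′) p eq)

      clash : ∀ {h h′ u} → Disjoint (pairFamily h) → ∀ c x → u ∈ preimage U (proj₁ h′) c → u ∈ family rest x → ⊥
      clash {h} {h′} {u} dj c x q q′ with other h′ h c q
      ... | inj₁ r with () ← dj u Fin.zero (Fin.suc (Fin.suc x)) r q′
      ... | inj₂ r with () ← dj u (Fin.suc Fin.zero) (Fin.suc (Fin.suc x)) r q′

      union-other : ∀ (h h′ : Coloring G U 2) {u} c → u ∈ preimage U (proj₁ h) c → u ∈ union (pairFamily h′)
      union-other h h′ c q with other h h′ c q
      ... | inj₁ r = ∈-union⁺ (pairFamily h′) Fin.zero r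
      ... | inj₂ r = ∈-union⁺ (pairFamily h′) (Fin.suc Fin.zero) r

    module _ (h h′ : Coloring G U 2) where

      pairFamily-Disjoint : Disjoint (pairFamily h) → Disjoint (pairFamily h′)
      pairFamily-Disjoint dj u Fin.zero              Fin.zero              _ _  = refl
      pairFamily-Disjoint dj u (Fin.suc Fin.zero)    (Fin.suc Fin.zero)    _ _  = refl
      pairFamily-Disjoint dj u Fin.zero              (Fin.suc Fin.zero)    q q′ with () ← preimage-disjoint (proj₁ h′) q q′
      pairFamily-Disjoint dj u (Fin.suc Fin.zero)    Fin.zero              q q′ with () ← preimage-disjoint (proj₁ h′) q q′
      pairFamily-Disjoint dj u (Fin.suc (Fin.suc x)) (Fin.suc (Fin.suc y)) q q′ = dj u _ _ q q′
      pairFamily-Disjoint dj u Fin.zero              (Fin.suc (Fin.suc y)) q q′ = ⊥-elim (clash {h} {h′} dj Fin.zero y q q′)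
      pairFamily-Disjoint dj u (Fin.suc Fin.zero)    (Fin.suc (Fin.suc y)) q q′ = ⊥-elim (clash {h} {h′} dj (Fin.suc Fin.zero) y q q′)
      pairFamily-Disjoint dj u (Fin.suc (Fin.suc x)) Fin.zero              q q′ = ⊥-elim (clash {h} {h′} dj Fin.zero x q′ q)
      pairFamily-Disjoint dj u (Fin.suc (Fin.suc x)) (Fin.suc Fin.zero)    q q′ = ⊥-elim (clash {h} {h′} dj (Fin.suc Fin.zero) x q′ q)

      union-pairFamily : union (pairFamily h) ⊆ union (pairFamily h′)
      union-pairFamily q with ∈-union⁻ (pairFamily h) q
      ... | Fin.zero              , q′ = union-other h h′ _ q′
      ... | Fin.suc Fin.zero      , q′ = union-other h h′ _ q′
      ... | Fin.suc (Fin.suc x)   , q′ = ∈-union⁺ (pairFamily h′) (Fin.suc (Fin.suc x)) q′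

      pairFamily-AgreeOutside : ∀ {W′} (cover : Covers (pairFamily h) W′) (cover′ : Covers (pairFamily h′) W′) →
                                Disjoint (pairFamily h) → Disjoint (pairFamily h′) →
                                AgreeOutside Fin.zero (Fin.suc Fin.zero) (colorBy _ cover) (colorBy _ cover′)
      pairFamily-AgreeOutside cover cover′ dj dj′ u p = compare _ _ (∈-colorBy _ cover u p) (∈-colorBy _ cover′ u p)
        where
        compare : ∀ ℓ ℓ′ → u ∈ pairFamily h ℓ → u ∈ pairFamily h′ ℓ′ →
                  ℓ ≡ ℓ′ ⊎ (OneOf Fin.zero (Fin.suc Fin.zero) ℓ × OneOf Fin.zero (Fin.suc Fin.zero) ℓ′)
        compare Fin.zero              Fin.zero              _ _  = inj₁ refl
        compare Fin.zero              (Fin.suc Fin.zero)    _ _  = inj₂ (inj₁ refl , inj₂ refl)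
        compare (Fin.suc Fin.zero)    Fin.zero              _ _  = inj₂ (inj₂ refl , inj₁ refl)
        compare (Fin.suc Fin.zero)    (Fin.suc Fin.zero)    _ _  = inj₁ refl
        compare (Fin.suc (Fin.suc x)) ℓ′                    q q′ = inj₁ (dj′ u _ ℓ′ q q′)
        compare Fin.zero              (Fin.suc (Fin.suc y)) q q′ = inj₁ (dj u _ _ q q′)
        compare (Fin.suc Fin.zero)    (Fin.suc (Fin.suc y)) q q′ = inj₁ (dj u _ _ q q′)

module KempeBasis {d : ℕ} (G : Graph d) (k : ℕ) (W : Subset d)
                  (n : Subset d → ℕ) (kc : ∀ W′ → KcIs G W′ k (n W′)) where

  open import Function using (_∘_)
  open import Data.Empty using (⊥-elim)
  open import Data.Nat as ℕ using (ℕ; zero; suc)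
  open import Data.Maybe using (Maybe; just; nothing)
  open import Data.Fin as Fin using (Fin)
  import Data.Fin.Properties as Fin
  open import Data.Fin.Subset using (Subset; _∈_; _⊆_; _∩_; Nonempty) renaming (⊥ to ∅)
  open import Data.Fin.Subset.Properties using (_⊆?_; ⊆-antisym; x∈p∩q⁻; ∉⊥)
  open import Data.List as List using (List; []; _∷_; _++_; length)
  open import Data.List.Relation.Unary.All as All using (All; []; _∷_)
  import Data.List.Relation.Unary.All.Properties as All
  open import Data.Product using (Σ; _×_; _,_; proj₁; proj₂)
  open import Data.Fin.Permutation as Perm using (Permutation′; _⟨$⟩ʳ_; _⟨$⟩ˡ_)
  open import Relation.Nullary using (¬_; Dec; yes; no; contradiction)
  open import Relation.Nullary.Decidable using (decidable-stable)
  open import Relation.Nullary.Negation using (¬¬-map)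
  open import Relation.Binary.PropositionalEquality
  import Relation.Binary.Construct.Closure.Equivalence as EqC
  open Classical
  open Multisets
  open SubsetSums
  open Families
  open Colorings

  representative : ∀ W′ → Fin (n W′) → Coloring G W′ k
  representative W′ = proj₁ (kc W′)

  classOf : ∀ W′ → Coloring G W′ k → Fin (n W′)
  classOf W′ f = proj₁ (proj₂ (proj₂ (kc W′)) f)

  classOf-spec : ∀ W′ f → KempeEq G W′ k f (representative W′ (classOf W′ f))
  classOf-spec W′ f = proj₂ (proj₂ (proj₂ (kc W′)) f)

  classOf-Kempe : ∀ {W′} {f g} → KempeEq G W′ k f g → classOf W′ f ≡ classOf W′ g
  classOf-Kempe {W′} {f} {g} f~g =
    proj₁ (proj₂ (kc W′)) _ _ (Kempe-trans (Kempe-sym (classOf-spec W′ f)) (Kempe-trans f~g (classOf-spec W′ g)))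

  classOf-representative : ∀ W′ a → classOf W′ (representative W′ a) ≡ a
  classOf-representative W′ a = proj₁ (proj₂ (kc W′)) _ _ (Kempe-sym (classOf-spec W′ (representative W′ a)))

  N : ℕ
  N = sumBelow n W

  -- basis elements are indexed by a set W′ ⊆ W together with a Kempe class of k-colorings of G[W′]
  index : ∀ W′ → .(W′ ⊆ W) → Fin (n W′) → Fin N
  index W′ W′⊆W a = encode d _ (W′ , injectRestrict (W′ ⊆? W) W′⊆W a)

  private
    basisColoringAt : Σ (Subset d) (λ W′ → Fin (restrict (W′ ⊆? W) (n W′))) → Σ (Subset d) λ W′ → W′ ⊆ W × Coloring G W′ k
    basisColoringAt (W′ , a) = let W′⊆W , b = projectRestrict (W′ ⊆? W) a in W′ , W′⊆W , representative W′ b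

  basisColoring : Fin N → Σ (Subset d) λ W′ → W′ ⊆ W × Coloring G W′ k
  basisColoring i = basisColoringAt (decode d _ i)

  basisMonomial : Fin N → List (Subset d)
  basisMonomial i = colorMonomial (proj₁ (proj₂ (proj₂ (basisColoring i))))

  basisMonomial-stable : ∀ i → All (Stable G W) (basisMonomial i)
  basisMonomial-stable i = let _ , W′⊆W , f = basisColoring i in
    All.map (Stable-mono G W′⊆W) (colorMonomial-stable G f)

  length-basisMonomial : ∀ i → length (basisMonomial i) ≡ k
  length-basisMonomial i = length-colorMonomial (proj₁ (proj₂ (proj₂ (basisColoring i))))

  basisMonomial-index : ∀ W′ .(W′⊆W : W′ ⊆ W) a → basisMonomial (index W′ W′⊆W a) ≡ colorMonomial (proj₁ (representative W′ a))
  basisMonomial-index W′ W′⊆W a = begin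
    basisMonomial (index W′ W′⊆W a)
      ≡⟨ cong (λ x → colorMonomial (proj₁ (proj₂ (proj₂ (basisColoringAt x))))) (decode-encode d _ _) ⟩
    colorMonomial (proj₁ (representative W′ (proj₂ (projectRestrict (W′ ⊆? W) (injectRestrict (W′ ⊆? W) W′⊆W a)))))
      ≡⟨ cong (colorMonomial ∘ proj₁ ∘ representative W′) (projectRestrict-injectRestrict (W′ ⊆? W) W′⊆W a) ⟩
    colorMonomial (proj₁ (representative W′ a))
      ∎
    where open ≡-Reasoning

  index-basisColoring : ∀ i → let W′ , W′⊆W , f = basisColoring i in index W′ W′⊆W (classOf W′ f) ≡ i
  index-basisColoring i = begin
    encode d _ (W′ , injectRestrict (W′ ⊆? W) W′⊆W (classOf W′ (representative W′ b)))
      ≡⟨ cong (λ x → encode d _ (W′ , injectRestrict (W′ ⊆? W) W′⊆W x)) (classOf-representative W′ b) ⟩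
    encode d _ (W′ , injectRestrict (W′ ⊆? W) W′⊆W b)
      ≡⟨ cong (λ x → encode d _ (W′ , x)) (injectRestrict-projectRestrict (W′ ⊆? W) a) ⟩
    encode d _ (decode d _ i)
      ≡⟨ encode-decode d _ i ⟩
    i ∎
    where
    open ≡-Reasoning
    W′ = proj₁ (decode d _ i)
    a = proj₂ (decode d _ i)
    W′⊆W = proj₁ (projectRestrict (W′ ⊆? W) a)
    b = proj₂ (projectRestrict (W′ ⊆? W) a)

  StableFamily : (Fin k → Subset d) → Set
  StableFamily M = ∀ ℓ → Stable G W (M ℓ)

  union⊆W : ∀ M → StableFamily M → union M ⊆ W
  union⊆W M stable q = let ℓ , q′ = ∈-union⁻ M q in proj₁ (stable ℓ) q′

  colorFamily : ∀ M {W′} → Covers M W′ → StableFamily M → Coloring G W′ k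
  colorFamily M cover stable = colorBy M cover , colorBy-proper M cover G (proj₂ ∘ stable)

  code : ∀ M → StableFamily M → Fin N
  code M stable = index (union M) (union⊆W M stable) (classOf (union M) (colorFamily M (union-covers M) stable))

  code-≡-index : ∀ {M} (stable : StableFamily M) {W′} .(W′⊆W : W′ ⊆ W) (f : Coloring G W′ k) → union M ≡ W′ →
                 (∀ (cover : Covers M W′) → ¬ ¬ KempeEq G W′ k (colorFamily M cover stable) f) →
                 code M stable ≡ index W′ W′⊆W (classOf W′ f)
  code-≡-index {M} stable _ f refl kempe =
    decidable-stable (_ Fin.≟ _) (¬¬-map (cong (index _ _) ∘ classOf-Kempe) (kempe (union-covers M)))

  code-≡ : ∀ {M M′} (stable : StableFamily M) (stable′ : StableFamily M′) → union M ≡ union M′ →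
           (∀ {W′} (cover : Covers M W′) (cover′ : Covers M′ W′) →
              ¬ ¬ KempeEq G W′ k (colorFamily M cover stable) (colorFamily M′ cover′ stable′)) →
           code M stable ≡ code M′ stable′
  code-≡ {M′ = M′} stable stable′ eq kempe =
    code-≡-index stable (union⊆W M′ stable′) _ eq λ cover → kempe cover (union-covers M′)

  module _ {M M′ : Fin k → Subset d} (σ : Permutation′ k) (M∘σ≡M′ : ∀ ℓ → M (σ ⟨$⟩ʳ ℓ) ≡ M′ ℓ) where

    private
      to : ∀ {u} ℓ → u ∈ M ℓ → u ∈ M′ (σ ⟨$⟩ˡ ℓ)
      to {u} ℓ q = subst (u ∈_) (trans (cong M (sym (Perm.inverseʳ σ))) (M∘σ≡M′ _)) q

      from : ∀ {u} ℓ → u ∈ M′ ℓ → u ∈ M (σ ⟨$⟩ʳ ℓ)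
      from {u} ℓ q = subst (u ∈_) (sym (M∘σ≡M′ ℓ)) q

    Disjoint-permute : Disjoint M → Disjoint M′
    Disjoint-permute disjoint u ℓ ℓ′ q q′ = ⟨$⟩ʳ-injective σ (disjoint u _ _ (from ℓ q) (from ℓ′ q′))

    Disjoint-permute⁻ : Disjoint M′ → Disjoint M
    Disjoint-permute⁻ disjoint′ u ℓ ℓ′ q q′ =
      trans (sym (Perm.inverseʳ σ)) (trans (cong (σ ⟨$⟩ʳ_) (disjoint′ u _ _ (to ℓ q) (to ℓ′ q′))) (Perm.inverseʳ σ))

    union-permute : union M ≡ union M′
    union-permute = ⊆-antisym
      (λ q → let ℓ , q′ = ∈-union⁻ M q in ∈-union⁺ M′ _ (to ℓ q′))
      (λ q → let ℓ , q′ = ∈-union⁻ M′ q in ∈-union⁺ M _ (from ℓ q′))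

    code-permute : Disjoint M → (stable : StableFamily M) (stable′ : StableFamily M′) → code M stable ≡ code M′ stable′
    code-permute disjoint stable stable′ = code-≡ stable stable′ union-permute λ cover cover′ →
      return (Kempe-sym (EqC.return (perm (σ , λ u p → colorBy-unique M cover disjoint p (from _ (∈-colorBy M′ cover′ u p))))))

  ∅-stable : Stable G W ∅
  ∅-stable = (λ q → ⊥-elim (∉⊥ q)) , (λ q → ⊥-elim (∉⊥ q))

  family-stable : ∀ {m} → All (Stable G W) m → StableFamily (family {k = k} m)
  family-stable s = family-All s ∅-stable

  classifyBy : ∀ m → All (Stable G W) m → Dec (length m ≡ k) → Dec (Disjoint (family {k = k} m)) → Maybe (Fin N)
  classifyBy m s (yes _) (yes _) = just (code (family {k = k} m) (family-stable s))
  classifyBy m s (yes _) (no _)  = nothing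
  classifyBy m s (no _)  _       = nothing

  -- the basis monomial that m is congruent to modulo K, or nothing when m lies in K or has the wrong degree
  classify : (m : List (Subset d)) → All (Stable G W) m → Maybe (Fin N)
  classify m s = classifyBy m s (length m ℕ.≟ k) (disjoint? (family {k = k} m))

  ∼⇒family-permutation : ∀ {m m′ : List (Subset d)} → m ∼ m′ → length m ≡ k → length m′ ≡ k →
                         Σ (Permutation′ k) λ σ → ∀ ℓ → family {k = k} m (σ ⟨$⟩ʳ ℓ) ≡ family m′ ℓ
  ∼⇒family-permutation {m} {m′} e l l′ = tabulate-∼⇒permutation (family m) (family m′)
    (subst₂ _∼_ (sym (tabulate-family m l)) (sym (tabulate-family m′ l′)) e)

  classify-∼ : ∀ {m m′ : List (Subset d)} s s′ → m ∼ m′ → classify m s ≡ classify m′ s′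
  classify-∼ {m} {m′} s s′ e = go (length m ℕ.≟ k) (length m′ ℕ.≟ k) (disjoint? (family {k = k} m)) (disjoint? (family {k = k} m′))
    where
    go : ∀ L L′ D D′ → classifyBy m s L D ≡ classifyBy m′ s′ L′ D′
    go (no _)   (no _)    _        _          = refl
    go (no m≢k) (yes l′)  _        _          = contradiction (trans (∼⇒length≡ m m′ e) l′) m≢k
    go (yes l)  (no m′≢k) _        _          = contradiction (trans (sym (∼⇒length≡ m m′ e)) l) m′≢k
    go (yes _)  (yes _)   (no _)   (no _)     = refl
    go (yes l)  (yes l′)  (yes dj) (no ¬dj′)  =
      let σ , σ-spec = ∼⇒family-permutation e l l′ in contradiction (Disjoint-permute {family m} {family m′} σ σ-spec dj) ¬dj′
    go (yes l)  (yes l′)  (no ¬dj) (yes dj′)  =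
      let σ , σ-spec = ∼⇒family-permutation e l l′ in contradiction (Disjoint-permute⁻ {family m} {family m′} σ σ-spec dj′) ¬dj
    go (yes l)  (yes l′)  (yes dj) (yes _)    =
      let σ , σ-spec = ∼⇒family-permutation e l l′ in cong just (code-permute {family m} {family m′} σ σ-spec dj (family-stable s) (family-stable s′))

  classify-basis : ∀ i s → classify (basisMonomial i) s ≡ just i
  classify-basis i s = go (length (basisMonomial i) ℕ.≟ k) (disjoint? M)
    where
    W′ = proj₁ (basisColoring i)
    W′⊆W = proj₁ (proj₂ (basisColoring i))
    f = proj₂ (proj₂ (basisColoring i))
    M = family {k = k} (basisMonomial i)
    M≡ : ∀ ℓ → M ℓ ≡ preimage W′ (proj₁ f) ℓ
    M≡ = family-tabulate (preimage W′ (proj₁ f))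
    ∈M : ∀ {u} p → u ∈ M (proj₁ f u p)
    ∈M {u} p = subst (u ∈_) (sym (M≡ _)) (∈-preimage⁺ (proj₁ f) p refl)
    disjoint : Disjoint M
    disjoint u ℓ ℓ′ q q′ = preimage-disjoint (proj₁ f) (subst (u ∈_) (M≡ ℓ) q) (subst (u ∈_) (M≡ ℓ′) q′)
    union≡W′ : union M ≡ W′
    union≡W′ = ⊆-antisym (λ q → let ℓ , q′ = ∈-union⁻ M q in preimage⊆ (proj₁ f) ℓ (subst (_ ∈_) (M≡ ℓ) q′))
                         (λ p → ∈-union⁺ M _ (∈M p))
    go : ∀ L D → classifyBy (basisMonomial i) s L D ≡ just i
    go (no l≢k) _        = contradiction (length-basisMonomial i) l≢k
    go (yes _)  (no ¬dj) = contradiction disjoint ¬dj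
    go (yes _)  (yes _)  = cong just (trans (code-≡-index (family-stable s) W′⊆W f union≡W′ λ cover →
      return (pointwise⇒Kempe _ f λ u p → colorBy-unique M cover disjoint p (∈M p))) (index-basisColoring i))

  private
    All-++-comm : ∀ {p} {P : Subset d → Set p} xs {ys} → All P (xs ++ ys) → All P (ys ++ xs)
    All-++-comm xs s = All.++⁺ (All.++⁻ʳ xs s) (All.++⁻ˡ xs s)

  classify-++-comm : ∀ xs ys s → classify (xs ++ ys) s ≡ classify (ys ++ xs) (All-++-comm xs s)
  classify-++-comm xs ys s = classify-∼ s (All-++-comm xs s) (++-comm-∼ xs ys)

  classify-mgen : ∀ rest S T → Nonempty (S ∩ T) → ∀ s → classify (rest ++ S ∷ T ∷ []) s ≡ nothing
  classify-mgen rest S T (u , u∈S∩T) s =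
    trans (classify-++-comm rest _ s) (go (length (S ∷ T ∷ rest) ℕ.≟ k) (disjoint? (family {k = k} (S ∷ T ∷ rest))))
    where
    go : ∀ L D → classifyBy (S ∷ T ∷ rest) (All-++-comm rest s) L D ≡ nothing
    go (no _)    _        = refl
    go (yes _)   (no _)   = refl
    go (yes refl) (yes dj) with dj u Fin.zero (Fin.suc Fin.zero) (proj₁ (x∈p∩q⁻ S T u∈S∩T)) (proj₂ (x∈p∩q⁻ S T u∈S∩T))
    ... | ()

  classify-jgen : ∀ rest {U} (f g : Coloring G U 2) s s′ →
                  classify (rest ++ preimage U (proj₁ f) Fin.zero ∷ preimage U (proj₁ f) (Fin.suc Fin.zero) ∷ []) s
                  ≡ classify (rest ++ preimage U (proj₁ g) Fin.zero ∷ preimage U (proj₁ g) (Fin.suc Fin.zero) ∷ []) s′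
  classify-jgen rest {U} f g s s′ =
    trans (classify-++-comm rest _ s)
      (trans (go (length (classes f) ℕ.≟ k) (length (classes g) ℕ.≟ k)
                 (disjoint? (family {k = k} (classes f))) (disjoint? (family {k = k} (classes g))))
             (sym (classify-++-comm rest _ s′)))
    where
    open PairFamily G {U} {length rest} rest
    classes : Coloring G U 2 → List (Subset d)
    classes h = preimage U (proj₁ h) Fin.zero ∷ preimage U (proj₁ h) (Fin.suc Fin.zero) ∷ rest
    go : ∀ L L′ D D′ → classifyBy (classes f) (All-++-comm rest s) L D ≡ classifyBy (classes g) (All-++-comm rest s′) L′ D′
    go (no _)     (no _)   _        _         = refl
    go (yes l)    (no ¬l)  _        _         = contradiction l ¬l
    go (no ¬l)    (yes l)  _        _         = contradiction l ¬l
    go (yes _)    (yes _)  (no _)   (no _)    = refl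
    go (yes refl) (yes _)  (yes dj) (no ¬dj′) = contradiction (pairFamily-Disjoint f g dj) ¬dj′
    go (yes refl) (yes _)  (no ¬dj) (yes dj′) = contradiction (pairFamily-Disjoint g f dj′) ¬dj
    go (yes refl) (yes _)  (yes dj) (yes dj′) =
      cong just (code-≡ (family-stable (All-++-comm rest s)) (family-stable (All-++-comm rest s′))
        (⊆-antisym (union-pairFamily f g) (union-pairFamily g f)) λ cover cover′ →
          AgreeOutside⇒¬¬Kempe ℕ.z<s _ _ (pairFamily-AgreeOutside f g cover cover′ dj dj′))

module TermwiseFunctional {c ℓ : Level} (F : Field c ℓ) {d : ℕ} (G : Graph d) (W : Subset d)
                        (w : ∀ m → All (Stable G W) m → Bool)
                        (w-∼ : ∀ {m m′} s s′ → m Multisets.∼ m′ → w m s ≡ w m′ s′) where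

  open import Level using (Level)
  open import Function using (_∘_; case_of_)
  open import Data.Empty using (⊥-elim)
  open import Data.Nat as ℕ using (ℕ; zero; suc; _≤_; s≤s)
  import Data.Nat.Properties as ℕ
  open import Data.Bool using (Bool; true; false)
  import Data.Bool.Properties as Bool
  open import Data.Fin as Fin using (Fin)
  open import Data.Fin.Subset using (Subset; _∩_; Nonempty)
  open import Data.List as List using (List; []; _∷_; _++_; length; filter; tabulate)
  import Data.List.Properties as List
  open import Data.List.Relation.Unary.All as All using (All; []; _∷_)
  import Data.List.Relation.Unary.All.Properties as All
  open import Data.Product using (_×_; _,_; proj₁; proj₂)
  open import Relation.Nullary using (¬_; Dec; does; ¬?)
  import Relation.Binary.PropositionalEquality as ≡
  open ≡ using (_≡_; _≢_)
  import Relation.Binary.Reasoning.Setoid as SetoidReasoning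
  open Multisets
  open Colorings

  open Field F
  open PolyRing F G using (Mon; Poly; sameMon; coeff; _≈P_; -P_; _-P_; _*P_; sumP; InR; xf; Gen; jgen; mgen; InK)
  open Polynomials F G
  open SetoidReasoning setoid
  open import Algebra.Properties.CommutativeSemigroup +-commutativeSemigroup using (x∙yz≈y∙xz)

  φ : ∀ p → InR W p → Carrier
  φ []            []       = 0#
  φ ((a , m) ∷ p) (s ∷ ps) = [ w m s ]· a + φ p ps

  φ-irrelevant : ∀ p ps ps′ → φ p ps ≡ φ p ps′
  φ-irrelevant []            []       []         = ≡.refl
  φ-irrelevant ((a , m) ∷ p) (s ∷ ps) (s′ ∷ ps′) =
    ≡.cong₂ (λ b x → [ b ]· a + x) (w-∼ s s′ ∼-refl) (φ-irrelevant p ps ps′)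

  φ-++ : ∀ p q pqs ps qs → φ (p ++ q) pqs ≈ φ p ps + φ q qs
  φ-++ []            q pqs       []        qs = trans (reflexive (φ-irrelevant q pqs qs)) (sym (+-identityˡ _))
  φ-++ ((a , m) ∷ p) q (s ∷ pqs) (s′ ∷ ps) qs = begin
    [ w m s ]· a + φ (p ++ q) pqs          ≈⟨ +-congˡ (φ-++ p q pqs ps qs) ⟩
    [ w m s ]· a + (φ p ps + φ q qs)       ≈⟨ +-assoc _ _ _ ⟨
    [ w m s ]· a + φ p ps + φ q qs         ≡⟨ ≡.cong (λ b → [ b ]· a + φ p ps + φ q qs) (w-∼ s s′ ∼-refl) ⟩
    [ w m s′ ]· a + φ p ps + φ q qs        ∎

  φ-neg : ∀ p nps ps → φ (-P p) nps ≈ - φ p ps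
  φ-neg []            []        []        = sym -0#≈0#
  φ-neg ((a , m) ∷ p) (s ∷ nps) (s′ ∷ ps) = begin
    [ w m s ]· (- a) + φ (-P p) nps        ≈⟨ +-cong ([]·-neg (w m s) a) (φ-neg p nps ps) ⟩
    - [ w m s ]· a + - φ p ps              ≈⟨ -‿+-comm _ _ ⟩
    - ([ w m s ]· a + φ p ps)              ≡⟨ ≡.cong (λ b → - ([ b ]· a + φ p ps)) (w-∼ s s′ ∼-refl) ⟩
    - ([ w m s′ ]· a + φ p ps)             ∎

  private
    Like : Mon → Carrier × Mon → Set
    Like m₀ t = sameMon (proj₂ t) m₀ ≡ true

    like? : ∀ m₀ t → Dec (Like m₀ t)
    like? m₀ t = sameMon (proj₂ t) m₀ Bool.≟ true

    unlike : ∀ m₀ → Poly → Poly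
    unlike m₀ = filter (¬? ∘ like? m₀)

    coefficientSum : Poly → Carrier
    coefficientSum []            = 0#
    coefficientSum ((a , _) ∷ p) = a + coefficientSum p

    coeff-filter : ∀ m₀ p m → coeff p m ≈ coeff (filter (like? m₀) p) m + coeff (unlike m₀ p) m
    coeff-filter m₀ []             m = sym (+-identityˡ 0#)
    coeff-filter m₀ ((a , m′) ∷ p) m with does (like? m₀ (a , m′))
    ... | true  = begin
      coeff ((a , m′) ∷ p) m                                 ≈⟨ coeff-∷ a m′ p m ⟩
      x + coeff p m                                          ≈⟨ +-congˡ (coeff-filter m₀ p m) ⟩
      x + (coeff pin m + coeff pout m)                       ≈⟨ +-assoc _ _ _ ⟨
      x + coeff pin m + coeff pout m                         ≈⟨ +-congʳ (coeff-∷ a m′ pin m) ⟨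
      coeff ((a , m′) ∷ pin) m + coeff pout m                ∎
      where
      x = [ sameMon m′ m ]· a
      pin = filter (like? m₀) p
      pout = unlike m₀ p
    ... | false = begin
      coeff ((a , m′) ∷ p) m                                 ≈⟨ coeff-∷ a m′ p m ⟩
      x + coeff p m                                          ≈⟨ +-congˡ (coeff-filter m₀ p m) ⟩
      x + (coeff pin m + coeff pout m)                       ≈⟨ x∙yz≈y∙xz x _ _ ⟩
      coeff pin m + (x + coeff pout m)                       ≈⟨ +-congˡ (coeff-∷ a m′ pout m) ⟨
      coeff pin m + coeff ((a , m′) ∷ pout) m                ∎
      where
      x = [ sameMon m′ m ]· a
      pin = filter (like? m₀) p
      pout = unlike m₀ p

    φ-filter : ∀ m₀ p ps → φ p ps ≈ φ (filter (like? m₀) p) (All.filter⁺ (like? m₀) ps) + φ (unlike m₀ p) (All.filter⁺ _ ps)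
    φ-filter m₀ []            []       = sym (+-identityˡ 0#)
    φ-filter m₀ ((a , m) ∷ p) (s ∷ ps) with does (like? m₀ (a , m))
    ... | true  = trans (+-congˡ (φ-filter m₀ p ps)) (sym (+-assoc _ _ _))
    ... | false = trans (+-congˡ (φ-filter m₀ p ps)) (x∙yz≈y∙xz _ _ _)

    coeff-like : ∀ m₀ p → All (Like m₀) p → coeff p m₀ ≈ coefficientSum p
    coeff-like m₀ []             []          = refl
    coeff-like m₀ ((a , m′) ∷ p) (like ∷ ps) rewrite like = +-congˡ (coeff-like m₀ p ps)

    coeff-unlike : ∀ m p → All (¬_ ∘ Like m) p → coeff p m ≈ 0#
    coeff-unlike m []             []            = refl
    coeff-unlike m ((a , m′) ∷ p) (unlike ∷ ps) with sameMon m′ m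
    ... | true  = ⊥-elim (unlike ≡.refl)
    ... | false = coeff-unlike m p ps

    φ-like : ∀ m₀ s₀ p ps → All (Like m₀) p → φ p ps ≈ [ w m₀ s₀ ]· coefficientSum p
    φ-like m₀ s₀ []            []       []          = sym ([]·-0 (w m₀ s₀) refl)
    φ-like m₀ s₀ ((a , m) ∷ p) (s ∷ ps) (like ∷ ls) = begin
      [ w m s ]· a + φ p ps                                  ≡⟨ ≡.cong (λ b → [ b ]· a + φ p ps) (w-∼ s s₀ (sameMon-sound m m₀ like)) ⟩
      [ w m₀ s₀ ]· a + φ p ps                                ≈⟨ +-congˡ (φ-like m₀ s₀ p ps ls) ⟩
      [ w m₀ s₀ ]· a + [ w m₀ s₀ ]· coefficientSum p         ≈⟨ []·-+ (w m₀ s₀) a _ ⟨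
      [ w m₀ s₀ ]· (a + coefficientSum p)                    ∎

    like-both : ∀ {m₀ m} t → Like m₀ t → Like m t → sameMon m₀ m ≡ true
    like-both t like₀ like = sameMon-complete (∼-trans (∼-sym (sameMon-sound (proj₂ t) _ like₀)) (sameMon-sound (proj₂ t) _ like))

    -- in a zero polynomial the terms with the same monomial as the first one cancel it
    like-cancel : ∀ a m₀ p → ((a , m₀) ∷ p) ≈P [] → a + coefficientSum (filter (like? m₀) p) ≈ 0#
    like-cancel a m₀ p p≈0 = begin
      a + coefficientSum pin                               ≈⟨ +-congˡ (coeff-like m₀ pin (All.all-filter (like? m₀) p)) ⟨
      a + coeff pin m₀                                     ≈⟨ +-congˡ (+-identityʳ _) ⟨
      a + (coeff pin m₀ + 0#)                              ≈⟨ +-congˡ (+-congˡ (coeff-unlike m₀ (unlike m₀ p) (All.all-filter (¬? ∘ like? m₀) p))) ⟨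
      a + (coeff pin m₀ + coeff (unlike m₀ p) m₀)          ≈⟨ +-congˡ (coeff-filter m₀ p m₀) ⟨
      a + coeff p m₀                                       ≡⟨ ≡.cong (λ b → [ b ]· a + coeff p m₀) (sameMon-complete {m₀} ∼-refl) ⟨
      [ sameMon m₀ m₀ ]· a + coeff p m₀                    ≈⟨ coeff-∷ a m₀ p m₀ ⟨
      coeff ((a , m₀) ∷ p) m₀                              ≈⟨ p≈0 m₀ ⟩
      0#                                                   ∎
      where pin = filter (like? m₀) p

    unlike-≈0 : ∀ a m₀ p → ((a , m₀) ∷ p) ≈P [] → unlike m₀ p ≈P []
    unlike-≈0 a m₀ p p≈0 m with sameMon m₀ m in eq
    ... | true  = coeff-unlike m (unlike m₀ p) (All.map (λ {t} unlike₀ like → unlike₀ (≡.trans (sameMon-∼ʳ (sameMon-sound m₀ m eq) (proj₂ t)) like))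
                                                        (All.all-filter (¬? ∘ like? m₀) p))
    ... | false = begin
      coeff (unlike m₀ p) m                                ≈⟨ +-identityˡ _ ⟨
      0# + coeff (unlike m₀ p) m                           ≈⟨ +-congʳ (coeff-unlike m (filter (like? m₀) p) (All.map (λ {t} like₀ like →
                                                                case ≡.trans (≡.sym (like-both t like₀ like)) eq of λ ()) (All.all-filter (like? m₀) p))) ⟨
      coeff (filter (like? m₀) p) m + coeff (unlike m₀ p) m ≈⟨ coeff-filter m₀ p m ⟨
      coeff p m                                            ≈⟨ +-identityˡ _ ⟨
      0# + coeff p m                                       ≡⟨ ≡.cong (λ b → [ b ]· a + coeff p m) eq ⟨
      [ sameMon m₀ m ]· a + coeff p m                      ≈⟨ coeff-∷ a m₀ p m ⟨
      coeff ((a , m₀) ∷ p) m                               ≈⟨ p≈0 m ⟩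
      0#                                                   ∎

    φ-zero : ∀ fuel p ps → length p ≤ fuel → p ≈P [] → φ p ps ≈ 0#
    φ-zero fuel       []             []        _         _  = refl
    φ-zero (suc fuel) ((a , m₀) ∷ p) (s₀ ∷ ps) (s≤s len) p≈0 = begin
      [ w m₀ s₀ ]· a + φ p ps                                       ≈⟨ +-congˡ (φ-filter m₀ p ps) ⟩
      [ w m₀ s₀ ]· a + (φ pin psin + φ pout psout)                  ≈⟨ +-assoc _ _ _ ⟨
      [ w m₀ s₀ ]· a + φ pin psin + φ pout psout                    ≈⟨ +-congʳ (+-congˡ (φ-like m₀ s₀ pin psin (All.all-filter (like? m₀) p))) ⟩
      [ w m₀ s₀ ]· a + [ w m₀ s₀ ]· coefficientSum pin + φ pout psout ≈⟨ +-congʳ ([]·-+ (w m₀ s₀) a _) ⟨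
      [ w m₀ s₀ ]· (a + coefficientSum pin) + φ pout psout          ≈⟨ +-cong ([]·-0 (w m₀ s₀) (like-cancel a m₀ p p≈0))
                                                                             (φ-zero fuel pout psout (ℕ.≤-trans (List.length-filter _ p) len) (unlike-≈0 a m₀ p p≈0)) ⟩
      0# + 0#                                                       ≈⟨ +-identityˡ 0# ⟩
      0#                                                            ∎
      where
      pin = filter (like? m₀) p
      pout = unlike m₀ p
      psin = All.filter⁺ (like? m₀) ps
      psout = All.filter⁺ (¬? ∘ like? m₀) ps

  φ-resp : ∀ p q ps qs → p ≈P q → φ p ps ≈ φ q qs
  φ-resp p q ps qs p≈q = x∙y⁻¹≈ε⇒x≈y _ _ (begin
    φ p ps - φ q qs                 ≈⟨ +-congˡ (φ-neg q nqs qs) ⟨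
    φ p ps + φ (-P q) nqs           ≈⟨ φ-++ p (-P q) pqs ps nqs ⟨
    φ (p -P q) pqs                  ≈⟨ φ-zero _ (p -P q) pqs ℕ.≤-refl p-q≈0 ⟩
    0#                              ∎)
    where
    nqs = InR-neg qs
    pqs = InR-++ ps nqs
    p-q≈0 : (p -P q) ≈P []
    p-q≈0 m = trans (coeff-sub p q m) (trans (+-congʳ (p≈q m)) (-‿inverseʳ _))

  φ-sumP-tabulate : ∀ {n} (x : Fin n → Carrier) (b : Fin n → Mon) (bs : ∀ j → All (Stable G W) (b j)) ps →
                    φ (sumP (tabulate λ j → (x j , b j) ∷ [])) ps ≈ sum (λ j → [ w (b j) (bs j) ]· x j)
  φ-sumP-tabulate {zero}  x b bs []       = refl
  φ-sumP-tabulate {suc n} x b bs (s ∷ ps) = +-cong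
    (reflexive (≡.cong (λ v → [ v ]· x Fin.zero) (w-∼ s (bs Fin.zero) ∼-refl)))
    (φ-sumP-tabulate (x ∘ Fin.suc) (b ∘ Fin.suc) (bs ∘ Fin.suc) ps)

  module _ (w-jgen : ∀ rest {U} (f g : Coloring G U 2) s s′ → w (rest ++ xf (proj₁ f)) s ≡ w (rest ++ xf (proj₁ g)) s′)
           (w-mgen : ∀ rest S T → Nonempty (S ∩ T) → ∀ s → w (rest ++ S ∷ T ∷ []) s ≡ false) where

    private
      φ-termMul-Gen : ∀ a m₀ {g} → Gen W g → ∀ ps → φ (termMul a m₀ g) ps ≈ 0#
      φ-termMul-Gen a m₀ (jgen U U⊆W f g) (s₁ ∷ s₂ ∷ []) = begin
        [ w (m₀ ++ xf (proj₁ f)) s₁ ]· (a * 1#) + ([ B ]· (a * - 1#) + 0#)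
          ≡⟨ ≡.cong (λ v → [ v ]· (a * 1#) + ([ B ]· (a * - 1#) + 0#)) (w-jgen m₀ f g s₁ s₂) ⟩
        [ B ]· (a * 1#) + ([ B ]· (a * - 1#) + 0#)   ≈⟨ +-congˡ (+-identityʳ _) ⟩
        [ B ]· (a * 1#) + [ B ]· (a * - 1#)          ≈⟨ []·-+ B _ _ ⟨
        [ B ]· (a * 1# + a * - 1#)                   ≈⟨ []·-0 B (trans (sym (distribˡ a 1# (- 1#))) (trans (*-congˡ (-‿inverseʳ 1#)) (zeroʳ a))) ⟩
        0#                                           ∎
        where B = w (m₀ ++ xf (proj₁ g)) s₂
      φ-termMul-Gen a m₀ (mgen S T _ _ S∩T≢∅) (s ∷ []) = begin
        [ w (m₀ ++ S ∷ T ∷ []) s ]· (a * 1#) + 0#    ≡⟨ ≡.cong (λ v → [ v ]· (a * 1#) + 0#) (w-mgen m₀ S T S∩T≢∅ s) ⟩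
        0# + 0#                                      ≈⟨ +-identityˡ 0# ⟩
        0#                                           ∎

      φ-*P-Gen : ∀ r {g} → Gen W g → ∀ ps → φ (r *P g) ps ≈ 0#
      φ-*P-Gen []             _  []   = refl
      φ-*P-Gen ((a , m₀) ∷ r) {g} gen ps = begin
        φ (termMul a m₀ g ++ r *P g) ps              ≈⟨ φ-++ (termMul a m₀ g) (r *P g) ps ps₁ ps₂ ⟩
        φ (termMul a m₀ g) ps₁ + φ (r *P g) ps₂      ≈⟨ +-cong (φ-termMul-Gen a m₀ gen ps₁) (φ-*P-Gen r gen ps₂) ⟩
        0# + 0#                                      ≈⟨ +-identityˡ 0# ⟩
        0#                                           ∎
        where
        ps₁ = All.++⁻ˡ (termMul a m₀ g) ps
        ps₂ = All.++⁻ʳ (termMul a m₀ g) ps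

      φ-combination : ∀ rs → All (λ rg → InR W (proj₁ rg) × Gen W (proj₂ rg)) rs → ∀ ps → φ (combination rs) ps ≈ 0#
      φ-combination []             []              []  = refl
      φ-combination ((r , g) ∷ rs) ((_ , gen) ∷ rgs) ps = begin
        φ (r *P g ++ combination rs) ps                 ≈⟨ φ-++ (r *P g) (combination rs) ps ps₁ ps₂ ⟩
        φ (r *P g) ps₁ + φ (combination rs) ps₂         ≈⟨ +-cong (φ-*P-Gen r gen ps₁) (φ-combination rs rgs ps₂) ⟩
        0# + 0#                                         ≈⟨ +-identityˡ 0# ⟩
        0#                                              ∎
        where
        ps₁ = All.++⁻ˡ (r *P g) ps
        ps₂ = All.++⁻ʳ (r *P g) ps

    φ-InK : ∀ p ps → InK W p → φ p ps ≈ 0#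
    φ-InK p ps (rs , rgs , p≈rs) =
      trans (φ-resp p (combination rs) ps (InR-combination rgs) p≈rs) (φ-combination rs rgs (InR-combination rgs))

module HilbertBasis {c ℓ : Level} (F : Field c ℓ) {d : ℕ} (G : Graph d) (k : ℕ) (W : Subset d)
                  (n : Subset d → ℕ) (kc : ∀ W′ → KcIs G W′ k (n W′)) where

  open import Level using (Level)
  open import Function using (_∘_)
  open import Data.Nat as ℕ using (ℕ; zero; suc)
  open import Data.Bool using (Bool; false)
  open import Data.Maybe using (Maybe; just; nothing)
  open import Data.Fin as Fin using (Fin)
  open import Data.Fin.Subset using (Subset; _∈_)
  open import Data.Fin.Subset.Properties using (x∈p∩q⁺)
  open import Data.List as List using (List; []; _∷_; _++_; length; tabulate)
  import Data.List.Properties as List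
  open import Data.List.Relation.Unary.All as All using (All; []; _∷_)
  import Data.List.Relation.Unary.All.Properties as All
  open import Data.List.Relation.Binary.Pointwise using ([]; _∷_)
  open import Data.Product using (_,_; proj₁)
  open import Relation.Nullary using (¬_; yes; no; does; contradiction)
  import Relation.Binary.PropositionalEquality as ≡
  open ≡ using (_≡_; _≢_)
  import Relation.Binary.Reasoning.Setoid as SetoidReasoning
  open Multisets
  open Colorings
  open Families

  open Field F
  open PolyRing F G using (Poly; coeff; _≈P_; _+P_; -P_; _-P_; _·P_; monomial; sumP; InR; Homog; InK; lincomb; HilbertIs)
  open Polynomials F G
  open KempeBasis G k W n kc
  open KempeCongruence F G {W}
  open SetoidReasoning setoid
  open import Algebra.Properties.CommutativeSemigroup +-commutativeSemigroup using (interchange)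

  private
    isClass : Fin N → Maybe (Fin N) → Bool
    isClass i nothing  = false
    isClass i (just j) = does (j Fin.≟ i)

  module Φ (i : Fin N) = TermwiseFunctional F G W (λ m s → isClass i (classify m s))
                                             (λ s s′ e → ≡.cong (isClass i) (classify-∼ s s′ e))

  φ : Fin N → ∀ p → InR W p → Carrier
  φ = Φ.φ

  basis : Fin N → Poly
  basis i = monomial (basisMonomial i)

  InR-lincomb-basis : ∀ x → InR W (lincomb x basis)
  InR-lincomb-basis x = ≡.subst (InR W) (≡.sym (lincomb-tabulate x basis))
    (InR-sumP-tabulate _ λ j → InR-scale (x j) (InR-monomial (basisMonomial-stable j)))

  φ-lincomb-basis : ∀ i x ps → φ i (lincomb x basis) ps ≈ x i
  φ-lincomb-basis i x ps = begin
    φ i (lincomb x basis) ps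
      ≈⟨ Φ.φ-resp i _ terms ps terms∈R (λ m → reflexive (≡.cong (λ p → coeff p m) (lincomb-tabulate x basis))) ⟩
    φ i terms terms∈R
      ≈⟨ Φ.φ-sumP-tabulate i (λ j → x j * 1#) basisMonomial basisMonomial-stable terms∈R ⟩
    sum (λ j → [ isClass i (classify (basisMonomial j) (basisMonomial-stable j)) ]· (x j * 1#))
      ≈⟨ sum-cong-≋ (λ j → reflexive (≡.cong (λ c → [ isClass i c ]· (x j * 1#)) (classify-basis j _))) ⟩
    sum (λ j → [ does (j Fin.≟ i) ]· (x j * 1#))
      ≈⟨ sum-δˡ (λ j → x j * 1#) i ⟩
    x i * 1#
      ≈⟨ *-identityʳ (x i) ⟩
    x i ∎
    where
    terms = sumP (tabulate λ j → (x j * 1# , basisMonomial j) ∷ [])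
    terms∈R = InR-sumP-tabulate _ λ j → InR-scale (x j) (InR-monomial (basisMonomial-stable j))

  independent : ∀ x → InK W (lincomb x basis) → ∀ i → x i ≈ 0#
  independent x x∈K i = begin
    x i                                      ≈⟨ φ-lincomb-basis i x (InR-lincomb-basis x) ⟨
    φ i (lincomb x basis) (InR-lincomb-basis x) ≈⟨ Φ.φ-InK i (λ rest f g s s′ → ≡.cong (isClass i) (classify-jgen rest f g s s′))
                                               (λ rest S T S∩T≢∅ s → ≡.cong (isClass i) (classify-mgen rest S T S∩T≢∅ s))
                                               (lincomb x basis) _ x∈K ⟩
    0# ∎


  InK-overlap : ∀ {k′} m → All (Stable G W) m → length m ≡ k′ →
                ∀ {u} {ℓ ℓ′ : Fin k′} → u ∈ family m ℓ → u ∈ family m ℓ′ → ℓ ≢ ℓ′ → InK W (monomial m)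
  InK-overlap {suc zero}    m s l {ℓ = Fin.zero} {Fin.zero} _ _ ℓ≢ℓ′ = contradiction ≡.refl ℓ≢ℓ′
  InK-overlap {suc (suc k′)} m s l {u} {ℓ} {ℓ′} q q′ ℓ≢ℓ′ =
    InK-mgen rest (M ℓ) (M ℓ′) (M-stable ℓ) (M-stable ℓ′) (u , x∈p∩q⁺ (q , q′)) rest-stable
      (∼-trans (≡⇒∼ (≡.sym (tabulate-family m l))) (tabulate-∼-others ℓ≢ℓ′ M))
    where
    M = family m
    M-stable = family-All s ∅-stable
    rest = tabulate (M ∘ others ℓ≢ℓ′)
    rest-stable : All (Stable G W) rest
    rest-stable = All.tabulate⁺ (M-stable ∘ others ℓ≢ℓ′)

  classify-nothing⇒InK : ∀ m s → length m ≡ k → classify m s ≡ nothing → InK W (monomial m)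
  classify-nothing⇒InK m s l = go (length m ℕ.≟ k) (disjoint? (family {k = k} m))
    where
    go : ∀ L D → classifyBy m s L D ≡ nothing → InK W (monomial m)
    go (no l≢k) _        _ = contradiction l l≢k
    go (yes _)  (no ¬dj) _ = let u , ℓ , ℓ′ , q , q′ , ℓ≢ℓ′ = ¬Disjoint⇒overlap (family m) ¬dj in InK-overlap m s l q q′ ℓ≢ℓ′

  classify-just⇒Congruent : ∀ m s {j} → classify m s ≡ just j → Congruent {W} m (basisMonomial j)
  classify-just⇒Congruent m s = go (length m ℕ.≟ k) (disjoint? M)
    where
    M = family {k = k} m
    go : ∀ L D {j} → classifyBy m s L D ≡ just j → Congruent {W} m (basisMonomial j)
    go (yes l) (yes dj) ≡.refl = Congruent-trans {W} {m} {colorMonomial (proj₁ col)} {basisMonomial (code M st)} (∼⇒Congruent (≡⇒∼ m≡col))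
      (≡.subst (Congruent {W} (colorMonomial (proj₁ col))) (≡.sym (basisMonomial-index (union M) (union⊆W M st) _))
        (Kempe⇒Congruent (union⊆W M st) (classOf-spec (union M) col)))
      where
      st = family-stable s
      col = colorFamily M (union-covers M) st
      m≡col : m ≡ colorMonomial (proj₁ col)
      m≡col = ≡.trans (≡.sym (tabulate-family m l))
              (≡.sym (List.tabulate-cong (preimage-colorBy M (union-covers M) dj (λ ℓ → ∈-union⁺ M ℓ))))

  private
    single≈scale : ∀ a m → ((a , m) ∷ []) ≈P (a ·P monomial m)
    single≈scale a m = termwise⇒≈P {(a , m) ∷ []} {(a * 1# , m) ∷ []} ((sym (*-identityʳ a) , ∼-refl) ∷ [])

  term-spans : ∀ a m s → length m ≡ k → InK W (((a , m) ∷ []) -P lincomb (λ i → [ isClass i (classify m s) ]· a) basis)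
  term-spans a m s l with classify m s in eq
  ... | nothing = InK-resp (((a , m) ∷ []) -P lincomb (λ _ → 0#) basis) (a ·P monomial m) (λ M′ → begin
    coeff (((a , m) ∷ []) -P lincomb (λ _ → 0#) basis) M′       ≈⟨ coeff-sub ((a , m) ∷ []) (lincomb (λ _ → 0#) basis) M′ ⟩
    coeff ((a , m) ∷ []) M′ - coeff (lincomb (λ _ → 0#) basis) M′ ≈⟨ +-congˡ (-‿cong (coeff-lincomb-0 (λ _ → 0#) basis (λ _ → refl) M′)) ⟩
    coeff ((a , m) ∷ []) M′ - 0#                                ≈⟨ +-congˡ -0#≈0# ⟩
    coeff ((a , m) ∷ []) M′ + 0#                                ≈⟨ +-identityʳ _ ⟩
    coeff ((a , m) ∷ []) M′                                     ≈⟨ single≈scale a m M′ ⟩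
    coeff (a ·P monomial m) M′                                  ∎)
    (InK-scale a (monomial m) (classify-nothing⇒InK m s l eq))
  ... | just j = InK-resp (((a , m) ∷ []) -P lincomb (λ i → [ does (j Fin.≟ i) ]· a) basis)
                           (a ·P binomial m (basisMonomial j)) (λ M′ → begin
    coeff (((a , m) ∷ []) -P lincomb (λ i → [ does (j Fin.≟ i) ]· a) basis) M′
      ≈⟨ coeff-sub ((a , m) ∷ []) (lincomb (λ i → [ does (j Fin.≟ i) ]· a) basis) M′ ⟩
    coeff ((a , m) ∷ []) M′ - coeff (lincomb (λ i → [ does (j Fin.≟ i) ]· a) basis) M′
      ≈⟨ +-cong (trans (single≈scale a m M′) (coeff-scale a (monomial m) M′)) (-‿cong (coeff-lincomb-δ a basis j M′)) ⟩
    a * coeff (monomial m) M′ - a * coeff (basis j) M′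
      ≈⟨ x[y-z]≈xy-xz a (coeff (monomial m) M′) (coeff (basis j) M′) ⟨
    a * (coeff (monomial m) M′ - coeff (basis j) M′)
      ≈⟨ *-congˡ (coeff-binomial m (basisMonomial j) M′) ⟨
    a * coeff (binomial m (basisMonomial j)) M′
      ≈⟨ coeff-scale a (binomial m (basisMonomial j)) M′ ⟨
    coeff (a ·P binomial m (basisMonomial j)) M′ ∎)
    (InK-scale a (binomial m (basisMonomial j)) (classify-just⇒Congruent m s eq))

  spans : ∀ p ps → Homog k p → InK W (p -P lincomb (λ i → φ i p ps) basis)
  spans []            []       []       = InK-zero ([] -P lincomb (λ _ → 0#) basis) λ M′ → begin
    coeff ([] -P lincomb (λ _ → 0#) basis) M′       ≈⟨ coeff-sub [] (lincomb (λ _ → 0#) basis) M′ ⟩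
    0# - coeff (lincomb (λ _ → 0#) basis) M′        ≈⟨ +-congˡ (-‿cong (coeff-lincomb-0 (λ _ → 0#) basis (λ _ → refl) M′)) ⟩
    0# - 0#                                         ≈⟨ -‿inverseʳ 0# ⟩
    0#                                              ∎
  spans ((a , m) ∷ p) (s ∷ ps) (l ∷ hk) =
    InK-resp (((a , m) ∷ p) -P lincomb (λ i → x i + y i) basis) (T +P R) split (InK-+ T R (term-spans a m s l) (spans p ps hk))
    where
    x = λ i → [ isClass i (classify m s) ]· a
    y = λ i → φ i p ps
    T = ((a , m) ∷ []) -P lincomb x basis
    R = p -P lincomb y basis
    split : (((a , m) ∷ p) -P lincomb (λ i → x i + y i) basis) ≈P (T +P R)
    split M′ = begin
      coeff ((a , m) ∷ p -P lincomb (λ i → x i + y i) basis) M′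
        ≈⟨ coeff-sub ((a , m) ∷ p) (lincomb (λ i → x i + y i) basis) M′ ⟩
      coeff ((a , m) ∷ [] ++ p) M′ - coeff (lincomb (λ i → x i + y i) basis) M′
        ≈⟨ +-cong (coeff-++ ((a , m) ∷ []) p M′) (-‿cong (coeff-lincomb-+ x y basis M′)) ⟩
      (coeff ((a , m) ∷ []) M′ + coeff p M′) - (coeff (lincomb x basis) M′ + coeff (lincomb y basis) M′)
        ≈⟨ +-congˡ (-‿+-comm (coeff (lincomb x basis) M′) (coeff (lincomb y basis) M′)) ⟨
      (coeff ((a , m) ∷ []) M′ + coeff p M′) + (- coeff (lincomb x basis) M′ + - coeff (lincomb y basis) M′)
        ≈⟨ interchange (coeff ((a , m) ∷ []) M′) (coeff p M′) (- coeff (lincomb x basis) M′) (- coeff (lincomb y basis) M′) ⟩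
      (coeff ((a , m) ∷ []) M′ - coeff (lincomb x basis) M′) + (coeff p M′ - coeff (lincomb y basis) M′)
        ≈⟨ +-cong (coeff-sub ((a , m) ∷ []) (lincomb x basis) M′) (coeff-sub p (lincomb y basis) M′) ⟨
      coeff T M′ + coeff R M′
        ≈⟨ coeff-++ T R M′ ⟨
      coeff (T +P R) M′ ∎

  hilbert : HilbertIs W k N
  hilbert = basis , (λ i → InR-monomial (basisMonomial-stable i) , (length-basisMonomial i ∷ [])) , independent ,
            λ p ps hk → (λ i → φ i p ps) , spans p ps hk

module Dimension {c ℓ : Level} (F : Field c ℓ) {d : ℕ} (G : Graph d) (W : Subset d) (k : ℕ) where

  open import Level using (Level; _⊔_)
  open import Function using (_∘_)
  open import Data.Nat as ℕ using (ℕ; _≤_)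
  import Data.Nat.Properties as ℕ
  open import Data.Fin as Fin using (Fin)
  open import Data.Fin.Subset using (Subset)
  open import Data.List as List using (tabulate)
  open import Data.Product using (∃; _×_; _,_; proj₁; proj₂)
  open import Relation.Nullary using (¬_; Dec; yes; no)
  open import Relation.Nullary.Decidable using (decidable-stable; ¬¬-excluded-middle)
  import Relation.Binary.PropositionalEquality as ≡
  open ≡ using (_≡_)
  import Relation.Binary.Reasoning.Setoid as SetoidReasoning
  import Algebra.Properties.Semiring.Sum as SemiringSum
  open Classical

  open Field F
  open PolyRing F G using (Poly; coeff; _≈P_; _-P_; _·P_; sumP; InR; Homog; InK; lincomb; HilbertIs)
  open Polynomials F G
  open LinearAlgebra F
  open SetoidReasoning setoid

  Spans : ∀ {h} → (Fin h → Poly) → Set (c ⊔ ℓ)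
  Spans b = ∀ p → InR W p → Homog k p → ∃ λ a → InK W (p -P lincomb a b)

  Independent : ∀ {N} → (Fin N → Poly) → Set (c ⊔ ℓ)
  Independent b = ∀ a → InK W (lincomb a b) → ∀ i → a i ≈ 0#

  -- a relation among the coordinates of the b′ j is a relation among the b′ j modulo K
  coordinate-relation⇒InK : ∀ {h N} (b : Fin h → Poly) (b′ : Fin N → Poly) (B : Fin N → Fin h → Carrier) →
                            (∀ j → InK W (b′ j -P lincomb (B j) b)) →
                            ∀ x → (∀ i → sum (λ j → B j i * x j) ≈ 0#) → InK W (lincomb x b′)
  coordinate-relation⇒InK b b′ B b′≡B x relation = InK-resp (lincomb x b′) E b′≈E
    (InK-sumP-tabulate _ λ j → InK-scale (x j) (b′ j -P lincomb (B j) b) (b′≡B j))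
    where
    E = sumP (tabulate λ j → x j ·P (b′ j -P lincomb (B j) b))
    b′≈E : lincomb x b′ ≈P E
    b′≈E m = sym (begin
      coeff E m
        ≈⟨ coeff-sumP-tabulate (λ j → x j ·P (b′ j -P lincomb (B j) b)) m ⟩
      sum (λ j → coeff (x j ·P (b′ j -P lincomb (B j) b)) m)
        ≈⟨ sum-cong-≋ (λ j → trans (coeff-scale (x j) (b′ j -P lincomb (B j) b) m)
             (*-congˡ (trans (coeff-sub (b′ j) (lincomb (B j) b) m) (+-congˡ (-‿cong (coeff-lincomb (B j) b m)))))) ⟩
      sum (λ j → x j * (coeff (b′ j) m - sum (λ i → B j i * coeff (b i) m)))
        ≈⟨ sum-cong-≋ (λ j → x[y-z]≈xy-xz (x j) _ _) ⟩
      sum (λ j → x j * coeff (b′ j) m - x j * sum (λ i → B j i * coeff (b i) m))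
        ≈⟨ ∑-distrib-+ (λ j → x j * coeff (b′ j) m) (λ j → - (x j * sum (λ i → B j i * coeff (b i) m))) ⟩
      sum (λ j → x j * coeff (b′ j) m) + sum (λ j → - (x j * sum (λ i → B j i * coeff (b i) m)))
        ≈⟨ +-congˡ (trans (sum-neg (λ j → x j * sum (λ i → B j i * coeff (b i) m)))
                          (trans (-‿cong (bilinear-0 B x (λ i → coeff (b i) m) relation)) -0#≈0#)) ⟩
      sum (λ j → x j * coeff (b′ j) m) + 0#
        ≈⟨ +-identityʳ _ ⟩
      sum (λ j → x j * coeff (b′ j) m)
        ≈⟨ coeff-lincomb x b′ m ⟨
      coeff (lincomb x b′) m ∎)

  independent≤spanning : ∀ {h N} (b : Fin h → Poly) → Spans b → (b′ : Fin N → Poly) →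
                         (∀ j → InR W (b′ j) × Homog k (b′ j)) → Independent b′ → ¬ ¬ (N ≤ h)
  independent≤spanning {h} {N} b spans b′ b′∈R independent = do
    N≤h? ← ¬¬-excluded-middle
    byCases N≤h?
    where
    coordinates : ∀ j → ∃ λ a → InK W (b′ j -P lincomb a b)
    coordinates j = spans (b′ j) (proj₁ (b′∈R j)) (proj₂ (b′∈R j))
    byCases : Dec (N ≤ h) → ¬ ¬ (N ≤ h)
    byCases (yes N≤h) = return N≤h
    byCases (no N≰h)  _ = underdetermined⇒¬¬solution h N (ℕ.≰⇒> N≰h) (λ i j → proj₁ (coordinates j) i) λ (x , (j , xj≉0) , rows) →
      xj≉0 (independent x (coordinate-relation⇒InK b b′ (proj₁ ∘ coordinates) (proj₂ ∘ coordinates) x rows) j)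

  HilbertIs-unique : ∀ {a b} → HilbertIs W k a → HilbertIs W k b → a ≡ b
  HilbertIs-unique {a} {b} (b₁ , b₁∈R , independent₁ , spans₁) (b₂ , b₂∈R , independent₂ , spans₂) =
    decidable-stable (a ℕ.≟ b) do
      a≤b ← independent≤spanning b₂ spans₂ b₁ b₁∈R independent₁
      b≤a ← independent≤spanning b₁ spans₁ b₂ b₂∈R independent₂
      return (ℕ.≤-antisym a≤b b≤a)

module MobiusInversion where

  open import Function using (_∘_)
  open import Data.Nat as ℕ using (ℕ; zero; suc; _∸_; _≡ᵇ_)
  import Data.Nat.Properties as ℕ
  open import Data.Integer as ℤ using (ℤ; +_; -_; _-_; _+_; _*_)
  import Data.Integer.Properties as ℤ
  open import Data.Bool using (Bool; true; false; if_then_else_)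
  import Data.Bool.Properties as Bool
  open import Function.Bundles using (Equivalence)
  open import Data.Fin.Subset using (Subset; inside; outside; ∣_∣; ⊤)
  open import Data.Fin.Subset.Properties using (∣p∣≤n; _⊆?_)
  open import Data.Vec using ([]; _∷_)
  open import Data.List as List using (List; []; _∷_; _++_; map; filter; upTo; applyUpTo)
  import Data.List.Properties as List
  open import Relation.Nullary using (does)
  open import Relation.Binary.PropositionalEquality
  open import Algebra.Properties.CommutativeSemigroup ℤ.+-commutativeSemigroup using (interchange)
  open import Algebra.Properties.AbelianGroup ℤ.+-0-abelianGroup using (//-rightDividesʳ)
  open SubsetSums using (sumSubsets; sumBelow; restrict)

  sign : ℕ → ℤ
  sign e = (- + 1) ℤ.^ e

  sumℤ-++ : ∀ (xs ys : List ℤ) → sumℤ (xs ++ ys) ≡ sumℤ xs + sumℤ ys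
  sumℤ-++ []       ys = sym (ℤ.+-identityˡ _)
  sumℤ-++ (x ∷ xs) ys = trans (cong (λ s → x + s) (sumℤ-++ xs ys)) (sym (ℤ.+-assoc x _ _))

  module _ {A : Set} where

    sumℤ-map-+ : ∀ (f g : A → ℤ) xs → sumℤ (map (λ x → f x + g x) xs) ≡ sumℤ (map f xs) + sumℤ (map g xs)
    sumℤ-map-+ f g []       = refl
    sumℤ-map-+ f g (x ∷ xs) = trans (cong (λ s → f x + g x + s) (sumℤ-map-+ f g xs)) (interchange (f x) (g x) _ _)

    sumℤ-map-cong : ∀ {f g : A → ℤ} → (∀ x → f x ≡ g x) → ∀ xs → sumℤ (map f xs) ≡ sumℤ (map g xs)
    sumℤ-map-cong f≗g xs = cong sumℤ (List.map-cong f≗g xs)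

    sumℤ-map-0 : ∀ (f : A → ℤ) → (∀ x → f x ≡ + 0) → ∀ xs → sumℤ (map f xs) ≡ + 0
    sumℤ-map-0 f f≗0 []       = refl
    sumℤ-map-0 f f≗0 (x ∷ xs) = cong₂ _+_ (f≗0 x) (sumℤ-map-0 f f≗0 xs)

  sumℤ-applyUpTo-0 : ∀ N (t : ℕ → ℤ) → (∀ m → t m ≡ + 0) → sumℤ (applyUpTo t N) ≡ + 0
  sumℤ-applyUpTo-0 zero    t t≗0 = refl
  sumℤ-applyUpTo-0 (suc N) t t≗0 = cong₂ _+_ (t≗0 0) (sumℤ-applyUpTo-0 N (t ∘ suc) (t≗0 ∘ suc))

  sumℤ-applyUpTo-δ : ∀ N j x (t : ℕ → ℤ) → (∀ m → t m ≡ (if does (j ℕ.≟ m) then x else + 0)) → j ℕ.< N →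
                     sumℤ (applyUpTo t N) ≡ x
  sumℤ-applyUpTo-δ (suc N) zero    x t t≗δ _ =
    trans (cong₂ _+_ (t≗δ 0) (sumℤ-applyUpTo-0 N (t ∘ suc) (t≗δ ∘ suc))) (ℤ.+-identityʳ x)
  sumℤ-applyUpTo-δ (suc N) (suc j) x t t≗δ (ℕ.s≤s j<N) =
    trans (cong₂ _+_ (t≗δ 0) (sumℤ-applyUpTo-δ N j x (t ∘ suc) (t≗δ ∘ suc) j<N)) (ℤ.+-identityˡ x)

  signedSum : ∀ d → (Subset d → ℤ) → ℤ
  signedSum d g = sumℤ (map (λ W → sign (d ∸ ∣ W ∣) * g W) (allSubsets d))

  altSum-regroup : ∀ d (h : Subset d → ℕ) (L : List (Subset d)) →
                   sumℤ (map (λ m → sign (d ∸ m) * + sumℕ (map h (filter (λ W → ∣ W ∣ ℕ.≟ m) L))) (upTo (suc d)))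
                   ≡ sumℤ (map (λ W → sign (d ∸ ∣ W ∣) * + h W) L)
  altSum-regroup d h []      = sumℤ-map-0 _ (λ m → ℤ.*-zeroʳ (sign (d ∸ m))) (upTo (suc d))
  altSum-regroup d h (W ∷ L) = begin
    sumℤ (map (λ m → sign (d ∸ m) * + sumℕ (map h (filter (λ W → ∣ W ∣ ℕ.≟ m) (W ∷ L)))) (upTo (suc d)))
      ≡⟨ sumℤ-map-cong split (upTo (suc d)) ⟩
    sumℤ (map (λ m → atW m + others m) (upTo (suc d)))
      ≡⟨ sumℤ-map-+ atW others (upTo (suc d)) ⟩
    sumℤ (map atW (upTo (suc d))) + sumℤ (map others (upTo (suc d)))
      ≡⟨ cong₂ _+_ (trans (cong sumℤ (List.map-applyUpTo (λ m → m) atW (suc d)))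
                          (sumℤ-applyUpTo-δ (suc d) ∣ W ∣ _ atW (λ _ → refl) (ℕ.s≤s (∣p∣≤n W))))
                   (altSum-regroup d h L) ⟩
    sign (d ∸ ∣ W ∣) * + h W + sumℤ (map (λ W → sign (d ∸ ∣ W ∣) * + h W) L)
      ∎
    where
    open ≡-Reasoning
    atW : ℕ → ℤ
    atW m = if does (∣ W ∣ ℕ.≟ m) then sign (d ∸ ∣ W ∣) * + h W else + 0
    others : ℕ → ℤ
    others m = sign (d ∸ m) * + sumℕ (map h (filter (λ W → ∣ W ∣ ℕ.≟ m) L))
    split : ∀ m → sign (d ∸ m) * + sumℕ (map h (filter (λ W → ∣ W ∣ ℕ.≟ m) (W ∷ L))) ≡ atW m + others m
    split m with ∣ W ∣ ≡ᵇ m in eq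
    ... | true rewrite sym (ℕ.≡ᵇ⇒≡ ∣ W ∣ m (Equivalence.from Bool.T-≡ eq)) = trans (cong (sign (d ∸ ∣ W ∣) *_) (ℤ.pos-+ (h W) _)) (ℤ.*-distribˡ-+ (sign (d ∸ ∣ W ∣)) (+ h W) _)
    ... | false = sym (ℤ.+-identityˡ _)

  altSum≡signedSum : ∀ d (h : Subset d → ℕ) → altSum d h ≡ signedSum d (+_ ∘ h)
  altSum≡signedSum d h = altSum-regroup d h (allSubsets d)

  signedSum-cong : ∀ d {g g′ : Subset d → ℤ} → (∀ W → g W ≡ g′ W) → signedSum d g ≡ signedSum d g′
  signedSum-cong d g≗g′ = sumℤ-map-cong (λ W → cong (sign (d ∸ ∣ W ∣) *_) (g≗g′ W)) (allSubsets d)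

  sign-suc : ∀ d (W : Subset d) → sign (suc d ∸ ∣ W ∣) ≡ - sign (d ∸ ∣ W ∣)
  sign-suc d W = trans (cong sign (ℕ.+-∸-assoc 1 (∣p∣≤n W))) (ℤ.-1*i≡-i _)

  signedSum-suc : ∀ d (g : Subset (suc d) → ℤ) → signedSum (suc d) g ≡ signedSum d (λ W → g (inside ∷ W) - g (outside ∷ W))
  signedSum-suc d g = begin
    signedSum (suc d) g
      ≡⟨ cong sumℤ (List.map-++ t (map (inside ∷_) Ws) (map (outside ∷_) Ws)) ⟩
    sumℤ (map t (map (inside ∷_) Ws) ++ map t (map (outside ∷_) Ws))
      ≡⟨ sumℤ-++ (map t (map (inside ∷_) Ws)) _ ⟩
    sumℤ (map t (map (inside ∷_) Ws)) + sumℤ (map t (map (outside ∷_) Ws))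
      ≡⟨ cong₂ _+_ (cong sumℤ (sym (List.map-∘ Ws))) (cong sumℤ (sym (List.map-∘ Ws))) ⟩
    sumℤ (map (λ W → s W * g (inside ∷ W)) Ws) + sumℤ (map (λ W → sign (suc d ∸ ∣ W ∣) * g (outside ∷ W)) Ws)
      ≡⟨ cong (λ x → sumℤ (map (λ W → s W * g (inside ∷ W)) Ws) + x) (begin
           sumℤ (map (λ W → sign (suc d ∸ ∣ W ∣) * g (outside ∷ W)) Ws)
             ≡⟨ sumℤ-map-cong (λ W → trans (cong (_* g (outside ∷ W)) (sign-suc d W))
                                          (trans (sym (ℤ.neg-distribˡ-* (s W) _)) (ℤ.neg-distribʳ-* (s W) _))) Ws ⟩
           sumℤ (map (λ W → s W * - g (outside ∷ W)) Ws) ∎) ⟩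
    sumℤ (map (λ W → s W * g (inside ∷ W)) Ws) + sumℤ (map (λ W → s W * - g (outside ∷ W)) Ws)
      ≡⟨ sumℤ-map-+ (λ W → s W * g (inside ∷ W)) (λ W → s W * - g (outside ∷ W)) Ws ⟨
    sumℤ (map (λ W → s W * g (inside ∷ W) + s W * - g (outside ∷ W)) Ws)
      ≡⟨ sumℤ-map-cong (λ W → sym (ℤ.*-distribˡ-+ (s W) (g (inside ∷ W)) (- g (outside ∷ W)))) Ws ⟩
    signedSum d (λ W → g (inside ∷ W) - g (outside ∷ W))
      ∎
    where
    open ≡-Reasoning
    Ws = allSubsets d
    s : Subset d → ℤ
    s W = sign (d ∸ ∣ W ∣)
    t : Subset (suc d) → ℤ
    t W = sign (suc d ∸ ∣ W ∣) * g W

  private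
    sumSubsets-0 : ∀ d → sumSubsets d (λ _ → 0) ≡ 0
    sumSubsets-0 zero    = refl
    sumSubsets-0 (suc d) = cong₂ ℕ._+_ (sumSubsets-0 d) (sumSubsets-0 d)

  -- the subsets of inside ∷ W that are not subsets of outside ∷ W are those containing the new vertex
  sumBelow-inside-outside : ∀ d (n : Subset (suc d) → ℕ) (W : Subset d) →
                            + sumBelow n (inside ∷ W) - + sumBelow n (outside ∷ W) ≡ + sumBelow (n ∘ (inside ∷_)) W
  sumBelow-inside-outside d n W = begin
    + (a ℕ.+ r) - + (sumSubsets d (λ _ → 0) ℕ.+ r)   ≡⟨ cong (λ z → + (a ℕ.+ r) - + (z ℕ.+ r)) (sumSubsets-0 d) ⟩
    + (a ℕ.+ r) - + r                                ≡⟨ cong (_- + r) (ℤ.pos-+ a r) ⟩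
    + a + + r - + r                                  ≡⟨ //-rightDividesʳ (+ r) (+ a) ⟩
    + a                                              ∎
    where
    open ≡-Reasoning
    a = sumBelow (n ∘ (inside ∷_)) W
    r = sumSubsets d (λ W′ → restrict (W′ ⊆? W) (n (outside ∷ W′)))

  signedSum-sumBelow : ∀ d (n : Subset d → ℕ) → signedSum d (+_ ∘ sumBelow n) ≡ + n ⊤
  signedSum-sumBelow zero    n = trans (ℤ.+-identityʳ _) (ℤ.*-identityˡ _)
  signedSum-sumBelow (suc d) n = begin
    signedSum (suc d) (+_ ∘ sumBelow n)                                         ≡⟨ signedSum-suc d (+_ ∘ sumBelow n) ⟩
    signedSum d (λ W → + sumBelow n (inside ∷ W) - + sumBelow n (outside ∷ W))  ≡⟨ signedSum-cong d (sumBelow-inside-outside d n) ⟩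
    signedSum d (+_ ∘ sumBelow (n ∘ (inside ∷_)))                               ≡⟨ signedSum-sumBelow d (n ∘ (inside ∷_)) ⟩
    + n ⊤                                                                       ∎
    where open ≡-Reasoning

  altSum-sumBelow : ∀ d (n : Subset d → ℕ) → altSum d (sumBelow n) ≡ + n ⊤
  altSum-sumBelow d n = trans (altSum≡signedSum d (sumBelow n)) (signedSum-sumBelow d n)

  altSum-cong : ∀ d {h h′ : Subset d → ℕ} → (∀ W → h W ≡ h′ W) → altSum d h ≡ altSum d h′
  altSum-cong d h≗h′ = sumℤ-map-cong (λ m → cong (λ z → sign (d ∸ m) * + z) (cong sumℕ (List.map-cong h≗h′ (subsetsOfSize d m))))
                                     (upTo (suc d))

module KempeCount where

  open import Function using (_∘_)
  open import Data.Nat as ℕ using (ℕ; zero; suc)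
  import Data.Nat.Properties as ℕ
  open import Data.Fin as Fin using (Fin)
  import Data.Fin.Properties as Fin
  open import Data.Fin.Subset using (Subset; _∈_; inside; outside)
  open import Data.Fin.Subset.Properties using (drop-there)
  open import Data.Vec as Vec using ([]; _∷_)
  open import Data.List as List using (List; []; _∷_; map; cartesianProductWith)
  open import Data.List.Relation.Unary.Any using (here; there)
  import Data.List.Membership.Propositional as List
  open import Data.List.Membership.Propositional.Properties using (∈-map⁺; ∈-allFin; ∈-cartesianProductWith⁺)
  open import Data.Product using (Σ; ∃; _×_; _,_; proj₁; proj₂)
  open import Relation.Nullary using (¬_)
  open import Relation.Binary using (IsEquivalence)
  open import Relation.Binary.PropositionalEquality
  open Classical
  open Colorings

  module _ {d k : ℕ} where

    extendInside : ∀ {W : Subset d} → Fin k → ColMap W k → ColMap (inside ∷ W) k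
    extendInside x g Fin.zero    _ = x
    extendInside x g (Fin.suc u) p = g u (drop-there p)

    extendOutside : ∀ {W : Subset d} → ColMap W k → ColMap (outside ∷ W) k
    extendOutside g (Fin.suc u) p = g u (drop-there p)

  allColMaps : ∀ {d} k (W : Subset d) → List (ColMap W k)
  allColMaps k []            = (λ _ ()) ∷ []
  allColMaps k (inside ∷ W)  = cartesianProductWith extendInside (List.allFin k) (allColMaps k W)
  allColMaps k (outside ∷ W) = map extendOutside (allColMaps k W)

  allColMaps-complete : ∀ {d} k (W : Subset d) (f : ColMap W k) → ∃ λ g → g List.∈ allColMaps k W × (∀ u p → f u p ≡ g u p)
  allColMaps-complete k []            f = _ , here refl , λ _ ()
  allColMaps-complete k (inside ∷ W)  f =
    let g , g∈ , f≗g = allColMaps-complete k W (λ u p → f (Fin.suc u) (Vec.there p))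
    in extendInside (f Fin.zero Vec.here) g , ∈-cartesianProductWith⁺ extendInside (∈-allFin _) g∈ , λ
      { Fin.zero    p → cong (f Fin.zero) (∈-irrelevant p Vec.here)
      ; (Fin.suc u) p → trans (cong (f (Fin.suc u)) (∈-irrelevant p (Vec.there (drop-there p)))) (f≗g u (drop-there p)) }
  allColMaps-complete k (outside ∷ W) f =
    let g , g∈ , f≗g = allColMaps-complete k W (λ u p → f (Fin.suc u) (Vec.there p))
    in extendOutside g , ∈-map⁺ extendOutside g∈ , λ
      { (Fin.suc u) p → trans (cong (f (Fin.suc u)) (∈-irrelevant p (Vec.there (drop-there p)))) (f≗g u (drop-there p)) }

  module _ {d : ℕ} (G : Graph d) (W : Subset d) (k : ℕ) where

    private
      Kempe-isEquivalence : IsEquivalence (KempeEq G W k)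
      Kempe-isEquivalence = record { refl = Kempe-refl ; sym = Kempe-sym ; trans = Kempe-trans }

    ¬¬-Kc : ¬ ¬ Σ ℕ (KcIs G W k)
    ¬¬-Kc = do
      (L , selected) ← ¬¬-select {P = Proper G W k} (allColMaps k W)
      (n , rep , rep-injective , covers) ← ¬¬-representatives Kempe-isEquivalence L
      return (n , rep , rep-injective , λ (f , proper) →
        let g , g∈ , f≗g = allColMaps-complete k W f
            g-proper , g∈L = selected g∈ λ u v pu pv adj eq → proper u v pu pv adj (trans (f≗g u pu) (trans eq (sym (f≗g v pv))))
            i , g~rep = covers g∈L
        in i , Kempe-trans (pointwise⇒Kempe (f , proper) (g , g-proper) f≗g) g~rep)

    KcIs-unique : ∀ {a b} → KcIs G W k a → KcIs G W k b → a ≡ b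
    KcIs-unique (rep , rep-injective , covers) (rep′ , rep′-injective , covers′) = ℕ.≤-antisym
      (inequivalent⇒≤ Kempe-isEquivalence rep rep′ rep-injective (covers′ ∘ rep))
      (inequivalent⇒≤ Kempe-isEquivalence rep′ rep rep′-injective (covers ∘ rep′))

open import Data.Integer using (+_)
open import Data.List using (map)
open import Data.Fin.Subset using (⊤)
open import Data.Product using (_×_; _,_; proj₁; proj₂)
open import Relation.Binary.PropositionalEquality using (cong; subst; module ≡-Reasoning)
open import Function using (_∘_)
import Data.Integer.Properties as ℤ
open import Relation.Nullary.Decidable using (decidable-stable)
open Classical
open SubsetSums
open MobiusInversion
open KempeCount

corollary6p9 : ∀ {c ℓ} (F : Field c ℓ) (d : ℕ) (G : Graph d) (k : ℕ) →
    ((n : Subset d → ℕ) → (∀ W → KcIs G W k (n W)) →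
      PolyRing.HilbertIs F G ⊤ k (sumℕ (map n (allSubsets d))))
    × ((h : Subset d → ℕ) → (∀ W → PolyRing.HilbertIs F G W k (h W)) →
      (kc : ℕ) → KcIs G ⊤ k kc → + kc ≡ altSum d h)
corollary6p9 F d G k = hilbertFunction , kempeCount
  where
  hilbertFunction : (n : Subset d → ℕ) → (∀ W → KcIs G W k (n W)) → PolyRing.HilbertIs F G ⊤ k (sumℕ (map n (allSubsets d)))
  hilbertFunction n kcs = subst (PolyRing.HilbertIs F G ⊤ k) (sumBelow-⊤ n) (HilbertBasis.hilbert F G k ⊤ n kcs)

  kempeCount : (h : Subset d → ℕ) → (∀ W → PolyRing.HilbertIs F G W k (h W)) → (kc : ℕ) → KcIs G ⊤ k kc → + kc ≡ altSum d h
  kempeCount h hilbertIs kc kcIs = decidable-stable (+ kc ℤ.≟ altSum d h) do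
    counts ← ¬¬-Π-Subset d (λ W → ¬¬-Kc G W k)
    let n = proj₁ ∘ counts
    return (begin
      + kc                       ≡⟨ cong +_ (KcIs-unique G ⊤ k kcIs (proj₂ (counts ⊤))) ⟩
      + n ⊤                      ≡⟨ altSum-sumBelow d n ⟨
      altSum d (sumBelow n)      ≡⟨ altSum-cong d (λ W → Dimension.HilbertIs-unique F G W k
                                      (HilbertBasis.hilbert F G k W n (proj₂ ∘ counts)) (hilbertIs W)) ⟩
      altSum d h                 ∎)
    where open ≡-Reasoning
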